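{- Let $P$ be an $R$-labeled poset of rank $n$ with fixed $R$-labeling $\lambda$. Then \[ {\text{ex}}\Psi(P;y,\mathbf{a},\mathbf{b}) = \sum_{(\mathcal{M},E)} y^{\#E}\cdot \mathsf{u}(\mathcal{M},E), \] where the sum ranges over all maximal chains $\mathcal{M}$ in $P$ and all subsets $E\subseteq\{1,\dots,n\}$.
   Context: A graded poset $P$ of rank $n$ is a finite poset with unique minimum $\hat 0$ (rank $0$) and unique maximum $\hat 1$ (rank $n$) such that ${\sf rank}(X)$ equals the length of every maximal chain from $\hat 0$ to $X$. A chain is a (possibly empty) totally ordered subset; for a chain $\mathcal{C}=\{\mathcal{C}_1<\dots<\mathcal{C}_k\}$ put ${\sf Rank}(\mathcal{C})=\{{\sf rank}(\mathcal{C}_i)\}$. For a graded poset $Q$ with minimum $\hat 0_Q$ and Möbius function $\mu$, its Poincaré polynomial is $\mathrm{Poin}(Q;y)=\sum_{X\in Q}|\mu(\hat 0_Q,X)|\,y^{{\sf rank}_Q(X)}$ (applied to intervals $[X,Y]$ with rank measured from $X$). The chain Poincaré polynomial of a chain $\mathcal{C}$ in $P$ is $\mathrm{Poin}_{\mathcal{C}}(P;y)=\prod_{i=1}^k\mathrm{Poin}([\mathcal{C}_i,\mathcal{C}_{i+1}];y)$ with $\mathcal{C}_{k+1}=\hat 1$ (empty product $=1$). The extended $\mathbf{a}\mathbf{b}$-index is ${\text{ex}}\Psi(P;y,\mathbf{a},\mathbf{b})=\sum_{\mathcal{C}}\mathrm{Poin}_{\mathcal{C}}(P;y)\,{\sf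 wt}_{\mathcal{C}}(\mathbf{a},\mathbf{b})\in\mathbb{Z}[y]\langle\mathbf{a},\mathbf{b}\rangle$, the sum over all chains $\mathcal{C}$ in $P\setminus\{\hat 1\}$, where $\mathbf{a},\mathbf{b}$ are noncommuting variables and ${\sf wt}_{\mathcal{C}}=w_0\cdots w_{n-1}$ with $w_i=\mathbf{b}$ if $i\in{\sf Rank}(\mathcal{C})$ and $w_i=\mathbf{a}-\mathbf{b}$ otherwise. An $R$-labeling of $P$ is a map $\lambda$ from cover relations $X\lessdot Y$ to positive integers such that every interval $[X,Y]$ has a unique maximal chain $X=\mathcal{M}_i\lessdot\dots\lessdot\mathcal{M}_j=Y$ with weakly increasing labels; $P$ is $R$-labeled if it is finite, graded and admits one. For a maximal chain $\mathcal{M}=\{\mathcal{M}_0\lessdot\dots\lessdot\mathcal{M}_n\}$, let $\mathsf{u}(\mathcal{M})=u_1\cdots u_n$ with $u_1=\mathbf{a}$ and, for $2\le i\le n$, $u_i=\mathbf{a}$ if $\lambda(\mathcal{M}_{i-2},\mathcal{M}_{i-1})\le\lambda(\mathcal{M}_{i-1},\mathcal{M}_i)$ and $u_i=\mathbf{b}$ otherwise. For $E\subseteq\{1,\dots,n\}$, let $\mathsf{u}(\mathcal{M},E)=v_1\cdots v_n$ where $v_i=\mathbf{a}$ if ($u_i=\mathbf{a}$ and $i\notin E$) or ($u_i=\mathbf{b}$ and $i-1\in E$), and $v_i=\mathbf{b}$ if ($u_i=\mathbf{a}$ and $i\in E$) or ($u_i=\mathbf{b}$ and $i-1\notin E$).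 -}

module Defs where

open import Data.Bool using (Bool; true; false; _∧_; _∨_; not; if_then_else_; T)
open import Data.Nat using (ℕ; zero; suc; _∸_; _≤ᵇ_; _≡ᵇ_; _≤_)
import Data.Nat as ℕ
open import Data.Integer using (ℤ; +_; -_; ∣_∣)
import Data.Integer as ℤ
open import Data.Fin using (Fin; _≟_)
open import Data.List using (List; []; _∷_; _++_; map; concatMap; filterᵇ; allFin; length; foldr; upTo; replicate; zipWith)
open import Data.Bool.ListAction using (all; any)
open import Data.Product using (_×_; _,_; Σ; ∃)
open import Relation.Binary.PropositionalEquality using (_≡_)
open import Relation.Nullary.Decidable using (⌊_⌋)

-- Elements of ℤ[y]⟨a,b⟩, as formal finite sums of terms  c · y^k · w

data Letter : Set where
  𝐚 𝐛 : Letter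

Word : Set
Word = List Letter

Term : Set
Term = ℤ × ℕ × Word

Poly : Set
Poly = List Term

_==ℓ_ : Letter → Letter → Bool
𝐚 ==ℓ 𝐚 = true
𝐛 ==ℓ 𝐛 = true
_ ==ℓ _ = false

_==w_ : Word → Word → Bool
[] ==w [] = true
(x ∷ xs) ==w (y ∷ ys) = (x ==ℓ y) ∧ (xs ==w ys)
_ ==w _ = false

sumℤ : List ℤ → ℤ
sumℤ = foldr ℤ._+_ (+ 0)

coeff : Poly → ℕ → Word → ℤ
coeff p k w = sumℤ (map (λ { (c , e , v) → if (e ≡ᵇ k) ∧ (v ==w w) then c else + 0 }) p)

_≈P_ : Poly → Poly → Set
p ≈P q = ∀ k w → coeff p k w ≡ coeff q k w

infix 4 _≈P_

oneP : Poly
oneP = (+ 1 , 0 , []) ∷ []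

_⊗_ : Poly → Poly → Poly
p ⊗ q = concatMap (λ { (c , e , v) → map (λ { (d , f , u) → (c ℤ.* d , e ℕ.+ f , v ++ u) }) q }) p

prodP : List Poly → Poly
prodP = foldr _⊗_ oneP

sumP : List Poly → Poly
sumP = foldr _++_ []

bP : Poly
bP = (+ 1 , 0 , 𝐛 ∷ []) ∷ []

a-bP : Poly
a-bP = (+ 1 , 0 , 𝐚 ∷ []) ∷ (- (+ 1) , 0 , 𝐛 ∷ []) ∷ []

record FinPoset : Set where
  field
    m          : ℕ
    leq        : Fin m → Fin m → Bool
    reflexive  : ∀ x → T (leq x x)
    antisym    : ∀ x y → T (leq x y) → T (leq y x) → x ≡ y
    transitive : ∀ x y z → T (leq x y) → T (leq y z) → T (leq x z)

module _ (P : FinPoset) where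
  open FinPoset P

  eqᵇ : Fin m → Fin m → Bool
  eqᵇ x y = ⌊ x ≟ y ⌋

  ltᵇ : Fin m → Fin m → Bool
  ltᵇ x y = leq x y ∧ not (eqᵇ x y)

  covᵇ : Fin m → Fin m → Bool
  covᵇ x y = ltᵇ x y ∧ all (λ z → not (ltᵇ x z ∧ ltᵇ z y)) (allFin m)

  -- x = z₀ ⋖ z₁ ⋖ … ⋖ z_k = y, where the list is z₁ … z_k
  -- (a maximal chain of the interval [x,y])
  satChainᵇ : Fin m → Fin m → List (Fin m) → Bool
  satChainᵇ x y []      = eqᵇ x y
  satChainᵇ x y (z ∷ c) = covᵇ x z ∧ satChainᵇ z y c

  strictChainᵇ : List (Fin m) → Bool
  strictChainᵇ []           = true
  strictChainᵇ (x ∷ [])     = true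
  strictChainᵇ (x ∷ y ∷ c)  = ltᵇ x y ∧ strictChainᵇ (y ∷ c)

  -- Möbius function, by the recursion μ(x,x)=1, μ(x,y) = − Σ_{x≤z<y} μ(x,z);
  -- the fuel argument (suc m) exceeds the length of every chain, so is never exhausted
  muFuel : ℕ → Fin m → Fin m → ℤ
  muFuel zero    x y = + 0
  muFuel (suc f) x y =
    if eqᵇ x y then + 1
    else if leq x y then - sumℤ (map (muFuel f x) (filterᵇ (λ z → leq x z ∧ ltᵇ z y) (allFin m)))
    else + 0

  μ : Fin m → Fin m → ℤ
  μ = muFuel (suc m)

listsOfLength : {A : Set} → List A → ℕ → List (List A)
listsOfLength xs zero    = [] ∷ []
listsOfLength xs (suc k) = concatMap (λ x → map (x ∷_) (listsOfLength xs k)) xs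

-- all subsets of {1,…,n}, as characteristic lists e₁ … e_n
subsets : ℕ → List (List Bool)
subsets n = listsOfLength (true ∷ false ∷ []) n

countTrue : List Bool → ℕ
countTrue []          = 0
countTrue (true ∷ e)  = suc (countTrue e)
countTrue (false ∷ e) = countTrue e

record IsGraded (P : FinPoset) (n : ℕ) : Set where
  open FinPoset P
  field
    bot    : Fin m
    top    : Fin m
    botMin : ∀ x → T (leq bot x)
    topMax : ∀ x → T (leq x top)
    rank   : Fin m → ℕ
    graded : ∀ x (c : List (Fin m)) → T (satChainᵇ P bot x c) → length c ≡ rank x
    rankTop : rank top ≡ n

-- R-labelings: labels λ(x,y) of cover relations x ⋖ y (values on
-- non-covers are irrelevant)

labelsAlong : (P : FinPoset) → (Fin (FinPoset.m P) → Fin (FinPoset.m P) → ℕ) →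
              Fin (FinPoset.m P) → List (Fin (FinPoset.m P)) → List ℕ
labelsAlong P lab x []      = []
labelsAlong P lab x (z ∷ c) = lab x z ∷ labelsAlong P lab z c

weaklyIncᵇ : List ℕ → Bool
weaklyIncᵇ []          = true
weaklyIncᵇ (x ∷ [])    = true
weaklyIncᵇ (x ∷ y ∷ l) = (x ≤ᵇ y) ∧ weaklyIncᵇ (y ∷ l)

incChainᵇ : (P : FinPoset) → (Fin (FinPoset.m P) → Fin (FinPoset.m P) → ℕ) →
            Fin (FinPoset.m P) → Fin (FinPoset.m P) → List (Fin (FinPoset.m P)) → Bool
incChainᵇ P lab x y c = satChainᵇ P x y c ∧ weaklyIncᵇ (labelsAlong P lab x c)

record IsRLabeling (P : FinPoset) (lab : Fin (FinPoset.m P) → Fin (FinPoset.m P) → ℕ) : Set where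
  open FinPoset P
  field
    positive : ∀ x y → T (covᵇ P x y) → 1 ≤ lab x y
    unique-inc : ∀ x y → T (leq x y) →
      Σ (List (Fin m)) λ c → T (incChainᵇ P lab x y c) ×
        (∀ c′ → T (incChainᵇ P lab x y c′) → c′ ≡ c)

module _ {n : ℕ} (P : FinPoset) (G : IsGraded P n) where
  open FinPoset P
  open IsGraded G

  poinInterval : Fin m → Fin m → Poly
  poinInterval x y =
    map (λ z → (+ ∣ μ P x z ∣ , rank z ∸ rank x , []))
        (filterᵇ (λ z → leq x z ∧ leq z y) (allFin m))

  poinChain : List (Fin m) → Poly
  poinChain []          = oneP
  poinChain (x ∷ [])    = poinInterval x top
  poinChain (x ∷ y ∷ c) = poinInterval x y ⊗ poinChain (y ∷ c)

  wt : List (Fin m) → Poly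
  wt c = prodP (map (λ i → if any (λ x → rank x ≡ᵇ i) c then bP else a-bP) (upTo n))

  -- chains of P ∖ {1̂}: strictly increasing lists avoiding 1̂
  -- (a chain has at most m elements)
  isChainᵇ : List (Fin m) → Bool
  isChainᵇ c = strictChainᵇ P c ∧ all (λ x → not (eqᵇ P x top)) c

  chains : List (List (Fin m))
  chains = filterᵇ isChainᵇ (concatMap (listsOfLength (allFin m)) (upTo (suc m)))

  exΨ : Poly
  exΨ = sumP (map (λ c → poinChain c ⊗ wt c) chains)

  -- maximal chains 0̂ = M₀ ⋖ M₁ ⋖ … ⋖ M_n = 1̂, represented by M₁ … M_n
  maxChains : List (List (Fin m))
  maxChains = filterᵇ (satChainᵇ P bot top) (listsOfLength (allFin m) n)

  module _ (lab : Fin m → Fin m → ℕ) where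

    uWord : List (Fin m) → Word
    uWord c = 𝐚 ∷ go (labelsAlong P lab bot c)
      where
        go : List ℕ → Word
        go []          = []
        go (_ ∷ [])    = []
        go (l ∷ l′ ∷ r) = (if l ≤ᵇ l′ then 𝐚 else 𝐛) ∷ go (l′ ∷ r)

    vLetter : Letter → Bool → Bool → Letter
    vLetter 𝐚 iE _  = if iE then 𝐛 else 𝐚
    vLetter 𝐛 _ i-1E = if i-1E then 𝐚 else 𝐛

    zip3 : Word → List Bool → List Bool → Word
    zip3 (u ∷ us) (e ∷ es) (e′ ∷ es′) = vLetter u e e′ ∷ zip3 us es es′
    zip3 _ _ _ = []

    -- u(M,E); E is given by e₁ … e_n, and 0 ∉ E
    uME : List (Fin m) → List Bool → Word
    uME c e = zip3 (uWord c) e (false ∷ e)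

    rhs : Poly
    rhs = concatMap (λ c → map (λ e → (+ 1 , countTrue e , uME c e)) (subsets n)) maxChains

-- Group the chains of P ∖ 1̂ by their rank set S, on which wt depends alone.
-- Since every interval has a unique maximal chain with weakly increasing labels, an alternating-sum
-- argument shows (Björner–Wachs) that |μ(x,w)| counts the maximal chains of [x,w] with strictly
-- decreasing labels. Extending such a chain by the increasing chain of [w,z], Poin([x,z]) becomes the
-- sum of y^#E over the maximal chains of [x,z] and the initial segments E of their steps along which
-- the labels strictly decrease and after which they weakly increase: exactly the pairs (M,E) for which
-- u(M,E) is 𝐚 after its first letter. Concatenating intervals, the chains with rank set S contribute the
-- sum of y^#E over the pairs (M,E) whose letters 𝐛 all lie in S. For fixed (M,E), summing the weights
-- over these S gives u(M,E) letter by letter, since 𝐛 + (𝐚 − 𝐛) = 𝐚.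

module Submission where

open import Defs
open import Data.Nat using (ℕ)
open import Data.Fin using (Fin)

open import Data.Bool using (Bool; true; false; _∧_; _∨_; not; if_then_else_; T)
import Data.Bool.Properties as 𝔹P
open import Data.Nat using (zero; suc; _≡ᵇ_; _≤ᵇ_; _<ᵇ_; _≤_; _<_; z≤n; s≤s)
import Data.Nat as ℕ
import Data.Nat.Properties as ℕP
open import Data.Integer using (ℤ; +_; -_; _+_; _-_; _*_; 0ℤ; 1ℤ; ∣_∣) renaming (_≤_ to _ℤ≤_)
import Data.Integer as ℤ
import Data.Integer.Properties as ℤP
open import Data.Integer.Solver using (module +-*-Solver)
open import Data.Fin using (_≟_; toℕ) renaming (zero to fzero; suc to fsuc)
import Data.Fin.Properties as FinP
open import Data.List using (List; []; _∷_; _++_; map; concatMap; filterᵇ; length; tabulate; allFin; take; drop; replicate; applyUpTo; upTo)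
import Data.List.Properties as ListP
open import Data.Bool.ListAction using (any; all)
open import Data.Product using (_×_; _,_; proj₁; proj₂; Σ; ∃₂)
open import Data.Sum using (inj₁; inj₂)
open import Data.Unit using (⊤; tt)
open import Data.Empty using (⊥; ⊥-elim)
open import Relation.Binary.PropositionalEquality
open import Relation.Nullary using (¬_)
open import Relation.Nullary.Decidable using (⌊_⌋; yes; no; isYes≗does; dec-true; dec-false)
open import Function using (_∘_; Equivalence)
open import Relation.Binary.Bundles using (Setoid)
import Relation.Binary.Reasoning.Setoid
open import Algebra.Properties.AbelianGroup ℤP.+-0-abelianGroup using (inverseˡ-unique)
open +-*-Solver using (solve; _:+_; _:*_; :-_; _:=_; con)

T⇒≡true : {b : Bool} → T b → b ≡ true
T⇒≡true = Equivalence.to 𝔹P.T-≡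

≡true⇒T : {b : Bool} → b ≡ true → T b
≡true⇒T = Equivalence.from 𝔹P.T-≡

∧-true₁ : {a b : Bool} → a ∧ b ≡ true → a ≡ true
∧-true₁ = 𝔹P.∧-conicalˡ _ _

∧-true₂ : {a b : Bool} → a ∧ b ≡ true → b ≡ true
∧-true₂ = 𝔹P.∧-conicalʳ _ _

⟦_⟧ : Bool → ℤ
⟦ true ⟧  = 1ℤ
⟦ false ⟧ = 0ℤ

⟦∧⟧ : ∀ a b → ⟦ a ∧ b ⟧ ≡ ⟦ a ⟧ * ⟦ b ⟧
⟦∧⟧ true  true  = refl
⟦∧⟧ true  false = refl
⟦∧⟧ false b     = refl

⟦⟧-nonneg : (b : Bool) → 0ℤ ℤ≤ ⟦ b ⟧
⟦⟧-nonneg true  = ℤ.+≤+ z≤n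
⟦⟧-nonneg false = ℤ.+≤+ z≤n

if-else-0≡⟦⟧* : ∀ (b : Bool) (c : ℤ) → (if b then c else 0ℤ) ≡ ⟦ b ⟧ * c
if-else-0≡⟦⟧* true  c = sym (ℤP.*-identityˡ c)
if-else-0≡⟦⟧* false c = refl

≡ᵇ-< : {a b : ℕ} → a < b → (a ≡ᵇ b) ≡ false
≡ᵇ-< {zero}  {suc b} _         = refl
≡ᵇ-< {suc a} {suc b} (s≤s a<b) = ≡ᵇ-< a<b

≡ᵇ-> : {a b : ℕ} → b < a → (a ≡ᵇ b) ≡ false
≡ᵇ-> {suc a} {zero}  _         = refl
≡ᵇ-> {suc a} {suc b} (s≤s b<a) = ≡ᵇ-> b<a

≡ᵇ⇒≡ : {a b : ℕ} → (a ≡ᵇ b) ≡ true → a ≡ b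
≡ᵇ⇒≡ {a} {b} eq = ℕP.≡ᵇ⇒≡ a b (≡true⇒T eq)

≡⇒≡ᵇ : {a b : ℕ} → a ≡ b → (a ≡ᵇ b) ≡ true
≡⇒≡ᵇ {a} {b} eq = T⇒≡true (ℕP.≡⇒≡ᵇ a b eq)

≡ᵇ-refl : (a : ℕ) → (a ≡ᵇ a) ≡ true
≡ᵇ-refl a = ≡⇒≡ᵇ {a} refl

-- Opaque, so that goals keep the form Σℤ l f and are rewritten only by the lemmas below.
opaque
  Σℤ : {A : Set} → List A → (A → ℤ) → ℤ
  Σℤ l f = sumℤ (map f l)

  Σℤ-def : {A : Set} (l : List A) (f : A → ℤ) → Σℤ l f ≡ sumℤ (map f l)
  Σℤ-def l f = refl

  Σℤ-[] : {A : Set} (f : A → ℤ) → Σℤ [] f ≡ 0ℤ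
  Σℤ-[] f = refl

  Σℤ-∷ : {A : Set} (x : A) (l : List A) (f : A → ℤ) → Σℤ (x ∷ l) f ≡ f x + Σℤ l f
  Σℤ-∷ x l f = refl

  Σℤ-++ : {A : Set} (xs ys : List A) (f : A → ℤ) → Σℤ (xs ++ ys) f ≡ Σℤ xs f + Σℤ ys f
  Σℤ-++ []       ys f = sym (ℤP.+-identityˡ _)
  Σℤ-++ (x ∷ xs) ys f = trans (cong (_+_ (f x)) (Σℤ-++ xs ys f)) (sym (ℤP.+-assoc (f x) _ _))

  Σℤ-cong : {A : Set} (l : List A) {f g : A → ℤ} → (∀ x → f x ≡ g x) → Σℤ l f ≡ Σℤ l g
  Σℤ-cong []      eq = refl
  Σℤ-cong (x ∷ l) eq = cong₂ _+_ (eq x) (Σℤ-cong l eq)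

  Σℤ-+ : {A : Set} (l : List A) (f g : A → ℤ) → Σℤ l (λ x → f x + g x) ≡ Σℤ l f + Σℤ l g
  Σℤ-+ []      f g = refl
  Σℤ-+ (x ∷ l) f g = trans (cong (_+_ (f x + g x)) (Σℤ-+ l f g))
    (solve 4 (λ a b c d → (a :+ b) :+ (c :+ d) := (a :+ c) :+ (b :+ d)) refl (f x) (g x) (Σℤ l f) (Σℤ l g))

  Σℤ-zero : {A : Set} (l : List A) {f : A → ℤ} → (∀ x → f x ≡ 0ℤ) → Σℤ l f ≡ 0ℤ
  Σℤ-zero []      eq = refl
  Σℤ-zero (x ∷ l) eq = trans (cong₂ _+_ (eq x) (Σℤ-zero l eq)) refl

  Σℤ-*ˡ : {A : Set} (c : ℤ) (l : List A) (f : A → ℤ) → c * Σℤ l f ≡ Σℤ l (λ x → c * f x)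
  Σℤ-*ˡ c []      f = ℤP.*-zeroʳ c
  Σℤ-*ˡ c (x ∷ l) f = trans (ℤP.*-distribˡ-+ c (f x) _) (cong (_+_ (c * f x)) (Σℤ-*ˡ c l f))

  Σℤ-neg : {A : Set} (l : List A) (f : A → ℤ) → - Σℤ l f ≡ Σℤ l (λ x → - f x)
  Σℤ-neg []      f = refl
  Σℤ-neg (x ∷ l) f = trans (ℤP.neg-distrib-+ (f x) _) (cong (_+_ (- f x)) (Σℤ-neg l f))

  Σℤ-concatMap : {A B : Set} (g : A → List B) (l : List A) (f : B → ℤ) →
    Σℤ (concatMap g l) f ≡ Σℤ l (λ x → Σℤ (g x) f)
  Σℤ-concatMap g []      f = refl
  Σℤ-concatMap g (x ∷ l) f = trans (Σℤ-++ (g x) (concatMap g l) f) (cong (_+_ (Σℤ (g x) f)) (Σℤ-concatMap g l f))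

  Σℤ-map : {A B : Set} (g : A → B) (l : List A) (f : B → ℤ) → Σℤ (map g l) f ≡ Σℤ l (f ∘ g)
  Σℤ-map g []      f = refl
  Σℤ-map g (x ∷ l) f = cong (_+_ (f (g x))) (Σℤ-map g l f)

  Σℤ-filter : {A : Set} (p : A → Bool) (l : List A) (f : A → ℤ) →
    Σℤ (filterᵇ p l) f ≡ Σℤ l (λ x → if p x then f x else 0ℤ)
  Σℤ-filter p []      f = refl
  Σℤ-filter p (x ∷ l) f with p x
  ... | true  = cong (_+_ (f x)) (Σℤ-filter p l f)
  ... | false = trans (Σℤ-filter p l f) (sym (ℤP.+-identityˡ _))

Σℤ-single : {A : Set} (x : A) (f : A → ℤ) → Σℤ (x ∷ []) f ≡ f x
Σℤ-single x f = trans (Σℤ-∷ x [] f) (trans (cong (_+_ (f x)) (Σℤ-[] f)) (ℤP.+-identityʳ (f x)))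

Σℤ-*ʳ : {A : Set} (c : ℤ) (l : List A) (f : A → ℤ) → Σℤ l f * c ≡ Σℤ l (λ x → f x * c)
Σℤ-*ʳ c l f = trans (ℤP.*-comm _ c) (trans (Σℤ-*ˡ c l f) (Σℤ-cong l (λ x → ℤP.*-comm c (f x))))

Σℤ-swap : {A B : Set} (l₁ : List A) (l₂ : List B) (f : A → B → ℤ) →
  Σℤ l₁ (λ x → Σℤ l₂ (f x)) ≡ Σℤ l₂ (λ y → Σℤ l₁ (λ x → f x y))
Σℤ-swap []       l₂ f = trans (Σℤ-[] _) (sym (Σℤ-zero l₂ (λ _ → Σℤ-[] _)))
Σℤ-swap (x ∷ l₁) l₂ f = trans (Σℤ-∷ x l₁ _) (trans (cong (_+_ (Σℤ l₂ (f x))) (Σℤ-swap l₁ l₂ f))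
  (trans (sym (Σℤ-+ l₂ (f x) _)) (Σℤ-cong l₂ (λ y → sym (Σℤ-∷ x l₁ (λ x′ → f x′ y))))))

Σℤ-*-Σℤ : {A B : Set} (l₁ : List A) (l₂ : List B) (f : A → ℤ) (g : B → ℤ) →
  Σℤ l₁ f * Σℤ l₂ g ≡ Σℤ l₁ (λ x → Σℤ l₂ (λ y → f x * g y))
Σℤ-*-Σℤ l₁ l₂ f g = trans (Σℤ-*ʳ (Σℤ l₂ g) l₁ f) (Σℤ-cong l₁ (λ x → Σℤ-*ˡ (f x) l₂ g))

Σℤ-nonneg : {A : Set} (l : List A) {f : A → ℤ} → (∀ x → 0ℤ ℤ≤ f x) → 0ℤ ℤ≤ Σℤ l f
Σℤ-nonneg []      pos = subst (0ℤ ℤ≤_) (sym (Σℤ-[] _)) (ℤ.+≤+ z≤n)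
Σℤ-nonneg (x ∷ l) pos = subst (0ℤ ℤ≤_) (sym (Σℤ-∷ x l _)) (ℤP.+-mono-≤ (pos x) (Σℤ-nonneg l pos))

termCoeff : Term → ℕ → Word → ℤ
termCoeff (c , e , v) k w = if (e ≡ᵇ k) ∧ (v ==w w) then c else 0ℤ

termCoeff-⟦⟧ : (c : ℤ) (e : ℕ) (v : Word) (k : ℕ) (w : Word) →
  termCoeff (c , e , v) k w ≡ ⟦ e ≡ᵇ k ⟧ * ⟦ v ==w w ⟧ * c
termCoeff-⟦⟧ c e v k w = trans (if-else-0≡⟦⟧* _ c) (cong (_* c) (⟦∧⟧ (e ≡ᵇ k) (v ==w w)))

opaque
  unfolding Σℤ
  coeff≡Σℤ : (p : Poly) (k : ℕ) (w : Word) → coeff p k w ≡ Σℤ p (λ t → termCoeff t k w)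
  coeff≡Σℤ []                k w = refl
  coeff≡Σℤ ((c , e , v) ∷ p) k w = cong (_+_ (termCoeff (c , e , v) k w)) (coeff≡Σℤ p k w)

coeff-++ : (p q : Poly) (k : ℕ) (w : Word) → coeff (p ++ q) k w ≡ coeff p k w + coeff q k w
coeff-++ p q k w = trans (coeff≡Σℤ (p ++ q) k w) (trans (Σℤ-++ p q _)
  (sym (cong₂ _+_ (coeff≡Σℤ p k w) (coeff≡Σℤ q k w))))

_·ₜ_ : Term → Term → Term
(c , e , v) ·ₜ (d , f , u) = (c * d , e ℕ.+ f , v ++ u)

Σℤ-⊗ : (p q : Poly) (g : Term → ℤ) → Σℤ (p ⊗ q) g ≡ Σℤ p (λ t → Σℤ q (λ s → g (t ·ₜ s)))
Σℤ-⊗ p q g = trans (Σℤ-concatMap _ p g) (Σℤ-cong p termwise)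
  where
  termwise : (t : Term) → Σℤ (map (λ { (d , f , u) → _ }) q) g ≡ Σℤ q (λ s → g (t ·ₜ s))
  termwise (c , e , v) = trans (Σℤ-map _ q g) (Σℤ-cong q (λ { (d , f , u) → refl }))

coeff-⊗-terms : (p q : Poly) (k : ℕ) (w : Word) →
  coeff (p ⊗ q) k w ≡ Σℤ p (λ t → Σℤ q (λ s → termCoeff (t ·ₜ s) k w))
coeff-⊗-terms p q k w = trans (coeff≡Σℤ (p ⊗ q) k w) (Σℤ-⊗ p q _)

splitsℕ : ℕ → List (ℕ × ℕ)
splitsℕ zero    = (0 , 0) ∷ []
splitsℕ (suc k) = (0 , suc k) ∷ map (λ s → (suc (proj₁ s) , proj₂ s)) (splitsℕ k)

splitsWord : Word → List (Word × Word)
splitsWord []      = ([] , []) ∷ []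
splitsWord (x ∷ w) = ([] , x ∷ w) ∷ map (λ s → (x ∷ proj₁ s , proj₂ s)) (splitsWord w)

opaque
  unfolding Σℤ
  Σℤ-splitsℕ : (e f k : ℕ) →
    Σℤ (splitsℕ k) (λ s → ⟦ e ≡ᵇ proj₁ s ⟧ * ⟦ f ≡ᵇ proj₂ s ⟧) ≡ ⟦ e ℕ.+ f ≡ᵇ k ⟧
  Σℤ-splitsℕ zero    f zero    = trans (ℤP.+-identityʳ _) (ℤP.*-identityˡ _)
  Σℤ-splitsℕ (suc e) f zero    = refl
  Σℤ-splitsℕ zero    f (suc k) = trans (cong₂ _+_ (ℤP.*-identityˡ ⟦ f ≡ᵇ suc k ⟧)
      (trans (Σℤ-map _ (splitsℕ k) _) (Σℤ-zero (splitsℕ k) (λ s → ℤP.*-zeroˡ ⟦ f ≡ᵇ proj₂ s ⟧))))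
    (ℤP.+-identityʳ _)
  Σℤ-splitsℕ (suc e) f (suc k) =
    trans (ℤP.+-identityˡ _) (trans (Σℤ-map _ (splitsℕ k) _) (Σℤ-splitsℕ e f k))

  Σℤ-splitsWord : (v u w : Word) →
    Σℤ (splitsWord w) (λ s → ⟦ v ==w proj₁ s ⟧ * ⟦ u ==w proj₂ s ⟧) ≡ ⟦ (v ++ u) ==w w ⟧
  Σℤ-splitsWord []      u []      = trans (ℤP.+-identityʳ _) (ℤP.*-identityˡ _)
  Σℤ-splitsWord (x ∷ v) u []      = refl
  Σℤ-splitsWord []      u (y ∷ w) = trans (cong₂ _+_ (ℤP.*-identityˡ ⟦ u ==w (y ∷ w) ⟧)
      (trans (Σℤ-map _ (splitsWord w) _) (Σℤ-zero (splitsWord w) (λ s → ℤP.*-zeroˡ ⟦ u ==w proj₂ s ⟧))))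
    (ℤP.+-identityʳ _)
  Σℤ-splitsWord (x ∷ v) u (y ∷ w) = begin
    0ℤ + Σℤ (map _ (splitsWord w)) _
      ≡⟨ trans (ℤP.+-identityˡ _) (Σℤ-map _ (splitsWord w) _) ⟩
    Σℤ (splitsWord w) (λ s → ⟦ (x ==ℓ y) ∧ (v ==w proj₁ s) ⟧ * ⟦ u ==w proj₂ s ⟧)
      ≡⟨ Σℤ-cong (splitsWord w) (λ s → trans (cong (_* ⟦ u ==w proj₂ s ⟧) (⟦∧⟧ (x ==ℓ y) _)) (ℤP.*-assoc ⟦ x ==ℓ y ⟧ _ _)) ⟩
    Σℤ (splitsWord w) (λ s → ⟦ x ==ℓ y ⟧ * (⟦ v ==w proj₁ s ⟧ * ⟦ u ==w proj₂ s ⟧))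
      ≡⟨ sym (Σℤ-*ˡ ⟦ x ==ℓ y ⟧ (splitsWord w) _) ⟩
    ⟦ x ==ℓ y ⟧ * Σℤ (splitsWord w) (λ s → ⟦ v ==w proj₁ s ⟧ * ⟦ u ==w proj₂ s ⟧)
      ≡⟨ cong (⟦ x ==ℓ y ⟧ *_) (Σℤ-splitsWord v u w) ⟩
    ⟦ x ==ℓ y ⟧ * ⟦ (v ++ u) ==w w ⟧
      ≡⟨ sym (⟦∧⟧ (x ==ℓ y) _) ⟩
    ⟦ (x ==ℓ y) ∧ ((v ++ u) ==w w) ⟧ ∎
    where open ≡-Reasoning

termCoeff-·ₜ : (t s : Term) (k : ℕ) (w : Word) → termCoeff (t ·ₜ s) k w ≡
  Σℤ (splitsℕ k) (λ ks → Σℤ (splitsWord w) (λ ws → termCoeff t (proj₁ ks) (proj₁ ws) * termCoeff s (proj₂ ks) (proj₂ ws)))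
termCoeff-·ₜ (c , e , v) (d , f , u) k w = sym (begin
  Σℤ (splitsℕ k) (λ ks → Σℤ (splitsWord w) (λ ws → termCoeff (c , e , v) (proj₁ ks) (proj₁ ws) * termCoeff (d , f , u) (proj₂ ks) (proj₂ ws)))
    ≡⟨ Σℤ-cong (splitsℕ k) (λ ks → Σℤ-cong (splitsWord w) (λ ws →
         trans (cong₂ _*_ (termCoeff-⟦⟧ c e v _ _) (termCoeff-⟦⟧ d f u _ _))
           (solve 6 (λ a₁ b₁ a₂ b₂ c′ d′ → (a₁ :* b₁ :* c′) :* (a₂ :* b₂ :* d′) := (a₁ :* a₂) :* ((b₁ :* b₂) :* (c′ :* d′)))
             refl (E₁ ks) (V₁ ws) (E₂ ks) (V₂ ws) c d))) ⟩
  Σℤ (splitsℕ k) (λ ks → Σℤ (splitsWord w) (λ ws → (E₁ ks * E₂ ks) * ((V₁ ws * V₂ ws) * (c * d))))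
    ≡⟨ trans (Σℤ-cong (splitsℕ k) (λ ks → sym (Σℤ-*ˡ (E₁ ks * E₂ ks) (splitsWord w) _))) (sym (Σℤ-*ʳ _ (splitsℕ k) _)) ⟩
  Σℤ (splitsℕ k) (λ ks → E₁ ks * E₂ ks) * Σℤ (splitsWord w) (λ ws → (V₁ ws * V₂ ws) * (c * d))
    ≡⟨ cong₂ _*_ (Σℤ-splitsℕ e f k) (trans (sym (Σℤ-*ʳ _ (splitsWord w) _)) (cong (_* (c * d)) (Σℤ-splitsWord v u w))) ⟩
  ⟦ e ℕ.+ f ≡ᵇ k ⟧ * (⟦ (v ++ u) ==w w ⟧ * (c * d))
    ≡⟨ sym (trans (termCoeff-⟦⟧ (c * d) (e ℕ.+ f) (v ++ u) k w) (ℤP.*-assoc ⟦ e ℕ.+ f ≡ᵇ k ⟧ ⟦ (v ++ u) ==w w ⟧ (c * d))) ⟩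
  termCoeff (c * d , e ℕ.+ f , v ++ u) k w ∎)
  where
  open ≡-Reasoning
  E₁ E₂ : ℕ × ℕ → ℤ
  E₁ ks = ⟦ e ≡ᵇ proj₁ ks ⟧
  E₂ ks = ⟦ f ≡ᵇ proj₂ ks ⟧
  V₁ V₂ : Word × Word → ℤ
  V₁ ws = ⟦ v ==w proj₁ ws ⟧
  V₂ ws = ⟦ u ==w proj₂ ws ⟧

coeff-⊗ : (p q : Poly) (k : ℕ) (w : Word) → coeff (p ⊗ q) k w ≡
  Σℤ (splitsℕ k) (λ ks → Σℤ (splitsWord w) (λ ws → coeff p (proj₁ ks) (proj₁ ws) * coeff q (proj₂ ks) (proj₂ ws)))
coeff-⊗ p q k w = begin
  coeff (p ⊗ q) k w
    ≡⟨ coeff-⊗-terms p q k w ⟩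
  Σℤ p (λ t → Σℤ q (λ s → termCoeff (t ·ₜ s) k w))
    ≡⟨ Σℤ-cong p (λ t → Σℤ-cong q (λ s → termCoeff-·ₜ t s k w)) ⟩
  Σℤ p (λ t → Σℤ q (λ s → Σℤ K (λ ks → Σℤ W (λ ws → F t s ks ws))))
    ≡⟨ trans (Σℤ-cong p (λ t → Σℤ-swap q K _)) (Σℤ-swap p K _) ⟩
  Σℤ K (λ ks → Σℤ p (λ t → Σℤ q (λ s → Σℤ W (λ ws → F t s ks ws))))
    ≡⟨ Σℤ-cong K (λ ks → trans (Σℤ-cong p (λ t → Σℤ-swap q W _)) (Σℤ-swap p W _)) ⟩
  Σℤ K (λ ks → Σℤ W (λ ws → Σℤ p (λ t → Σℤ q (λ s → F t s ks ws))))
    ≡⟨ Σℤ-cong K (λ ks → Σℤ-cong W (λ ws →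
         trans (sym (Σℤ-*-Σℤ p q _ _)) (sym (cong₂ _*_ (coeff≡Σℤ p _ _) (coeff≡Σℤ q _ _))))) ⟩
  Σℤ K (λ ks → Σℤ W (λ ws → coeff p (proj₁ ks) (proj₁ ws) * coeff q (proj₂ ks) (proj₂ ws))) ∎
  where
  open ≡-Reasoning
  K = splitsℕ k
  W = splitsWord w
  F : Term → Term → ℕ × ℕ → Word × Word → ℤ
  F t s ks ws = termCoeff t (proj₁ ks) (proj₁ ws) * termCoeff s (proj₂ ks) (proj₂ ws)

-- A record rather than Defs' _≈P_ (a Π-type), so that the two sides can be inferred from a proof.
infix 4 _≈_
record _≈_ (p q : Poly) : Set where
  constructor mk≈
  field coeff-≡ : ∀ k w → coeff p k w ≡ coeff q k w
open _≈_ public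

≈-refl : {p : Poly} → p ≈ p
≈-refl = mk≈ λ k w → refl

≈-sym : {p q : Poly} → p ≈ q → q ≈ p
≈-sym e = mk≈ λ k w → sym (coeff-≡ e k w)

≈-trans : {p q r : Poly} → p ≈ q → q ≈ r → p ≈ r
≈-trans e f = mk≈ λ k w → trans (coeff-≡ e k w) (coeff-≡ f k w)

≡⇒≈ : {p q : Poly} → p ≡ q → p ≈ q
≡⇒≈ refl = ≈-refl

Poly-setoid : Setoid _ _
Poly-setoid = record
  { Carrier = Poly ; _≈_ = _≈_
  ; isEquivalence = record { refl = ≈-refl ; sym = ≈-sym ; trans = ≈-trans } }

module ≈-Reasoning = Relation.Binary.Reasoning.Setoid Poly-setoid

++-cong : {p p′ q q′ : Poly} → p ≈ p′ → q ≈ q′ → p ++ q ≈ p′ ++ q′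
++-cong {p} {p′} {q} {q′} e f = mk≈ λ k w →
  trans (coeff-++ p q k w) (trans (cong₂ _+_ (coeff-≡ e k w) (coeff-≡ f k w)) (sym (coeff-++ p′ q′ k w)))

++-identityʳ : (p : Poly) → p ++ [] ≈ p
++-identityʳ p = ≡⇒≈ (ListP.++-identityʳ p)

⊗-cong : {p p′ q q′ : Poly} → p ≈ p′ → q ≈ q′ → p ⊗ q ≈ p′ ⊗ q′
⊗-cong {p} {p′} {q} {q′} e f = mk≈ λ k w → trans (coeff-⊗ p q k w) (trans
  (Σℤ-cong (splitsℕ k) (λ ks → Σℤ-cong (splitsWord w) (λ ws → cong₂ _*_ (coeff-≡ e _ _) (coeff-≡ f _ _))))
  (sym (coeff-⊗ p′ q′ k w)))

⊗-congˡ : {p p′ : Poly} (q : Poly) → p ≈ p′ → p ⊗ q ≈ p′ ⊗ q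
⊗-congˡ q e = ⊗-cong e ≈-refl

⊗-congʳ : (p : Poly) {q q′ : Poly} → q ≈ q′ → p ⊗ q ≈ p ⊗ q′
⊗-congʳ p e = ⊗-cong (≈-refl {p}) e

⊗-distribʳ-++ : (p q r : Poly) → (p ++ q) ⊗ r ≈ (p ⊗ r) ++ (q ⊗ r)
⊗-distribʳ-++ p q r = ≡⇒≈ (ListP.concatMap-++ _ p q)

⊗-distribˡ-++ : (p q r : Poly) → p ⊗ (q ++ r) ≈ (p ⊗ q) ++ (p ⊗ r)
⊗-distribˡ-++ p q r = mk≈ λ k w → begin
  coeff (p ⊗ (q ++ r)) k w
    ≡⟨ coeff-⊗-terms p (q ++ r) k w ⟩
  Σℤ p (λ t → Σℤ (q ++ r) (λ s → termCoeff (t ·ₜ s) k w))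
    ≡⟨ trans (Σℤ-cong p (λ t → Σℤ-++ q r _)) (Σℤ-+ p _ _) ⟩
  Σℤ p (λ t → Σℤ q (λ s → termCoeff (t ·ₜ s) k w)) + Σℤ p (λ t → Σℤ r (λ s → termCoeff (t ·ₜ s) k w))
    ≡⟨ cong₂ _+_ (sym (coeff-⊗-terms p q k w)) (sym (coeff-⊗-terms p r k w)) ⟩
  coeff (p ⊗ q) k w + coeff (p ⊗ r) k w
    ≡⟨ sym (coeff-++ (p ⊗ q) (p ⊗ r) k w) ⟩
  coeff ((p ⊗ q) ++ (p ⊗ r)) k w ∎
  where open ≡-Reasoning

⊗-zeroʳ : (p : Poly) → p ⊗ [] ≈ []
⊗-zeroʳ p = mk≈ λ k w → trans (coeff-⊗-terms p [] k w) (Σℤ-zero p (λ t → Σℤ-[] _))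

⊗-identityˡ : (p : Poly) → oneP ⊗ p ≈ p
⊗-identityˡ p = ≡⇒≈ (trans (ListP.++-identityʳ _)
  (trans (ListP.map-cong (λ { (d , f , u) → cong (_, f , u) (ℤP.*-identityˡ d) }) p) (ListP.map-id p)))

⊗-identityʳ : (p : Poly) → p ⊗ oneP ≈ p
⊗-identityʳ p = ≡⇒≈ (trans (ListP.concatMap-cong (λ { (c , e , v) → cong (_∷ [])
    (cong₂ _,_ (ℤP.*-identityʳ c) (cong₂ _,_ (ℕP.+-identityʳ e) (ListP.++-identityʳ v))) }) p)
  (ListP.concatMap-pure p))

ΣP : {A : Set} → List A → (A → Poly) → Poly
ΣP l f = sumP (map f l)

coeff-ΣP : {A : Set} (l : List A) (f : A → Poly) (k : ℕ) (w : Word) →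
  coeff (ΣP l f) k w ≡ Σℤ l (λ x → coeff (f x) k w)
coeff-ΣP []      f k w = sym (Σℤ-[] _)
coeff-ΣP (x ∷ l) f k w = trans (coeff-++ (f x) (ΣP l f) k w)
  (trans (cong (_+_ (coeff (f x) k w)) (coeff-ΣP l f k w)) (sym (Σℤ-∷ x l _)))

ΣP-lift : {A B : Set} (l₁ : List A) (l₂ : List B) {f : A → Poly} {g : B → Poly} →
  (∀ k w → Σℤ l₁ (λ x → coeff (f x) k w) ≡ Σℤ l₂ (λ y → coeff (g y) k w)) → ΣP l₁ f ≈ ΣP l₂ g
ΣP-lift l₁ l₂ {f} {g} eq = mk≈ λ k w → trans (coeff-ΣP l₁ f k w) (trans (eq k w) (sym (coeff-ΣP l₂ g k w)))

ΣP-cong : {A : Set} (l : List A) {f g : A → Poly} → (∀ x → f x ≈ g x) → ΣP l f ≈ ΣP l g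
ΣP-cong l e = ΣP-lift l l (λ k w → Σℤ-cong l (λ x → coeff-≡ (e x) k w))

ΣP-zero : {A : Set} (l : List A) {f : A → Poly} → (∀ x → f x ≈ []) → ΣP l f ≈ []
ΣP-zero l e = mk≈ λ k w → trans (coeff-ΣP l _ k w) (Σℤ-zero l (λ x → coeff-≡ (e x) k w))

ΣP-single : {A : Set} (a : A) (f : A → Poly) → ΣP (a ∷ []) f ≈ f a
ΣP-single a f = ++-identityʳ (f a)

ΣP-swap : {A B : Set} (l₁ : List A) (l₂ : List B) (f : A → B → Poly) →
  ΣP l₁ (λ x → ΣP l₂ (f x)) ≈ ΣP l₂ (λ y → ΣP l₁ (λ x → f x y))
ΣP-swap l₁ l₂ f = ΣP-lift l₁ l₂ λ k w → begin
  Σℤ l₁ (λ x → coeff (ΣP l₂ (f x)) k w)          ≡⟨ Σℤ-cong l₁ (λ x → coeff-ΣP l₂ (f x) k w) ⟩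
  Σℤ l₁ (λ x → Σℤ l₂ (λ y → coeff (f x y) k w))  ≡⟨ Σℤ-swap l₁ l₂ _ ⟩
  Σℤ l₂ (λ y → Σℤ l₁ (λ x → coeff (f x y) k w))  ≡⟨ Σℤ-cong l₂ (λ y → sym (coeff-ΣP l₁ (λ x → f x y) k w)) ⟩
  Σℤ l₂ (λ y → coeff (ΣP l₁ (λ x → f x y)) k w)  ∎
  where open ≡-Reasoning

ΣP-⊗ʳ : {A : Set} (l : List A) (f : A → Poly) (q : Poly) → ΣP l f ⊗ q ≈ ΣP l (λ x → f x ⊗ q)
ΣP-⊗ʳ []      f q = ≈-refl
ΣP-⊗ʳ (x ∷ l) f q = ≈-trans (⊗-distribʳ-++ (f x) (ΣP l f) q) (++-cong ≈-refl (ΣP-⊗ʳ l f q))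

ΣP-⊗ˡ : {A : Set} (p : Poly) (l : List A) (f : A → Poly) → p ⊗ ΣP l f ≈ ΣP l (λ x → p ⊗ f x)
ΣP-⊗ˡ p []      f = ⊗-zeroʳ p
ΣP-⊗ˡ p (x ∷ l) f = ≈-trans (⊗-distribˡ-++ p (f x) (ΣP l f)) (++-cong ≈-refl (ΣP-⊗ˡ p l f))

ΣP-⊗-ΣP : {A B : Set} (l₁ : List A) (l₂ : List B) (f : A → Poly) (g : B → Poly) →
  ΣP l₁ f ⊗ ΣP l₂ g ≈ ΣP l₁ (λ a → ΣP l₂ (λ b → f a ⊗ g b))
ΣP-⊗-ΣP l₁ l₂ f g = ≈-trans (ΣP-⊗ʳ l₁ f (ΣP l₂ g)) (ΣP-cong l₁ (λ a → ΣP-⊗ˡ (f a) l₂ g))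

ΣP-concatMap : {A B : Set} (g : A → List B) (l : List A) (f : B → Poly) →
  ΣP (concatMap g l) f ≈ ΣP l (λ x → ΣP (g x) f)
ΣP-concatMap g l f = ΣP-lift (concatMap g l) l λ k w →
  trans (Σℤ-concatMap g l _) (Σℤ-cong l (λ x → sym (coeff-ΣP (g x) f k w)))

ΣP-map : {A B : Set} (g : A → B) (l : List A) (f : B → Poly) → ΣP (map g l) f ≈ ΣP l (f ∘ g)
ΣP-map g l f = ≡⇒≈ (cong sumP (sym (ListP.map-∘ l)))

ifP : Bool → Poly → Poly
ifP b p = if b then p else []

coeff-ifP : (b : Bool) (p : Poly) (k : ℕ) (w : Word) → coeff (ifP b p) k w ≡ ⟦ b ⟧ * coeff p k w
coeff-ifP true  p k w = sym (ℤP.*-identityˡ _)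
coeff-ifP false p k w = refl

ifP-cong : (b : Bool) {p q : Poly} → (b ≡ true → p ≈ q) → ifP b p ≈ ifP b q
ifP-cong true  e = e refl
ifP-cong false e = ≈-refl

ifP-true : {b : Bool} (p : Poly) → b ≡ true → ifP b p ≈ p
ifP-true p refl = ≈-refl

ifP-false : {b : Bool} (p : Poly) → b ≡ false → ifP b p ≈ []
ifP-false p refl = ≈-refl

ifP-∧ : (a b : Bool) (p : Poly) → ifP (a ∧ b) p ≡ ifP a (ifP b p)
ifP-∧ true  b p = refl
ifP-∧ false b p = refl

ifP-⊗ˡ : (b : Bool) (p q : Poly) → ifP b p ⊗ q ≈ ifP b (p ⊗ q)
ifP-⊗ˡ true  p q = ≈-refl
ifP-⊗ˡ false p q = ≈-refl

ifP-⊗ʳ : (b : Bool) (p q : Poly) → p ⊗ ifP b q ≈ ifP b (p ⊗ q)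
ifP-⊗ʳ true  p q = ≈-refl
ifP-⊗ʳ false p q = ⊗-zeroʳ p

ifP-⊗-ifP : (a b : Bool) (p q : Poly) → ifP a p ⊗ ifP b q ≈ ifP a (ifP b (p ⊗ q))
ifP-⊗-ifP true  b p q = ifP-⊗ʳ b p q
ifP-⊗-ifP false b p q = ≈-refl

ΣP-ifP : {A : Set} (l : List A) (b : Bool) (f : A → Poly) → ΣP l (λ c → ifP b (f c)) ≈ ifP b (ΣP l f)
ΣP-ifP l true  f = ≈-refl
ΣP-ifP l false f = ΣP-zero l (λ _ → ≈-refl)

ΣP-filter : {A : Set} (p : A → Bool) (l : List A) (f : A → Poly) →
  ΣP (filterᵇ p l) f ≈ ΣP l (λ x → ifP (p x) (f x))
ΣP-filter p []      f = ≈-refl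
ΣP-filter p (x ∷ l) f with p x
... | true  = ++-cong ≈-refl (ΣP-filter p l f)
... | false = ΣP-filter p l f

ΣP-ifP-⊗ʳ : {A : Set} (l : List A) (b : A → Bool) (f : A → Poly) (q : Poly) →
  ΣP l (λ x → ifP (b x) (f x)) ⊗ q ≈ ΣP l (λ x → ifP (b x) (f x ⊗ q))
ΣP-ifP-⊗ʳ l b f q = ≈-trans (ΣP-⊗ʳ l _ q) (ΣP-cong l (λ x → ifP-⊗ˡ (b x) (f x) q))

y^_ : ℕ → Poly
y^ e = (+ 1 , e , []) ∷ []

_≟ᵇ_ : {m : ℕ} → Fin m → Fin m → Bool
x ≟ᵇ y = ⌊ x ≟ y ⌋

≟ᵇ-refl : {m : ℕ} (x : Fin m) → (x ≟ᵇ x) ≡ true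
≟ᵇ-refl x = trans (isYes≗does (x ≟ x)) (dec-true (x ≟ x) refl)

≟ᵇ-≢ : {m : ℕ} {x y : Fin m} → ¬ x ≡ y → (x ≟ᵇ y) ≡ false
≟ᵇ-≢ {x = x} {y} x≢y = trans (isYes≗does (x ≟ y)) (dec-false (x ≟ y) x≢y)

≟ᵇ-sound : {m : ℕ} {x y : Fin m} → (x ≟ᵇ y) ≡ true → x ≡ y
≟ᵇ-sound {x = x} {y} eq with x ≟ y
... | yes x≡y = x≡y

≟ᵇ-sym : {m : ℕ} (x y : Fin m) → (x ≟ᵇ y) ≡ (y ≟ᵇ x)
≟ᵇ-sym x y with x ≟ y | y ≟ x
... | yes _   | yes _   = refl
... | yes x≡y | no  y≢x = ⊥-elim (y≢x (sym x≡y))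
... | no  x≢y | yes y≡x = ⊥-elim (x≢y (sym y≡x))
... | no  _   | no  _   = refl

opaque
  unfolding Σℤ
  Σℤ-tabulate : {A : Set} {n : ℕ} (g : Fin n → A) (f : A → ℤ) → Σℤ (tabulate g) f ≡ Σℤ (allFin n) (f ∘ g)
  Σℤ-tabulate {n = zero}  g f = refl
  Σℤ-tabulate {n = suc n} g f =
    cong (_+_ (f (g fzero))) (trans (Σℤ-tabulate (g ∘ fsuc) f) (sym (Σℤ-tabulate fsuc (f ∘ g))))

Σℤ-allFin-suc : {n : ℕ} (f : Fin (suc n) → ℤ) → Σℤ (allFin (suc n)) f ≡ f fzero + Σℤ (allFin n) (f ∘ fsuc)
Σℤ-allFin-suc f = trans (Σℤ-∷ fzero _ f) (cong (_+_ (f fzero)) (Σℤ-tabulate fsuc f))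

Σℤ-δ : {m : ℕ} (y : Fin m) (f : Fin m → ℤ) → Σℤ (allFin m) (λ z → ⟦ z ≟ᵇ y ⟧ * f z) ≡ f y
Σℤ-δ {suc m} fzero f = trans (Σℤ-allFin-suc _) (trans (cong₂ _+_ (ℤP.*-identityˡ (f fzero))
  (Σℤ-zero (allFin m) (λ z → ℤP.*-zeroˡ (f (fsuc z))))) (ℤP.+-identityʳ _))
Σℤ-δ {suc m} (fsuc y) f = trans (Σℤ-allFin-suc _) (trans (ℤP.+-identityˡ _)
  (trans (Σℤ-cong (allFin m) (λ z → cong (λ b → ⟦ b ⟧ * f (fsuc z)) (suc-≟ᵇ-suc z y))) (Σℤ-δ y (f ∘ fsuc))))
  where
  suc-≟ᵇ-suc : {m : ℕ} (x y : Fin m) → (fsuc x ≟ᵇ fsuc y) ≡ (x ≟ᵇ y)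
  suc-≟ᵇ-suc x y with x ≟ y
  ... | yes _ = refl
  ... | no  _ = refl

Σℤ-upTo-suc : (n : ℕ) (f : ℕ → ℤ) → Σℤ (upTo (suc n)) f ≡ f 0 + Σℤ (upTo n) (f ∘ suc)
Σℤ-upTo-suc n f = trans (Σℤ-∷ 0 _ f) (cong (_+_ (f 0)) (Σℤ-applyUpTo suc n f))
  where
  Σℤ-applyUpTo : (g : ℕ → ℕ) (n : ℕ) (f : ℕ → ℤ) → Σℤ (applyUpTo g n) f ≡ Σℤ (upTo n) (f ∘ g)
  Σℤ-applyUpTo g zero    f = trans (Σℤ-[] f) (sym (Σℤ-[] _))
  Σℤ-applyUpTo g (suc n) f = trans (Σℤ-∷ (g 0) _ f) (trans (cong (_+_ (f (g 0)))
    (trans (Σℤ-applyUpTo (g ∘ suc) n f) (sym (Σℤ-applyUpTo suc n (f ∘ g))))) (sym (Σℤ-∷ 0 _ (f ∘ g))))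

Σℤ-upTo-cong : (n : ℕ) {f g : ℕ → ℤ} → (∀ j → j < n → f j ≡ g j) → Σℤ (upTo n) f ≡ Σℤ (upTo n) g
Σℤ-upTo-cong zero    {f} {g} eq = trans (Σℤ-[] f) (sym (Σℤ-[] g))
Σℤ-upTo-cong (suc n) {f} {g} eq = trans (Σℤ-upTo-suc n f) (trans (cong₂ _+_ (eq 0 (s≤s z≤n))
  (Σℤ-upTo-cong n (λ j j<n → eq (suc j) (s≤s j<n)))) (sym (Σℤ-upTo-suc n g)))

Σℤ-upTo-δ : (n t : ℕ) → t < n → (g : ℕ → ℤ) → Σℤ (upTo n) (λ j → ⟦ t ≡ᵇ j ⟧ * g j) ≡ g t
Σℤ-upTo-δ (suc n) zero    _         g = trans (Σℤ-upTo-suc n _) (trans (cong₂ _+_ (ℤP.*-identityˡ (g 0))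
  (Σℤ-zero (upTo n) (λ j → ℤP.*-zeroˡ (g (suc j))))) (ℤP.+-identityʳ _))
Σℤ-upTo-δ (suc n) (suc t) (s≤s t<n) g =
  trans (Σℤ-upTo-suc n _) (trans (ℤP.+-identityˡ _) (Σℤ-upTo-δ n t t<n (g ∘ suc)))

Σℤ-lists-suc : {A : Set} (xs : List A) (k : ℕ) (F : List A → ℤ) →
  Σℤ (listsOfLength xs (suc k)) F ≡ Σℤ xs (λ x → Σℤ (listsOfLength xs k) (λ c → F (x ∷ c)))
Σℤ-lists-suc xs k F =
  trans (Σℤ-concatMap _ xs F) (Σℤ-cong xs (λ x → Σℤ-map (x ∷_) (listsOfLength xs k) F))

Σℤ-lists-zero : {A : Set} (xs : List A) (F : List A → ℤ) → Σℤ (listsOfLength xs 0) F ≡ F []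
Σℤ-lists-zero xs F = Σℤ-single [] F

Σℤ-lists-+ : {A : Set} (xs : List A) (j k : ℕ) (F : List A → ℤ) →
  Σℤ (listsOfLength xs (j ℕ.+ k)) F ≡ Σℤ (listsOfLength xs j) (λ c₁ → Σℤ (listsOfLength xs k) (λ c₂ → F (c₁ ++ c₂)))
Σℤ-lists-+ xs zero    k F = sym (Σℤ-lists-zero xs _)
Σℤ-lists-+ xs (suc j) k F = begin
  Σℤ (listsOfLength xs (suc (j ℕ.+ k))) F
    ≡⟨ Σℤ-lists-suc xs (j ℕ.+ k) F ⟩
  Σℤ xs (λ x → Σℤ (listsOfLength xs (j ℕ.+ k)) (λ c → F (x ∷ c)))
    ≡⟨ Σℤ-cong xs (λ x → Σℤ-lists-+ xs j k (λ c → F (x ∷ c))) ⟩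
  Σℤ xs (λ x → Σℤ (listsOfLength xs j) (λ c₁ → Σℤ (listsOfLength xs k) (λ c₂ → F (x ∷ c₁ ++ c₂))))
    ≡⟨ sym (Σℤ-lists-suc xs j _) ⟩
  Σℤ (listsOfLength xs (suc j)) (λ c₁ → Σℤ (listsOfLength xs k) (λ c₂ → F (c₁ ++ c₂))) ∎
  where open ≡-Reasoning

Σℤ-lists-cong : {A : Set} (xs : List A) (k : ℕ) {f g : List A → ℤ} →
  (∀ c → length c ≡ k → f c ≡ g c) → Σℤ (listsOfLength xs k) f ≡ Σℤ (listsOfLength xs k) g
Σℤ-lists-cong xs zero    {f} {g} eq = trans (Σℤ-lists-zero xs f) (trans (eq [] refl) (sym (Σℤ-lists-zero xs g)))
Σℤ-lists-cong xs (suc k) {f} {g} eq = trans (Σℤ-lists-suc xs k f) (trans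
  (Σℤ-cong xs (λ x → Σℤ-lists-cong xs k (λ c len → eq (x ∷ c) (cong suc len)))) (sym (Σℤ-lists-suc xs k g)))

_≟ᴸ_ : {m : ℕ} → List (Fin m) → List (Fin m) → Bool
[]      ≟ᴸ []      = true
(x ∷ c) ≟ᴸ (y ∷ d) = (x ≟ᵇ y) ∧ (c ≟ᴸ d)
_       ≟ᴸ _       = false

≟ᴸ-refl : {m : ℕ} (c : List (Fin m)) → (c ≟ᴸ c) ≡ true
≟ᴸ-refl []      = refl
≟ᴸ-refl (x ∷ c) = cong₂ _∧_ (≟ᵇ-refl x) (≟ᴸ-refl c)

≟ᴸ-sound : {m : ℕ} (c d : List (Fin m)) → (c ≟ᴸ d) ≡ true → c ≡ d
≟ᴸ-sound []      []      eq = refl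
≟ᴸ-sound (x ∷ c) (y ∷ d) eq with x ≟ᵇ y in x≟y
... | true = cong₂ _∷_ (≟ᵇ-sound x≟y) (≟ᴸ-sound c d eq)

Σℤ-lists-δ : {m : ℕ} (c₀ : List (Fin m)) (f : List (Fin m) → ℤ) →
  Σℤ (listsOfLength (allFin m) (length c₀)) (λ c → ⟦ c ≟ᴸ c₀ ⟧ * f c) ≡ f c₀
Σℤ-lists-δ []       f = trans (Σℤ-lists-zero (allFin _) _) (ℤP.*-identityˡ (f []))
Σℤ-lists-δ {m} (y ∷ c₀) f = begin
  Σℤ (listsOfLength (allFin m) (suc (length c₀))) (λ c → ⟦ c ≟ᴸ (y ∷ c₀) ⟧ * f c)
    ≡⟨ Σℤ-lists-suc (allFin m) (length c₀) _ ⟩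
  Σℤ (allFin m) (λ x → Σℤ C (λ c → ⟦ (x ≟ᵇ y) ∧ (c ≟ᴸ c₀) ⟧ * f (x ∷ c)))
    ≡⟨ Σℤ-cong (allFin m) (λ x → trans (Σℤ-cong C (λ c → trans (cong (_* f (x ∷ c)) (⟦∧⟧ (x ≟ᵇ y) (c ≟ᴸ c₀)))
         (ℤP.*-assoc ⟦ x ≟ᵇ y ⟧ ⟦ c ≟ᴸ c₀ ⟧ (f (x ∷ c))))) (sym (Σℤ-*ˡ ⟦ x ≟ᵇ y ⟧ C _))) ⟩
  Σℤ (allFin m) (λ x → ⟦ x ≟ᵇ y ⟧ * Σℤ C (λ c → ⟦ c ≟ᴸ c₀ ⟧ * f (x ∷ c)))
    ≡⟨ Σℤ-δ y _ ⟩
  Σℤ C (λ c → ⟦ c ≟ᴸ c₀ ⟧ * f (y ∷ c))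
    ≡⟨ Σℤ-lists-δ c₀ (λ c → f (y ∷ c)) ⟩
  f (y ∷ c₀) ∎
  where
  open ≡-Reasoning
  C = listsOfLength (allFin m) (length c₀)

Σℤ-lists-unique : {m : ℕ} (k : ℕ) (p : List (Fin m) → Bool) (c₀ : List (Fin m)) →
  length c₀ ≡ k → p c₀ ≡ true → (∀ c → p c ≡ true → c ≡ c₀) →
  Σℤ (listsOfLength (allFin m) k) (λ c → ⟦ p c ⟧) ≡ 1ℤ
Σℤ-lists-unique k p c₀ refl pc₀ unique =
  trans (Σℤ-cong _ p≡δ) (trans (Σℤ-lists-δ c₀ (λ _ → 1ℤ)) refl)
  where
  p≡δ : ∀ c → ⟦ p c ⟧ ≡ ⟦ c ≟ᴸ c₀ ⟧ * 1ℤ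
  p≡δ c with p c in pc | c ≟ᴸ c₀ in c≟c₀
  ... | true  | true  = refl
  ... | false | false = refl
  ... | true  | false with () ← trans (sym (≟ᴸ-refl c)) (trans (cong (c ≟ᴸ_) (unique c pc)) c≟c₀)
  ... | false | true  with () ← trans (sym pc₀) (trans (cong p (sym (≟ᴸ-sound c c₀ c≟c₀))) pc)

Σℤ-subsets-zero : (F : List Bool → ℤ) → Σℤ (subsets 0) F ≡ F []
Σℤ-subsets-zero = Σℤ-lists-zero (true ∷ false ∷ [])

Σℤ-subsets-suc : (k : ℕ) (F : List Bool → ℤ) →
  Σℤ (subsets (suc k)) F ≡ Σℤ (subsets k) (λ E → F (true ∷ E)) + Σℤ (subsets k) (λ E → F (false ∷ E))
Σℤ-subsets-suc k F = trans (Σℤ-lists-suc _ k F)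
  (trans (Σℤ-∷ true _ _) (cong (_+_ (Σℤ (subsets k) (λ E → F (true ∷ E)))) (Σℤ-single false _)))

_==ᴮ_ : Bool → Bool → Bool
true  ==ᴮ true  = true
false ==ᴮ false = true
_     ==ᴮ _     = false

_==ᴮᴸ_ : List Bool → List Bool → Bool
[]       ==ᴮᴸ []       = true
(a ∷ as) ==ᴮᴸ (b ∷ bs) = (a ==ᴮ b) ∧ (as ==ᴮᴸ bs)
_        ==ᴮᴸ _        = false

Σℤ-subsets-δ : (B : List Bool) (g : List Bool → ℤ) → Σℤ (subsets (length B)) (λ S → ⟦ B ==ᴮᴸ S ⟧ * g S) ≡ g B
Σℤ-subsets-δ []          g = trans (Σℤ-subsets-zero _) (ℤP.*-identityˡ (g []))
Σℤ-subsets-δ (true ∷ B)  g = trans (Σℤ-subsets-suc (length B) _) (trans (cong₂ _+_ (Σℤ-subsets-δ B (λ S → g (true ∷ S)))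
  (Σℤ-zero (subsets (length B)) (λ S → ℤP.*-zeroˡ (g (false ∷ S))))) (ℤP.+-identityʳ _))
Σℤ-subsets-δ (false ∷ B) g = trans (Σℤ-subsets-suc (length B) _) (trans (cong₂ _+_
  (Σℤ-zero (subsets (length B)) (λ S → ℤP.*-zeroˡ (g (true ∷ S)))) (Σℤ-subsets-δ B (λ S → g (false ∷ S)))) (ℤP.+-identityˡ _))

ΣP-lists-cong : {A : Set} (xs : List A) (k : ℕ) {f g : List A → Poly} →
  (∀ c → length c ≡ k → f c ≈ g c) → ΣP (listsOfLength xs k) f ≈ ΣP (listsOfLength xs k) g
ΣP-lists-cong xs k eq = ΣP-lift _ _ (λ k′ w → Σℤ-lists-cong xs k (λ c len → coeff-≡ (eq c len) k′ w))

ΣP-lists-+ : {A : Set} (xs : List A) (j k : ℕ) (F : List A → Poly) →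
  ΣP (listsOfLength xs (j ℕ.+ k)) F ≈ ΣP (listsOfLength xs j) (λ c₁ → ΣP (listsOfLength xs k) (λ c₂ → F (c₁ ++ c₂)))
ΣP-lists-+ xs j k F = ΣP-lift _ _ λ k′ w → trans (Σℤ-lists-+ xs j k (λ c → coeff (F c) k′ w))
  (Σℤ-cong (listsOfLength xs j) (λ c₁ → sym (coeff-ΣP (listsOfLength xs k) (λ c₂ → F (c₁ ++ c₂)) k′ w)))

ΣP-lists-suc : {A : Set} (xs : List A) (k : ℕ) (F : List A → Poly) →
  ΣP (listsOfLength xs (suc k)) F ≈ ΣP xs (λ x → ΣP (listsOfLength xs k) (λ c → F (x ∷ c)))
ΣP-lists-suc xs k F = ≈-trans (ΣP-concatMap _ xs F) (ΣP-cong xs (λ x → ΣP-map (x ∷_) (listsOfLength xs k) F))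

ΣP-subsets-suc : (k : ℕ) (F : List Bool → Poly) →
  ΣP (subsets (suc k)) F ≈ ΣP (subsets k) (λ E → F (true ∷ E)) ++ ΣP (subsets k) (λ E → F (false ∷ E))
ΣP-subsets-suc k F = ≈-trans (ΣP-lists-suc _ k F) (++-cong (≈-refl {ΣP (subsets k) (λ E → F (true ∷ E))}) (++-identityʳ _))

ΣP-δ : {m : ℕ} (y : Fin m) (f : Fin m → Poly) → ΣP (allFin m) (λ z → ifP (z ≟ᵇ y) (f z)) ≈ f y
ΣP-δ y f = mk≈ λ k w → trans (coeff-ΣP _ _ k w)
  (trans (Σℤ-cong _ (λ z → coeff-ifP (z ≟ᵇ y) (f z) k w)) (Σℤ-δ y (λ z → coeff (f z) k w)))

ΣP-upTo-δ : (N K : ℕ) → K < N → (H : ℕ → Poly) → ΣP (upTo N) (λ k → ifP (K ≡ᵇ k) (H k)) ≈ H K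
ΣP-upTo-δ N K K<N H = mk≈ λ k′ w → trans (coeff-ΣP (upTo N) _ k′ w)
  (trans (Σℤ-cong (upTo N) (λ k → coeff-ifP (K ≡ᵇ k) (H k) k′ w)) (Σℤ-upTo-δ N K K<N (λ k → coeff (H k) k′ w)))

infix 30 y^_
-- Label sequences and the letters of u(M,E)

strictDecᵇ : List ℕ → Bool
strictDecᵇ []          = true
strictDecᵇ (a ∷ [])     = true
strictDecᵇ (a ∷ b ∷ l) = (b <ᵇ a) ∧ strictDecᵇ (b ∷ l)

≤ᵇ≡not-<ᵇ : ∀ a b → (a ≤ᵇ b) ≡ not (b <ᵇ a)
≤ᵇ≡not-<ᵇ zero    b       = refl
≤ᵇ≡not-<ᵇ (suc a) zero    = refl
≤ᵇ≡not-<ᵇ (suc a) (suc b) = trans (<ᵇ-suc a b) (≤ᵇ≡not-<ᵇ a b)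
  where
  <ᵇ-suc : ∀ a b → (a <ᵇ suc b) ≡ (a ≤ᵇ b)
  <ᵇ-suc zero    b = refl
  <ᵇ-suc (suc a) b = refl

−1^_ : ℕ → ℤ
−1^ zero  = 1ℤ
−1^ suc j = - (−1^ j)

decInc : ℕ → List ℕ → ℤ
decInc j L = ⟦ strictDecᵇ (take j L) ⟧ * ⟦ weaklyIncᵇ (drop j L) ⟧

decInc-++ : (L₁ L₂ : List ℕ) → decInc (length L₁) (L₁ ++ L₂) ≡ ⟦ strictDecᵇ L₁ ⟧ * ⟦ weaklyIncᵇ L₂ ⟧
decInc-++ L₁ L₂ = cong₂ (λ L L′ → ⟦ strictDecᵇ L ⟧ * ⟦ weaklyIncᵇ L′ ⟧) (take-length-++ L₁) (drop-length-++ L₁)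
  where
  take-length-++ : (L₁ : List ℕ) → take (length L₁) (L₁ ++ L₂) ≡ L₁
  take-length-++ []       = refl
  take-length-++ (a ∷ L₁) = cong (a ∷_) (take-length-++ L₁)
  drop-length-++ : (L₁ : List ℕ) → drop (length L₁) (L₁ ++ L₂) ≡ L₂
  drop-length-++ []       = refl
  drop-length-++ (a ∷ L₁) = drop-length-++ L₁

-- The j = 0 term is ⟦ weaklyIncᵇ (b ∷ L) ⟧; the others are −⟦ b <ᵇ a ⟧ times the same sum for b ∷ L.
Σ-alternating-decInc-after : (a : ℕ) (L : List ℕ) →
  Σℤ (upTo (suc (length L))) (λ j → −1^ j * (⟦ strictDecᵇ (a ∷ take j L) ⟧ * ⟦ weaklyIncᵇ (drop j L) ⟧))
    ≡ ⟦ weaklyIncᵇ (a ∷ L) ⟧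
Σ-alternating-decInc-after a []      = trans (Σℤ-single 0 _) refl
Σ-alternating-decInc-after a (b ∷ L) = begin
  Σℤ (upTo (suc (suc (length L)))) F
    ≡⟨ Σℤ-upTo-suc (suc (length L)) F ⟩
  F 0 + Σℤ (upTo (suc (length L))) (F ∘ suc)
    ≡⟨ cong₂ _+_ (trans (ℤP.*-identityˡ (1ℤ * W)) (ℤP.*-identityˡ W)) (Σℤ-cong (upTo (suc (length L))) (λ j →
         trans (cong (λ z → - (−1^ j) * (z * ⟦ weaklyIncᵇ (drop j L) ⟧)) (⟦∧⟧ (b <ᵇ a) _))
           (solve 4 (λ s p q r → (:- s) :* ((p :* q) :* r) := :- (p :* (s :* (q :* r)))) refl
             (−1^ j) ⟦ b <ᵇ a ⟧ ⟦ strictDecᵇ (b ∷ take j L) ⟧ ⟦ weaklyIncᵇ (drop j L) ⟧))) ⟩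
  W + Σℤ (upTo (suc (length L))) (λ j → - (⟦ b <ᵇ a ⟧ * (−1^ j * (⟦ strictDecᵇ (b ∷ take j L) ⟧ * ⟦ weaklyIncᵇ (drop j L) ⟧))))
    ≡⟨ cong (_+_ W) (trans (sym (Σℤ-neg _ _)) (cong -_ (sym (Σℤ-*ˡ ⟦ b <ᵇ a ⟧ _ _)))) ⟩
  W - ⟦ b <ᵇ a ⟧ * Σℤ (upTo (suc (length L))) (λ j → −1^ j * (⟦ strictDecᵇ (b ∷ take j L) ⟧ * ⟦ weaklyIncᵇ (drop j L) ⟧))
    ≡⟨ cong (λ z → W - ⟦ b <ᵇ a ⟧ * z) (Σ-alternating-decInc-after b L) ⟩
  W - ⟦ b <ᵇ a ⟧ * W
    ≡⟨ W-⟦⟧*W (b <ᵇ a) ⟩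
  ⟦ not (b <ᵇ a) ⟧ * W
    ≡⟨ cong (λ z → ⟦ z ⟧ * W) (sym (≤ᵇ≡not-<ᵇ a b)) ⟩
  ⟦ a ≤ᵇ b ⟧ * W
    ≡⟨ sym (⟦∧⟧ (a ≤ᵇ b) (weaklyIncᵇ (b ∷ L))) ⟩
  ⟦ weaklyIncᵇ (a ∷ b ∷ L) ⟧ ∎
  where
  open ≡-Reasoning
  F : ℕ → ℤ
  F j = −1^ j * (⟦ strictDecᵇ (a ∷ take j (b ∷ L)) ⟧ * ⟦ weaklyIncᵇ (drop j (b ∷ L)) ⟧)
  W = ⟦ weaklyIncᵇ (b ∷ L) ⟧
  W-⟦⟧*W : (c : Bool) → W - ⟦ c ⟧ * W ≡ ⟦ not c ⟧ * W
  W-⟦⟧*W true  = trans (cong (λ z → W - z) (ℤP.*-identityˡ W)) (ℤP.+-inverseʳ W)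
  W-⟦⟧*W false = trans (ℤP.+-identityʳ W) (sym (ℤP.*-identityˡ W))

Σ-alternating-decInc≡0 : (a : ℕ) (L : List ℕ) →
  Σℤ (upTo (suc (length (a ∷ L)))) (λ j → −1^ j * decInc j (a ∷ L)) ≡ 0ℤ
Σ-alternating-decInc≡0 a L = begin
  Σℤ (upTo (suc (suc (length L)))) (λ j → −1^ j * decInc j (a ∷ L))
    ≡⟨ Σℤ-upTo-suc (suc (length L)) _ ⟩
  1ℤ * (1ℤ * W) + Σℤ (upTo (suc (length L))) (λ j → - (−1^ j) * (⟦ strictDecᵇ (a ∷ take j L) ⟧ * ⟦ weaklyIncᵇ (drop j L) ⟧))
    ≡⟨ cong₂ _+_ (trans (ℤP.*-identityˡ (1ℤ * W)) (ℤP.*-identityˡ W))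
         (trans (Σℤ-cong _ (λ j → sym (ℤP.neg-distribˡ-* (−1^ j) _))) (sym (Σℤ-neg _ _))) ⟩
  W - Σℤ (upTo (suc (length L))) (λ j → −1^ j * (⟦ strictDecᵇ (a ∷ take j L) ⟧ * ⟦ weaklyIncᵇ (drop j L) ⟧))
    ≡⟨ cong (_-_ W) (Σ-alternating-decInc-after a L) ⟩
  W - W
    ≡⟨ ℤP.+-inverseʳ W ⟩
  0ℤ ∎
  where
  open ≡-Reasoning
  W = ⟦ weaklyIncᵇ (a ∷ L) ⟧

-- The letter v_i of u(M,E) is 𝐚, for consecutive labels ℓ ≤ ℓ′ (u_i = 𝐚) or ℓ > ℓ′ (u_i = 𝐛)
-- and e = [i−1 ∈ E], e′ = [i ∈ E].
isA : ℕ → Bool → ℕ → Bool → Bool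
isA ℓ e ℓ′ e′ = if ℓ ≤ᵇ ℓ′ then not e′ else e

allA : List ℕ → List Bool → Bool
allA (a ∷ b ∷ L) (e ∷ f ∷ E) = isA a e b f ∧ allA (b ∷ L) (f ∷ E)
allA _           _           = true

isA-tt : ∀ a b → isA a true b true ≡ (b <ᵇ a)
isA-tt a b with a ≤ᵇ b in a≤b
... | true  = trans (cong not (sym a≤b)) (trans (cong not (≤ᵇ≡not-<ᵇ a b)) (𝔹P.not-involutive _))
... | false = sym (trans (sym (𝔹P.not-involutive _)) (trans (cong not (sym (≤ᵇ≡not-<ᵇ a b))) (cong not a≤b)))

isA-tf : ∀ a b → isA a true b false ≡ true
isA-tf a b with a ≤ᵇ b
... | true  = refl
... | false = refl

isA-ft : ∀ a b → isA a false b true ≡ false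
isA-ft a b with a ≤ᵇ b
... | true  = refl
... | false = refl

isA-ff : ∀ a b → isA a false b false ≡ (a ≤ᵇ b)
isA-ff a b with a ≤ᵇ b
... | true  = refl
... | false = refl

-- If the first step is not in E, then no step is, and the labels must weakly increase throughout.
Σ-allA-false∷ : (a : ℕ) (L : List ℕ) (ψ : ℕ → ℤ) →
  Σℤ (subsets (length L)) (λ E → ⟦ allA (a ∷ L) (false ∷ E) ⟧ * ψ (countTrue E)) ≡ ψ 0 * ⟦ weaklyIncᵇ (a ∷ L) ⟧
Σ-allA-false∷ a []      ψ = trans (Σℤ-subsets-zero _) (trans (ℤP.*-identityˡ (ψ 0)) (sym (ℤP.*-identityʳ (ψ 0))))
Σ-allA-false∷ a (b ∷ L) ψ = begin
  Σℤ (subsets (suc (length L))) (λ E → ⟦ allA (a ∷ b ∷ L) (false ∷ E) ⟧ * ψ (countTrue E))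
    ≡⟨ Σℤ-subsets-suc (length L) _ ⟩
  Σℤ (subsets (length L)) (λ E → ⟦ isA a false b true ∧ allA (b ∷ L) (true ∷ E) ⟧ * ψ (suc (countTrue E)))
    + Σℤ (subsets (length L)) (λ E → ⟦ isA a false b false ∧ allA (b ∷ L) (false ∷ E) ⟧ * ψ (countTrue E))
    ≡⟨ cong₂ _+_ (Σℤ-zero _ (λ E → cong (λ z → ⟦ z ∧ _ ⟧ * ψ (suc (countTrue E))) (isA-ft a b)))
         (Σℤ-cong _ (λ E → trans (cong (λ z → ⟦ z ∧ allA (b ∷ L) (false ∷ E) ⟧ * ψ (countTrue E)) (isA-ff a b))
           (trans (cong (_* ψ (countTrue E)) (⟦∧⟧ (a ≤ᵇ b) _)) (ℤP.*-assoc ⟦ a ≤ᵇ b ⟧ _ _)))) ⟩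
  0ℤ + Σℤ (subsets (length L)) (λ E → ⟦ a ≤ᵇ b ⟧ * (⟦ allA (b ∷ L) (false ∷ E) ⟧ * ψ (countTrue E)))
    ≡⟨ trans (ℤP.+-identityˡ _) (sym (Σℤ-*ˡ ⟦ a ≤ᵇ b ⟧ _ _)) ⟩
  ⟦ a ≤ᵇ b ⟧ * Σℤ (subsets (length L)) (λ E → ⟦ allA (b ∷ L) (false ∷ E) ⟧ * ψ (countTrue E))
    ≡⟨ cong (⟦ a ≤ᵇ b ⟧ *_) (Σ-allA-false∷ b L ψ) ⟩
  ⟦ a ≤ᵇ b ⟧ * (ψ 0 * ⟦ weaklyIncᵇ (b ∷ L) ⟧)
    ≡⟨ solve 3 (λ p q r → p :* (q :* r) := q :* (p :* r)) refl ⟦ a ≤ᵇ b ⟧ (ψ 0) ⟦ weaklyIncᵇ (b ∷ L) ⟧ ⟩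
  ψ 0 * (⟦ a ≤ᵇ b ⟧ * ⟦ weaklyIncᵇ (b ∷ L) ⟧)
    ≡⟨ cong (ψ 0 *_) (sym (⟦∧⟧ (a ≤ᵇ b) _)) ⟩
  ψ 0 * ⟦ weaklyIncᵇ (a ∷ b ∷ L) ⟧ ∎
  where open ≡-Reasoning

Σ-allA-true∷ : (a : ℕ) (L : List ℕ) (ψ : ℕ → ℤ) →
  Σℤ (subsets (length L)) (λ E → ⟦ allA (a ∷ L) (true ∷ E) ⟧ * ψ (suc (countTrue E)))
    ≡ Σℤ (upTo (suc (length L))) (λ j → ψ (suc j) * (⟦ strictDecᵇ (a ∷ take j L) ⟧ * ⟦ weaklyIncᵇ (drop j L) ⟧))
Σ-allA-true∷ a []      ψ = trans (Σℤ-subsets-zero _)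
  (trans (ℤP.*-identityˡ (ψ 1)) (sym (trans (Σℤ-single 0 _) (ℤP.*-identityʳ (ψ 1)))))
Σ-allA-true∷ a (b ∷ L) ψ = begin
  Σℤ (subsets (suc (length L))) (λ E → ⟦ allA (a ∷ b ∷ L) (true ∷ E) ⟧ * ψ (suc (countTrue E)))
    ≡⟨ Σℤ-subsets-suc (length L) _ ⟩
  Σℤ (subsets (length L)) (λ E → ⟦ isA a true b true ∧ allA (b ∷ L) (true ∷ E) ⟧ * ψ (suc (suc (countTrue E))))
    + Σℤ (subsets (length L)) (λ E → ⟦ isA a true b false ∧ allA (b ∷ L) (false ∷ E) ⟧ * ψ (suc (countTrue E)))
    ≡⟨ cong₂ _+_
         (Σℤ-cong _ (λ E → trans (cong (λ z → ⟦ z ∧ allA (b ∷ L) (true ∷ E) ⟧ * ψ (suc (suc (countTrue E)))) (isA-tt a b))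
           (trans (cong (_* ψ (suc (suc (countTrue E)))) (⟦∧⟧ (b <ᵇ a) _)) (ℤP.*-assoc ⟦ b <ᵇ a ⟧ _ _))))
         (Σℤ-cong _ (λ E → cong (λ z → ⟦ z ∧ allA (b ∷ L) (false ∷ E) ⟧ * ψ (suc (countTrue E))) (isA-tf a b))) ⟩
  Σℤ (subsets (length L)) (λ E → ⟦ b <ᵇ a ⟧ * (⟦ allA (b ∷ L) (true ∷ E) ⟧ * ψ (suc (suc (countTrue E)))))
    + Σℤ (subsets (length L)) (λ E → ⟦ allA (b ∷ L) (false ∷ E) ⟧ * ψ (suc (countTrue E)))
    ≡⟨ cong₂ _+_ (trans (sym (Σℤ-*ˡ ⟦ b <ᵇ a ⟧ _ _)) (cong (⟦ b <ᵇ a ⟧ *_) (Σ-allA-true∷ b L (ψ ∘ suc))))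
                 (Σ-allA-false∷ b L (ψ ∘ suc)) ⟩
  ⟦ b <ᵇ a ⟧ * Σℤ (upTo (suc (length L))) (λ j → ψ (suc (suc j)) * (⟦ strictDecᵇ (b ∷ take j L) ⟧ * ⟦ weaklyIncᵇ (drop j L) ⟧))
    + ψ 1 * ⟦ weaklyIncᵇ (b ∷ L) ⟧
    ≡⟨ trans (ℤP.+-comm (⟦ b <ᵇ a ⟧ * _) (ψ 1 * W)) (cong₂ _+_ (cong (ψ 1 *_) (sym (ℤP.*-identityˡ W))) descent-at-a) ⟩
  ψ 1 * (1ℤ * ⟦ weaklyIncᵇ (b ∷ L) ⟧)
    + Σℤ (upTo (suc (length L))) (λ j → ψ (suc (suc j)) * (⟦ strictDecᵇ (a ∷ b ∷ take j L) ⟧ * ⟦ weaklyIncᵇ (drop j L) ⟧))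
    ≡⟨ sym (Σℤ-upTo-suc (suc (length L)) _) ⟩
  Σℤ (upTo (suc (length (b ∷ L)))) (λ j → ψ (suc j) * (⟦ strictDecᵇ (a ∷ take j (b ∷ L)) ⟧ * ⟦ weaklyIncᵇ (drop j (b ∷ L)) ⟧)) ∎
  where
  open ≡-Reasoning
  W = ⟦ weaklyIncᵇ (b ∷ L) ⟧
  descent-at-a : ⟦ b <ᵇ a ⟧ * Σℤ (upTo (suc (length L))) (λ j → ψ (suc (suc j)) * (⟦ strictDecᵇ (b ∷ take j L) ⟧ * ⟦ weaklyIncᵇ (drop j L) ⟧))
    ≡ Σℤ (upTo (suc (length L))) (λ j → ψ (suc (suc j)) * (⟦ strictDecᵇ (a ∷ b ∷ take j L) ⟧ * ⟦ weaklyIncᵇ (drop j L) ⟧))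
  descent-at-a = trans (Σℤ-*ˡ ⟦ b <ᵇ a ⟧ _ _) (Σℤ-cong _ (λ j → trans
    (solve 4 (λ p q r s → p :* (q :* (r :* s)) := q :* ((p :* r) :* s)) refl
      ⟦ b <ᵇ a ⟧ (ψ (suc (suc j))) ⟦ strictDecᵇ (b ∷ take j L) ⟧ ⟦ weaklyIncᵇ (drop j L) ⟧)
    (cong (λ z → ψ (suc (suc j)) * (z * ⟦ weaklyIncᵇ (drop j L) ⟧)) (sym (⟦∧⟧ (b <ᵇ a) _)))))

-- allA forces E to be an initial segment {1,…,j} of the steps, along which the labels strictly decrease
-- and after which they weakly increase.
Σ-allA≡Σ-decInc : (L : List ℕ) (ψ : ℕ → ℤ) →
  Σℤ (subsets (length L)) (λ E → ⟦ allA L E ⟧ * ψ (countTrue E)) ≡ Σℤ (upTo (suc (length L))) (λ j → ψ j * decInc j L)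
Σ-allA≡Σ-decInc []      ψ = trans (Σℤ-subsets-zero _)
  (trans (ℤP.*-identityˡ (ψ 0)) (sym (trans (Σℤ-single 0 _) (ℤP.*-identityʳ (ψ 0)))))
Σ-allA≡Σ-decInc (a ∷ L) ψ = begin
  Σℤ (subsets (suc (length L))) (λ E → ⟦ allA (a ∷ L) E ⟧ * ψ (countTrue E))
    ≡⟨ Σℤ-subsets-suc (length L) _ ⟩
  Σℤ (subsets (length L)) (λ E → ⟦ allA (a ∷ L) (true ∷ E) ⟧ * ψ (suc (countTrue E)))
    + Σℤ (subsets (length L)) (λ E → ⟦ allA (a ∷ L) (false ∷ E) ⟧ * ψ (countTrue E))
    ≡⟨ trans (cong₂ _+_ (Σ-allA-true∷ a L ψ) (Σ-allA-false∷ a L ψ)) (ℤP.+-comm (Σℤ (upTo (suc (length L))) _) (ψ 0 * W)) ⟩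
  ψ 0 * ⟦ weaklyIncᵇ (a ∷ L) ⟧
    + Σℤ (upTo (suc (length L))) (λ j → ψ (suc j) * (⟦ strictDecᵇ (a ∷ take j L) ⟧ * ⟦ weaklyIncᵇ (drop j L) ⟧))
    ≡⟨ cong (λ z → ψ 0 * z + Σℤ (upTo (suc (length L))) (λ j → ψ (suc j) * decInc (suc j) (a ∷ L))) (sym (ℤP.*-identityˡ W)) ⟩
  ψ 0 * decInc 0 (a ∷ L) + Σℤ (upTo (suc (length L))) (λ j → ψ (suc j) * decInc (suc j) (a ∷ L))
    ≡⟨ sym (Σℤ-upTo-suc (suc (length L)) _) ⟩
  Σℤ (upTo (suc (length (a ∷ L)))) (λ j → ψ j * decInc j (a ∷ L)) ∎
  where
  open ≡-Reasoning
  W = ⟦ weaklyIncᵇ (a ∷ L) ⟧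

countTrue-++ : (E₁ E₂ : List Bool) → countTrue (E₁ ++ E₂) ≡ countTrue E₁ ℕ.+ countTrue E₂
countTrue-++ []           E₂ = refl
countTrue-++ (true ∷ E₁)  E₂ = cong suc (countTrue-++ E₁ E₂)
countTrue-++ (false ∷ E₁) E₂ = countTrue-++ E₁ E₂

-- The list of [v_i = 𝐚] along the labels L, given the label ℓ and flag e of the preceding position.
aMask : ℕ → Bool → List ℕ → List Bool → List Bool
aMask ℓ e (ℓ′ ∷ L) (e′ ∷ E) = isA ℓ e ℓ′ e′ ∷ aMask ℓ′ e′ L E
aMask _ _ _        _        = []

-- Given the list of [v_i = 𝐚]: every position outside S carries the letter 𝐚.
coveredBy : List Bool → List Bool → Bool
coveredBy (s ∷ S) (c ∷ cs) = (s ∨ c) ∧ coveredBy S cs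
coveredBy _       _        = true

bsIn : List Bool → ℕ → Bool → List ℕ → List Bool → Bool
bsIn S ℓ e L E = coveredBy S (aMask ℓ e L E)

bsIn-falses : (k a : ℕ) (e : Bool) (L : List ℕ) (E : List Bool) → length L ≡ k → length E ≡ k →
  bsIn (replicate k false) a e L E ≡ allA (a ∷ L) (e ∷ E)
bsIn-falses zero    a e []      []      _    _    = refl
bsIn-falses (suc k) a e (b ∷ L) (f ∷ E) len₁ len₂ =
  cong (isA a e b f ∧_) (bsIn-falses k b f L E (ℕP.suc-injective len₁) (ℕP.suc-injective len₂))

startsWithTrue : List Bool → Set
startsWithTrue []          = ⊤
startsWithTrue (true ∷ _)  = ⊤
startsWithTrue (false ∷ _) = ⊥

-- The first position of S is allowed to be 𝐛, so the preceding label and flag do not matter.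
bsIn-state : (S : List Bool) → startsWithTrue S → (ℓ ℓ′ : ℕ) (e e′ : Bool) (L : List ℕ) (E : List Bool) →
  bsIn S ℓ e L E ≡ bsIn S ℓ′ e′ L E
bsIn-state []         _ ℓ ℓ′ e e′ L       E       = refl
bsIn-state (true ∷ S) _ ℓ ℓ′ e e′ []      E       = refl
bsIn-state (true ∷ S) _ ℓ ℓ′ e e′ (a ∷ L) []      = refl
bsIn-state (true ∷ S) _ ℓ ℓ′ e e′ (a ∷ L) (f ∷ E) = refl

bsIn-++ : (S₁ S₂ : List Bool) (ℓ : ℕ) (e : Bool) (L₁ L₂ : List ℕ) (E₁ E₂ : List Bool) →
  length L₁ ≡ length S₁ → length E₁ ≡ length S₁ → startsWithTrue S₂ →
  bsIn (S₁ ++ S₂) ℓ e (L₁ ++ L₂) (E₁ ++ E₂) ≡ bsIn S₁ ℓ e L₁ E₁ ∧ bsIn S₂ 0 false L₂ E₂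
bsIn-++ []       S₂ ℓ e []       L₂ []       E₂ _    _    S₂⊤ = bsIn-state S₂ S₂⊤ ℓ 0 e false L₂ E₂
bsIn-++ (s ∷ S₁) S₂ ℓ e (a ∷ L₁) L₂ (f ∷ E₁) E₂ len₁ len₂ S₂⊤ =
  trans (cong ((s ∨ isA ℓ e a f) ∧_) (bsIn-++ S₁ S₂ a f L₁ L₂ E₁ E₂ (ℕP.suc-injective len₁) (ℕP.suc-injective len₂) S₂⊤))
        (sym (𝔹P.∧-assoc (s ∨ isA ℓ e a f) _ _))

-- From the initial state (label 0, flag false) the first letter is 𝐚 exactly when step 1 is not in E.
Σ-bsIn-falses : (L : List ℕ) (ψ : ℕ → ℤ) →
  Σℤ (subsets (length L)) (λ E → ⟦ bsIn (replicate (length L) false) 0 false L E ⟧ * ψ (countTrue E))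
    ≡ ψ 0 * ⟦ weaklyIncᵇ L ⟧
Σ-bsIn-falses []      ψ = trans (Σℤ-subsets-zero _) (ℤP.*-comm 1ℤ (ψ 0))
Σ-bsIn-falses (a ∷ L) ψ = begin
  Σℤ (subsets (suc (length L))) (λ E → ⟦ bsIn (replicate (suc (length L)) false) 0 false (a ∷ L) E ⟧ * ψ (countTrue E))
    ≡⟨ Σℤ-subsets-suc (length L) _ ⟩
  Σℤ (subsets (length L)) (λ E → ⟦ isA 0 false a true ∧ bsIn (replicate (length L) false) a true L E ⟧ * ψ (suc (countTrue E)))
    + Σℤ (subsets (length L)) (λ E → ⟦ isA 0 false a false ∧ bsIn (replicate (length L) false) a false L E ⟧ * ψ (countTrue E))
    ≡⟨ cong₂ _+_ (Σℤ-zero (subsets (length L)) (λ E → cong (λ b → ⟦ b ∧ bsIn (replicate (length L) false) a true L E ⟧ * ψ (suc (countTrue E))) (isA-ft 0 a)))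
         (Σℤ-lists-cong _ (length L) (λ E len → cong (λ b → ⟦ b ⟧ * ψ (countTrue E))
           (trans (cong (_∧ bsIn (replicate (length L) false) a false L E) (isA-ff 0 a)) (bsIn-falses (length L) a false L E refl len)))) ⟩
  0ℤ + Σℤ (subsets (length L)) (λ E → ⟦ allA (a ∷ L) (false ∷ E) ⟧ * ψ (countTrue E))
    ≡⟨ trans (ℤP.+-identityˡ _) (Σ-allA-false∷ a L ψ) ⟩
  ψ 0 * ⟦ weaklyIncᵇ (a ∷ L) ⟧ ∎
  where open ≡-Reasoning

toLetter : Bool → Letter
toLetter true  = 𝐚
toLetter false = 𝐛

wtOf : List Bool → Poly
wtOf S = prodP (map (λ b → if b then bP else a-bP) S)

aP : Poly
aP = (+ 1 , 0 , 𝐚 ∷ []) ∷ []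

b+[a-b]≈a : bP ++ a-bP ≈ aP
b+[a-b]≈a = mk≈ λ k w → by-cases (0 ≡ᵇ k) ((𝐛 ∷ []) ==w w) ((𝐚 ∷ []) ==w w)
  where
  by-cases : (k≡0 w≡b w≡a : Bool) →
    (if k≡0 ∧ w≡b then + 1 else 0ℤ) + ((if k≡0 ∧ w≡a then + 1 else 0ℤ) + ((if k≡0 ∧ w≡b then - + 1 else 0ℤ) + 0ℤ))
      ≡ (if k≡0 ∧ w≡a then + 1 else 0ℤ) + 0ℤ
  by-cases false _     _     = refl
  by-cases true  true  true  = refl
  by-cases true  true  false = refl
  by-cases true  false true  = refl
  by-cases true  false false = refl

letterP : Bool → Poly
letterP b = if b then aP else bP

prod-letterP : (cs : List Bool) → prodP (map letterP cs) ≡ (+ 1 , 0 , map toLetter cs) ∷ []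
prod-letterP []           = refl
prod-letterP (true ∷ cs)  rewrite prod-letterP cs = refl
prod-letterP (false ∷ cs) rewrite prod-letterP cs = refl

-- At a position where 𝐚 is allowed, S may or may not contain it, contributing 𝐛 + (𝐚 − 𝐛) = 𝐚.
Σ-coveredBy-wtOf : (cs : List Bool) → ΣP (subsets (length cs)) (λ S → ifP (coveredBy S cs) (wtOf S)) ≈ prodP (map letterP cs)
Σ-coveredBy-wtOf []       = ΣP-single [] (λ S → ifP (coveredBy S []) (wtOf S))
Σ-coveredBy-wtOf (c ∷ cs) = begin
  ΣP (subsets (suc (length cs))) (λ S → ifP (coveredBy S (c ∷ cs)) (wtOf S))
    ≈⟨ ΣP-subsets-suc (length cs) _ ⟩
  ΣP (subsets (length cs)) (λ S → ifP (coveredBy S cs) (bP ⊗ wtOf S))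
    ++ ΣP (subsets (length cs)) (λ S → ifP (c ∧ coveredBy S cs) (a-bP ⊗ wtOf S))
    ≈⟨ ++-cong (ΣP-cong (subsets (length cs)) (λ S → ≈-sym (ifP-⊗ʳ (coveredBy S cs) bP (wtOf S))))
               (ΣP-cong (subsets (length cs)) (λ S → ≈-trans (≡⇒≈ (ifP-∧ c (coveredBy S cs) _))
                 (ifP-cong c (λ _ → ≈-sym (ifP-⊗ʳ (coveredBy S cs) a-bP (wtOf S)))))) ⟩
  ΣP (subsets (length cs)) (λ S → bP ⊗ ifP (coveredBy S cs) (wtOf S))
    ++ ΣP (subsets (length cs)) (λ S → ifP c (a-bP ⊗ ifP (coveredBy S cs) (wtOf S)))
    ≈⟨ ++-cong (≈-sym (ΣP-⊗ˡ bP (subsets (length cs)) _))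
               (≈-trans (ΣP-ifP (subsets (length cs)) c _) (ifP-cong c (λ _ → ≈-sym (ΣP-⊗ˡ a-bP (subsets (length cs)) _)))) ⟩
  (bP ⊗ X) ++ ifP c (a-bP ⊗ X)
    ≈⟨ by-letter c ⟩
  letterP c ⊗ X
    ≈⟨ ⊗-congʳ (letterP c) (Σ-coveredBy-wtOf cs) ⟩
  prodP (map letterP (c ∷ cs)) ∎
  where
  open ≈-Reasoning
  X = ΣP (subsets (length cs)) (λ S → ifP (coveredBy S cs) (wtOf S))
  by-letter : (c : Bool) → (bP ⊗ X) ++ ifP c (a-bP ⊗ X) ≈ letterP c ⊗ X
  by-letter true  = ≈-trans (≈-sym (⊗-distribʳ-++ bP a-bP X)) (⊗-congˡ X b+[a-b]≈a)
  by-letter false = ++-identityʳ _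

_==ᴺᴸ_ : List ℕ → List ℕ → Bool
[]       ==ᴺᴸ []       = true
(a ∷ as) ==ᴺᴸ (b ∷ bs) = (a ≡ᵇ b) ∧ (as ==ᴺᴸ bs)
_        ==ᴺᴸ _        = false

==ᴺᴸ-sound : (as bs : List ℕ) → (as ==ᴺᴸ bs) ≡ true → as ≡ bs
==ᴺᴸ-sound []       []       eq = refl
==ᴺᴸ-sound (a ∷ as) (b ∷ bs) eq = cong₂ _∷_ (≡ᵇ⇒≡ (∧-true₁ eq)) (==ᴺᴸ-sound as bs (∧-true₂ eq))

positions : ℕ → List Bool → List ℕ
positions i []          = []
positions i (true ∷ S)  = i ∷ positions (suc i) S
positions i (false ∷ S) = positions (suc i) S

length-positions : (i : ℕ) (S : List Bool) → length (positions i S) ≤ length S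
length-positions i []          = z≤n
length-positions i (true ∷ S)  = s≤s (length-positions (suc i) S)
length-positions i (false ∷ S) = ℕP.m≤n⇒m≤1+n (length-positions (suc i) S)

elemᵇ : ℕ → List ℕ → Bool
elemᵇ i rs = any (λ r → r ≡ᵇ i) rs

indicator : ℕ → ℕ → List ℕ → List Bool
indicator i k rs = applyUpTo (λ j → elemᵇ (i ℕ.+ j) rs) k

StrictlyIncIn : ℕ → ℕ → List ℕ → Set
StrictlyIncIn lo hi []       = ⊤
StrictlyIncIn lo hi (r ∷ rs) = lo ≤ r × r < hi × StrictlyIncIn (suc r) hi rs

applyUpTo-cong : {A : Set} {f g : ℕ → A} (k : ℕ) → (∀ j → f j ≡ g j) → applyUpTo f k ≡ applyUpTo g k
applyUpTo-cong zero    eq = refl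
applyUpTo-cong (suc k) eq = cong₂ _∷_ (eq 0) (applyUpTo-cong k (λ j → eq (suc j)))

indicator-suc : (i k : ℕ) (rs : List ℕ) → indicator i (suc k) rs ≡ elemᵇ i rs ∷ indicator (suc i) k rs
indicator-suc i k rs = cong₂ _∷_ (cong (λ t → elemᵇ t rs) (ℕP.+-identityʳ i))
  (applyUpTo-cong k (λ j → cong (λ t → elemᵇ t rs) (ℕP.+-suc i j)))

elemᵇ-below : {lo hi j : ℕ} (rs : List ℕ) → StrictlyIncIn lo hi rs → j < lo → elemᵇ j rs ≡ false
elemᵇ-below []       _                   j<lo = refl
elemᵇ-below (r ∷ rs) (lo≤r , _ , inc) j<lo rewrite ≡ᵇ-> (ℕP.<-≤-trans j<lo lo≤r) =
  elemᵇ-below rs inc (ℕP.<-trans j<lo (ℕP.<-≤-trans (ℕP.n<1+n _) (s≤s lo≤r)))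

positions-above : (r lo : ℕ) (rs : List ℕ) (S : List Bool) → r < lo → ((r ∷ rs) ==ᴺᴸ positions lo S) ≡ false
positions-above r lo rs []          r<lo = refl
positions-above r lo rs (true ∷ S)  r<lo rewrite ≡ᵇ-< r<lo = refl
positions-above r lo rs (false ∷ S) r<lo = positions-above r (suc lo) rs S (ℕP.<-trans r<lo (ℕP.n<1+n lo))

indicator≡⇔positions : (i : ℕ) (S : List Bool) (rs : List ℕ) → StrictlyIncIn i (i ℕ.+ length S) rs →
  (indicator i (length S) rs ==ᴮᴸ S) ≡ (rs ==ᴺᴸ positions i S)
indicator≡⇔positions i []      []       _ = refl
indicator≡⇔positions i []      (r ∷ rs) (i≤r , r<i+0 , _) =
  ⊥-elim (ℕP.<-irrefl refl (ℕP.≤-<-trans i≤r (subst (r <_) (ℕP.+-identityʳ i) r<i+0)))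
indicator≡⇔positions i (s ∷ S) rs inc =
  trans (cong (_==ᴮᴸ (s ∷ S)) (indicator-suc i (length S) rs)) (head-and-tail s rs inc)
  where
  shift : ∀ {lo rs} → StrictlyIncIn lo (i ℕ.+ suc (length S)) rs → StrictlyIncIn lo (suc i ℕ.+ length S) rs
  shift {lo} {rs} = subst (λ h → StrictlyIncIn lo h rs) (ℕP.+-suc i (length S))
  head-and-tail : (s : Bool) (rs : List ℕ) → StrictlyIncIn i (i ℕ.+ suc (length S)) rs →
    ((elemᵇ i rs ==ᴮ s) ∧ (indicator (suc i) (length S) rs ==ᴮᴸ S)) ≡ (rs ==ᴺᴸ positions i (s ∷ S))
  head-and-tail true  []       _ = refl
  head-and-tail false []       _ = indicator≡⇔positions (suc i) S [] tt
  head-and-tail s     (r ∷ rs) (i≤r , r<h , inc) with ℕP.m≤n⇒m<n∨m≡n i≤r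
  ... | inj₂ refl
    rewrite ≡ᵇ-refl i
          | applyUpTo-cong {f = λ j → elemᵇ (suc i ℕ.+ j) (i ∷ rs)} {g = λ j → elemᵇ (suc i ℕ.+ j) rs} (length S)
              (λ j → cong (_∨ elemᵇ (suc i ℕ.+ j) rs) (≡ᵇ-< (s≤s (ℕP.m≤m+n i j))))
          = at-head s
    where
    at-head : (s : Bool) → ((true ==ᴮ s) ∧ (indicator (suc i) (length S) rs ==ᴮᴸ S)) ≡ ((i ∷ rs) ==ᴺᴸ positions i (s ∷ S))
    at-head true  rewrite ≡ᵇ-refl i = indicator≡⇔positions (suc i) S rs (shift inc)
    at-head false = sym (positions-above i (suc i) rs S (ℕP.n<1+n i))
  ... | inj₁ i<r rewrite elemᵇ-below {suc i} {i ℕ.+ suc (length S)} {i} (r ∷ rs) (i<r , r<h , inc) (ℕP.n<1+n i) = above-head s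
    where
    above-head : (s : Bool) → ((false ==ᴮ s) ∧ (indicator (suc i) (length S) (r ∷ rs) ==ᴮᴸ S)) ≡ ((r ∷ rs) ==ᴺᴸ positions i (s ∷ S))
    above-head true  rewrite ≡ᵇ-> i<r = refl
    above-head false = indicator≡⇔positions (suc i) S (r ∷ rs) (shift {suc i} {r ∷ rs} (i<r , r<h , inc))

falses-++-false∷ : (j : ℕ) (S : List Bool) → replicate j false ++ (false ∷ S) ≡ replicate (suc j) false ++ S
falses-++-false∷ zero    S = refl
falses-++-false∷ (suc j) S = cong (false ∷_) (falses-++-false∷ j S)

module RLabeled {n : ℕ} (P : FinPoset) (G : IsGraded P n)
                (lab : Fin (FinPoset.m P) → Fin (FinPoset.m P) → ℕ) (RL : IsRLabeling P lab) where

  open FinPoset P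
  open IsGraded G
  open IsRLabeling RL

  maxChain : Fin m → Fin m → List (Fin m) → Bool
  maxChain = satChainᵇ P

  labels : Fin m → List (Fin m) → List ℕ
  labels = labelsAlong P lab

  endpoint : Fin m → List (Fin m) → Fin m
  endpoint x []      = x
  endpoint x (z ∷ c) = endpoint z c

  Chains : ℕ → List (List (Fin m))
  Chains = listsOfLength (allFin m)

  ≤-refl : (x : Fin m) → leq x x ≡ true
  ≤-refl x = T⇒≡true (reflexive x)

  ≤-trans : {x y z : Fin m} → leq x y ≡ true → leq y z ≡ true → leq x z ≡ true
  ≤-trans {x} {y} {z} x≤y y≤z = T⇒≡true (transitive x y z (≡true⇒T x≤y) (≡true⇒T y≤z))

  maxChain⇒≤ : {x y : Fin m} (c : List (Fin m)) → maxChain x y c ≡ true → leq x y ≡ true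
  maxChain⇒≤ {x} []      eq with refl ← ≟ᵇ-sound eq = ≤-refl x
  maxChain⇒≤     (a ∷ c) eq = ≤-trans (∧-true₁ (∧-true₁ (∧-true₁ eq))) (maxChain⇒≤ c (∧-true₂ eq))

  ≰⇒¬maxChain : {x y : Fin m} → leq x y ≡ false → (c : List (Fin m)) → maxChain x y c ≡ false
  ≰⇒¬maxChain {x} {y} x≰y c with maxChain x y c in eq
  ... | true  with () ← trans (sym x≰y) (maxChain⇒≤ c eq)
  ... | false = refl

  maxChain-endpoint : {x y : Fin m} (c : List (Fin m)) → maxChain x y c ≡ true → endpoint x c ≡ y
  maxChain-endpoint []      eq = ≟ᵇ-sound eq
  maxChain-endpoint (a ∷ c) eq = maxChain-endpoint c (∧-true₂ eq)

  maxChain-++ : {x z y : Fin m} (c₁ c₂ : List (Fin m)) →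
    maxChain x z c₁ ≡ true → maxChain z y c₂ ≡ true → maxChain x y (c₁ ++ c₂) ≡ true
  maxChain-++ []       c₂ eq₁ eq₂ with refl ← ≟ᵇ-sound eq₁ = eq₂
  maxChain-++ (a ∷ c₁) c₂ eq₁ eq₂ = cong₂ _∧_ (∧-true₁ eq₁) (maxChain-++ c₁ c₂ (∧-true₂ eq₁) eq₂)

  ⟦maxChain-++⟧ : (x y : Fin m) (c₁ c₂ : List (Fin m)) →
    ⟦ maxChain x y (c₁ ++ c₂) ⟧ ≡ Σℤ (allFin m) (λ z → ⟦ maxChain x z c₁ ⟧ * ⟦ maxChain z y c₂ ⟧)
  ⟦maxChain-++⟧ x y [] c₂ =
    sym (trans (Σℤ-cong (allFin m) (λ z → cong (λ b → ⟦ b ⟧ * ⟦ maxChain z y c₂ ⟧) (≟ᵇ-sym x z))) (Σℤ-δ x _))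
  ⟦maxChain-++⟧ x y (a ∷ c₁) c₂ = begin
    ⟦ covᵇ P x a ∧ maxChain a y (c₁ ++ c₂) ⟧
      ≡⟨ trans (⟦∧⟧ (covᵇ P x a) _) (cong (⟦ covᵇ P x a ⟧ *_) (⟦maxChain-++⟧ a y c₁ c₂)) ⟩
    ⟦ covᵇ P x a ⟧ * Σℤ (allFin m) (λ z → ⟦ maxChain a z c₁ ⟧ * ⟦ maxChain z y c₂ ⟧)
      ≡⟨ Σℤ-*ˡ ⟦ covᵇ P x a ⟧ (allFin m) _ ⟩
    Σℤ (allFin m) (λ z → ⟦ covᵇ P x a ⟧ * (⟦ maxChain a z c₁ ⟧ * ⟦ maxChain z y c₂ ⟧))
      ≡⟨ Σℤ-cong (allFin m) (λ z → trans (sym (ℤP.*-assoc ⟦ covᵇ P x a ⟧ _ _))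
           (cong (_* ⟦ maxChain z y c₂ ⟧) (sym (⟦∧⟧ (covᵇ P x a) (maxChain a z c₁))))) ⟩
    Σℤ (allFin m) (λ z → ⟦ covᵇ P x a ∧ maxChain a z c₁ ⟧ * ⟦ maxChain z y c₂ ⟧) ∎
    where open ≡-Reasoning

  labels-++ : (x : Fin m) (c₁ c₂ : List (Fin m)) → labels x (c₁ ++ c₂) ≡ labels x c₁ ++ labels (endpoint x c₁) c₂
  labels-++ x []       c₂ = refl
  labels-++ x (a ∷ c₁) c₂ = cong (lab x a ∷_) (labels-++ a c₁ c₂)

  length-labels : (x : Fin m) (c : List (Fin m)) → length (labels x c) ≡ length c
  length-labels x []      = refl
  length-labels x (a ∷ c) = cong suc (length-labels a c)

  maxChain-exists : {x y : Fin m} → leq x y ≡ true → Σ (List (Fin m)) (λ c → maxChain x y c ≡ true)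
  maxChain-exists {x} {y} x≤y with unique-inc x y (≡true⇒T x≤y)
  ... | c , inc , _ = c , ∧-true₁ (T⇒≡true inc)

  rank-maxChain : {x y : Fin m} (c : List (Fin m)) → maxChain x y c ≡ true → rank y ≡ rank x ℕ.+ length c
  rank-maxChain {x} {y} c eq with maxChain-exists {bot} {x} (T⇒≡true (botMin x))
  ... | c₀ , eq₀ = trans (sym (graded y (c₀ ++ c) (≡true⇒T (maxChain-++ c₀ c eq₀ eq))))
    (trans (ListP.length-++ c₀) (cong (ℕ._+ length c) (graded x c₀ (≡true⇒T eq₀))))

  ≤⇒rank≤ : {x y : Fin m} → leq x y ≡ true → rank x ≤ rank y
  ≤⇒rank≤ x≤y with maxChain-exists x≤y
  ... | c , eq = subst (rank _ ≤_) (sym (rank-maxChain c eq)) (ℕP.m≤m+n _ _)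

  ≤∧rank≡⇒≡ : {x y : Fin m} → leq x y ≡ true → rank x ≡ rank y → x ≡ y
  ≤∧rank≡⇒≡ {x} {y} x≤y r with maxChain-exists x≤y
  ... | []    , eq = ≟ᵇ-sound eq
  ... | a ∷ c , eq = ⊥-elim (ℕP.m≢1+m+n (rank x)
    (trans r (trans (rank-maxChain (a ∷ c) eq) (ℕP.+-suc (rank x) (length c)))))

  <⇒rank< : {x y : Fin m} → ltᵇ P x y ≡ true → rank x < rank y
  <⇒rank< {x} {y} x<y with ℕP.m≤n⇒m<n∨m≡n (≤⇒rank≤ (∧-true₁ x<y))
  ... | inj₁ r< = r<
  ... | inj₂ r≡ with () ← trans (sym (∧-true₂ x<y)) (cong not (trans (cong (x ≟ᵇ_) (sym (≤∧rank≡⇒≡ (∧-true₁ x<y) r≡))) (≟ᵇ-refl x)))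

  -- Chains with decreasing labels and the Möbius function

  Σℤ-Chains-none : (k : ℕ) (p : List (Fin m) → Bool) → (∀ c → length c ≡ k → p c ≡ false) →
    Σℤ (Chains k) (λ c → ⟦ p c ⟧) ≡ 0ℤ
  Σℤ-Chains-none k p none = trans (Σℤ-lists-cong (allFin m) k (λ c len → cong ⟦_⟧ (none c len)))
    (Σℤ-zero (Chains k) (λ _ → refl))

  decCount incCount : Fin m → Fin m → ℕ → ℤ
  decCount x w j = Σℤ (Chains j) (λ c → ⟦ maxChain x w c ∧ strictDecᵇ (labels x c) ⟧)
  incCount w z k = Σℤ (Chains k) (λ c → ⟦ maxChain w z c ∧ weaklyIncᵇ (labels w c) ⟧)

  decChains : Fin m → Fin m → ℤ
  decChains x w = decCount x w (rank w ℕ.∸ rank x)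

  -- The R-labeling: the unique weakly increasing maximal chain of [w,z] is the only chain counted.
  incCount≡ : (w z : Fin m) (k : ℕ) → incCount w z k ≡ ⟦ leq w z ∧ (rank z ≡ᵇ rank w ℕ.+ k) ⟧
  incCount≡ w z k with leq w z in w≤z
  ... | false = Σℤ-Chains-none k _ (λ c _ → cong (_∧ weaklyIncᵇ (labels w c)) (≰⇒¬maxChain w≤z c))
  ... | true with rank z ≡ᵇ rank w ℕ.+ k in rank≡
  ...   | false = Σℤ-Chains-none k _ wrong-length
    where
    wrong-length : (c : List (Fin m)) → length c ≡ k → (maxChain w z c ∧ weaklyIncᵇ (labels w c)) ≡ false
    wrong-length c len with maxChain w z c in eq
    ... | false = refl
    ... | true with () ← trans (sym rank≡) (≡⇒≡ᵇ (trans (rank-maxChain c eq) (cong (rank w ℕ.+_) len)))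
  ...   | true with unique-inc w z (≡true⇒T w≤z)
  ...     | c₀ , inc₀ , unique = Σℤ-lists-unique k _ c₀ len₀ (T⇒≡true inc₀) (λ c inc → unique c (≡true⇒T inc))
    where
    len₀ : length c₀ ≡ k
    len₀ = ℕP.+-cancelˡ-≡ (rank w) _ _ (trans (sym (rank-maxChain c₀ (∧-true₁ (T⇒≡true inc₀)))) (≡ᵇ⇒≡ rank≡))

  decCount≡ : (x w : Fin m) (j : ℕ) → decCount x w j ≡ ⟦ rank w ≡ᵇ rank x ℕ.+ j ⟧ * decChains x w
  decCount≡ x w j with rank w ≡ᵇ rank x ℕ.+ j in rank≡
  ... | true  = trans (cong (decCount x w) (sym (trans (cong (ℕ._∸ rank x) (≡ᵇ⇒≡ rank≡)) (ℕP.m+n∸m≡n (rank x) j))))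
                      (sym (ℤP.*-identityˡ (decChains x w)))
  ... | false = Σℤ-Chains-none j _ wrong-length
    where
    wrong-length : (c : List (Fin m)) → length c ≡ j → (maxChain x w c ∧ strictDecᵇ (labels x c)) ≡ false
    wrong-length c len with maxChain x w c in eq
    ... | false = refl
    ... | true with () ← trans (sym rank≡) (≡⇒≡ᵇ (trans (rank-maxChain c eq) (cong (rank x ℕ.+_) len)))

  decChains-≰ : {x w : Fin m} → leq x w ≡ false → decChains x w ≡ 0ℤ
  decChains-≰ {x} {w} x≰w =
    Σℤ-Chains-none (rank w ℕ.∸ rank x) _ (λ c _ → cong (_∧ strictDecᵇ (labels x c)) (≰⇒¬maxChain x≰w c))

  decChains-refl : (x : Fin m) → decChains x x ≡ 1ℤ
  decChains-refl x = trans (cong (decCount x x) (ℕP.n∸n≡0 (rank x)))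
    (trans (Σℤ-lists-zero (allFin m) _) (cong (λ b → ⟦ b ∧ true ⟧) (≟ᵇ-refl x)))

  decChains-nonneg : (x w : Fin m) → 0ℤ ℤ≤ decChains x w
  decChains-nonneg x w = Σℤ-nonneg (Chains (rank w ℕ.∸ rank x)) (λ c → ⟦⟧-nonneg (maxChain x w c ∧ strictDecᵇ (labels x c)))

  -- Cutting a chain at its j-th element w: the summand for w is nonzero only for the cut through w.
  ⟦maxChain⟧*decInc-++ : (x z : Fin m) (c₁ c₂ : List (Fin m)) →
    ⟦ maxChain x z (c₁ ++ c₂) ⟧ * decInc (length c₁) (labels x (c₁ ++ c₂))
      ≡ Σℤ (allFin m) (λ w → ⟦ maxChain x w c₁ ∧ strictDecᵇ (labels x c₁) ⟧ * ⟦ maxChain w z c₂ ∧ weaklyIncᵇ (labels w c₂) ⟧)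
  ⟦maxChain⟧*decInc-++ x z c₁ c₂ = begin
    ⟦ maxChain x z (c₁ ++ c₂) ⟧ * decInc (length c₁) (labels x (c₁ ++ c₂))
      ≡⟨ cong₂ _*_ (⟦maxChain-++⟧ x z c₁ c₂) (cong (decInc (length c₁)) (labels-++ x c₁ c₂)) ⟩
    Σℤ (allFin m) (λ w → ⟦ maxChain x w c₁ ⟧ * ⟦ maxChain w z c₂ ⟧) * decInc (length c₁) (labels x c₁ ++ labels (endpoint x c₁) c₂)
      ≡⟨ cong (Σℤ (allFin m) (λ w → ⟦ maxChain x w c₁ ⟧ * ⟦ maxChain w z c₂ ⟧) *_)
           (trans (cong (λ k → decInc k (labels x c₁ ++ labels (endpoint x c₁) c₂)) (sym (length-labels x c₁)))
             (decInc-++ (labels x c₁) (labels (endpoint x c₁) c₂))) ⟩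
    Σℤ (allFin m) (λ w → ⟦ maxChain x w c₁ ⟧ * ⟦ maxChain w z c₂ ⟧) * (⟦ strictDecᵇ (labels x c₁) ⟧ * ⟦ weaklyIncᵇ (labels (endpoint x c₁) c₂) ⟧)
      ≡⟨ trans (Σℤ-*ʳ _ (allFin m) _) (Σℤ-cong (allFin m) regroup) ⟩
    Σℤ (allFin m) (λ w → ⟦ maxChain x w c₁ ∧ strictDecᵇ (labels x c₁) ⟧ * ⟦ maxChain w z c₂ ∧ weaklyIncᵇ (labels w c₂) ⟧) ∎
    where
    open ≡-Reasoning
    regroup : (w : Fin m) → ⟦ maxChain x w c₁ ⟧ * ⟦ maxChain w z c₂ ⟧ * (⟦ strictDecᵇ (labels x c₁) ⟧ * ⟦ weaklyIncᵇ (labels (endpoint x c₁) c₂) ⟧)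
      ≡ ⟦ maxChain x w c₁ ∧ strictDecᵇ (labels x c₁) ⟧ * ⟦ maxChain w z c₂ ∧ weaklyIncᵇ (labels w c₂) ⟧
    regroup w with maxChain x w c₁ in eq
    ... | false = trans (cong (_* (⟦ strictDecᵇ (labels x c₁) ⟧ * ⟦ weaklyIncᵇ (labels (endpoint x c₁) c₂) ⟧))
                          (ℤP.*-zeroˡ ⟦ maxChain w z c₂ ⟧)) (ℤP.*-zeroˡ (⟦ strictDecᵇ (labels x c₁) ⟧ * ⟦ weaklyIncᵇ (labels (endpoint x c₁) c₂) ⟧))
    ... | true rewrite maxChain-endpoint c₁ eq =
      trans (solve 3 (λ p q r → con 1ℤ :* p :* (q :* r) := q :* (p :* r)) refl
               ⟦ maxChain w z c₂ ⟧ ⟦ strictDecᵇ (labels x c₁) ⟧ ⟦ weaklyIncᵇ (labels w c₂) ⟧)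
            (cong (⟦ strictDecᵇ (labels x c₁) ⟧ *_) (sym (⟦∧⟧ (maxChain w z c₂) _)))

  Σ-decInc≡Σ-dec*inc : (x z : Fin m) (d j : ℕ) → j ≤ d →
    Σℤ (Chains d) (λ c → ⟦ maxChain x z c ⟧ * decInc j (labels x c))
      ≡ Σℤ (allFin m) (λ w → decCount x w j * incCount w z (d ℕ.∸ j))
  Σ-decInc≡Σ-dec*inc x z d j j≤d = begin
    Σℤ (Chains d) F
      ≡⟨ cong (λ t → Σℤ (Chains t) F) (sym (ℕP.m+[n∸m]≡n j≤d)) ⟩
    Σℤ (Chains (j ℕ.+ k)) F
      ≡⟨ Σℤ-lists-+ (allFin m) j k F ⟩
    Σℤ (Chains j) (λ c₁ → Σℤ (Chains k) (λ c₂ → F (c₁ ++ c₂)))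
      ≡⟨ Σℤ-lists-cong (allFin m) j (λ c₁ len → Σℤ-cong (Chains k) (λ c₂ →
           trans (cong (λ i → ⟦ maxChain x z (c₁ ++ c₂) ⟧ * decInc i _) (sym len)) (⟦maxChain⟧*decInc-++ x z c₁ c₂))) ⟩
    Σℤ (Chains j) (λ c₁ → Σℤ (Chains k) (λ c₂ → Σℤ (allFin m) (λ w → D c₁ w * I w c₂)))
      ≡⟨ trans (Σℤ-cong (Chains j) (λ c₁ → Σℤ-swap (Chains k) (allFin m) _)) (Σℤ-swap (Chains j) (allFin m) _) ⟩
    Σℤ (allFin m) (λ w → Σℤ (Chains j) (λ c₁ → Σℤ (Chains k) (λ c₂ → D c₁ w * I w c₂)))
      ≡⟨ Σℤ-cong (allFin m) (λ w → sym (Σℤ-*-Σℤ (Chains j) (Chains k) (λ c₁ → D c₁ w) (I w))) ⟩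
    Σℤ (allFin m) (λ w → decCount x w j * incCount w z k) ∎
    where
    open ≡-Reasoning
    k = d ℕ.∸ j
    F : List (Fin m) → ℤ
    F c = ⟦ maxChain x z c ⟧ * decInc j (labels x c)
    D : List (Fin m) → Fin m → ℤ
    D c₁ w = ⟦ maxChain x w c₁ ∧ strictDecᵇ (labels x c₁) ⟧
    I : Fin m → List (Fin m) → ℤ
    I w c₂ = ⟦ maxChain w z c₂ ∧ weaklyIncᵇ (labels w c₂) ⟧

  +-≡ᵇ-+ : (a t j : ℕ) → (a ℕ.+ t ≡ᵇ a ℕ.+ j) ≡ (t ≡ᵇ j)
  +-≡ᵇ-+ zero    t j = refl
  +-≡ᵇ-+ (suc a) t j = +-≡ᵇ-+ a t j

  -- A chain of length d from x to z, descending for j steps, passes through a w of rank rank x + j.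
  dec*inc≡ : (x w z : Fin m) (d j : ℕ) → j ≤ d →
    decCount x w j * incCount w z (d ℕ.∸ j)
      ≡ ⟦ rank w ℕ.∸ rank x ≡ᵇ j ⟧ * (⟦ leq x w ∧ leq w z ∧ (rank z ≡ᵇ rank x ℕ.+ d) ⟧ * decChains x w)
  dec*inc≡ x w z d j j≤d with leq x w in x≤w
  ... | false = begin
    decCount x w j * incCount w z (d ℕ.∸ j)
      ≡⟨ cong (_* incCount w z (d ℕ.∸ j)) (trans (decCount≡ x w j) (cong (⟦ rank w ≡ᵇ rank x ℕ.+ j ⟧ *_) (decChains-≰ x≤w))) ⟩
    ⟦ rank w ≡ᵇ rank x ℕ.+ j ⟧ * 0ℤ * incCount w z (d ℕ.∸ j)
      ≡⟨ solve 2 (λ a b → a :* con 0ℤ :* b := con 0ℤ) refl ⟦ rank w ≡ᵇ rank x ℕ.+ j ⟧ (incCount w z (d ℕ.∸ j)) ⟩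
    0ℤ
      ≡⟨ sym (ℤP.*-zeroʳ ⟦ rank w ℕ.∸ rank x ≡ᵇ j ⟧) ⟩
    ⟦ rank w ℕ.∸ rank x ≡ᵇ j ⟧ * 0ℤ ∎
    where open ≡-Reasoning
  ... | true = begin
    decCount x w j * incCount w z (d ℕ.∸ j)
      ≡⟨ cong₂ _*_ (trans (decCount≡ x w j) (cong (λ r → ⟦ r ≡ᵇ rank x ℕ.+ j ⟧ * D) rw≡)) (incCount≡ w z (d ℕ.∸ j)) ⟩
    ⟦ rank x ℕ.+ t ≡ᵇ rank x ℕ.+ j ⟧ * D * ⟦ leq w z ∧ (rank z ≡ᵇ rank w ℕ.+ (d ℕ.∸ j)) ⟧
      ≡⟨ cong (λ b → ⟦ b ⟧ * D * ⟦ leq w z ∧ (rank z ≡ᵇ rank w ℕ.+ (d ℕ.∸ j)) ⟧) (+-≡ᵇ-+ (rank x) t j) ⟩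
    ⟦ t ≡ᵇ j ⟧ * D * ⟦ leq w z ∧ (rank z ≡ᵇ rank w ℕ.+ (d ℕ.∸ j)) ⟧
      ≡⟨ on-t≡j (t ≡ᵇ j) refl ⟩
    ⟦ t ≡ᵇ j ⟧ * (⟦ leq w z ∧ (rank z ≡ᵇ rank x ℕ.+ d) ⟧ * D) ∎
    where
    open ≡-Reasoning
    t = rank w ℕ.∸ rank x
    D = decChains x w
    rw≡ : rank w ≡ rank x ℕ.+ t
    rw≡ = sym (ℕP.m+[n∸m]≡n (≤⇒rank≤ x≤w))
    on-t≡j : (b : Bool) → (t ≡ᵇ j) ≡ b → ⟦ b ⟧ * D * ⟦ leq w z ∧ (rank z ≡ᵇ rank w ℕ.+ (d ℕ.∸ j)) ⟧
                                         ≡ ⟦ b ⟧ * (⟦ leq w z ∧ (rank z ≡ᵇ rank x ℕ.+ d) ⟧ * D)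
    on-t≡j false _ = refl
    on-t≡j true  t≡j = trans (cong (λ r → 1ℤ * D * ⟦ leq w z ∧ (rank z ≡ᵇ r) ⟧) rw+d-j≡rx+d)
      (solve 2 (λ a b → con 1ℤ :* a :* b := con 1ℤ :* (b :* a)) refl D ⟦ leq w z ∧ (rank z ≡ᵇ rank x ℕ.+ d) ⟧)
      where
      rw+d-j≡rx+d : rank w ℕ.+ (d ℕ.∸ j) ≡ rank x ℕ.+ d
      rw+d-j≡rx+d = begin
        rank w ℕ.+ (d ℕ.∸ j)           ≡⟨ cong (λ r → r ℕ.+ (d ℕ.∸ j)) (trans rw≡ (cong (rank x ℕ.+_) (≡ᵇ⇒≡ t≡j))) ⟩
        rank x ℕ.+ j ℕ.+ (d ℕ.∸ j)     ≡⟨ ℕP.+-assoc (rank x) j _ ⟩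
        rank x ℕ.+ (j ℕ.+ (d ℕ.∸ j))   ≡⟨ cong (rank x ℕ.+_) (ℕP.m+[n∸m]≡n j≤d) ⟩
        rank x ℕ.+ d ∎

  Σ-dec*inc : (x w z : Fin m) (d : ℕ) (φ : ℕ → ℤ) →
    Σℤ (upTo (suc d)) (λ j → φ j * (decCount x w j * incCount w z (d ℕ.∸ j)))
      ≡ ⟦ leq x w ∧ leq w z ∧ (rank z ≡ᵇ rank x ℕ.+ d) ⟧ * (φ (rank w ℕ.∸ rank x) * decChains x w)
  Σ-dec*inc x w z d φ = begin
    Σℤ (upTo (suc d)) (λ j → φ j * (decCount x w j * incCount w z (d ℕ.∸ j)))
      ≡⟨ Σℤ-upTo-cong (suc d) (λ j j<1+d → trans (cong (φ j *_) (dec*inc≡ x w z d j (ℕP.≤-pred j<1+d)))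
           (solve 3 (λ p q r → p :* (q :* r) := q :* (p :* r)) refl (φ j) ⟦ t ≡ᵇ j ⟧ (⟦ C ⟧ * D))) ⟩
    Σℤ (upTo (suc d)) (λ j → ⟦ t ≡ᵇ j ⟧ * (φ j * (⟦ C ⟧ * D)))
      ≡⟨ collapse C refl ⟩
    ⟦ C ⟧ * (φ t * D) ∎
    where
    open ≡-Reasoning
    t = rank w ℕ.∸ rank x
    D = decChains x w
    C = leq x w ∧ leq w z ∧ (rank z ≡ᵇ rank x ℕ.+ d)
    collapse : (b : Bool) → C ≡ b → Σℤ (upTo (suc d)) (λ j → ⟦ t ≡ᵇ j ⟧ * (φ j * (⟦ b ⟧ * D))) ≡ ⟦ b ⟧ * (φ t * D)
    collapse false _ = Σℤ-zero (upTo (suc d)) (λ j → solve 2 (λ a b → a :* (b :* (con 0ℤ :* con D)) := con 0ℤ) refl ⟦ t ≡ᵇ j ⟧ (φ j))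
    collapse true  C≡true = trans (Σℤ-upTo-δ (suc d) t (s≤s t≤d) (λ j → φ j * (1ℤ * D)))
      (solve 2 (λ a b → a :* (con 1ℤ :* b) := con 1ℤ :* (a :* b)) refl (φ t) D)
      where
      t≤d : t ≤ d
      t≤d = subst (t ≤_) (trans (cong (ℕ._∸ rank x) (≡ᵇ⇒≡ (∧-true₂ {leq w z} rest))) (ℕP.m+n∸m≡n (rank x) d))
        (ℕP.∸-monoˡ-≤ (rank x) (≤⇒rank≤ (∧-true₁ rest)))
        where
        rest = ∧-true₂ {leq x w} C≡true

  Σ-chains-decInc : (x z : Fin m) (d : ℕ) (φ : ℕ → ℤ) →
    Σℤ (Chains d) (λ c → ⟦ maxChain x z c ⟧ * Σℤ (upTo (suc d)) (λ j → φ j * decInc j (labels x c)))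
      ≡ Σℤ (allFin m) (λ w → ⟦ leq x w ∧ leq w z ∧ (rank z ≡ᵇ rank x ℕ.+ d) ⟧ * (φ (rank w ℕ.∸ rank x) * decChains x w))
  Σ-chains-decInc x z d φ = begin
    Σℤ (Chains d) (λ c → ⟦ maxChain x z c ⟧ * Σℤ (upTo (suc d)) (λ j → φ j * decInc j (labels x c)))
      ≡⟨ trans (Σℤ-cong (Chains d) (λ c → Σℤ-*ˡ ⟦ maxChain x z c ⟧ (upTo (suc d)) _)) (Σℤ-swap (Chains d) (upTo (suc d)) _) ⟩
    Σℤ (upTo (suc d)) (λ j → Σℤ (Chains d) (λ c → ⟦ maxChain x z c ⟧ * (φ j * decInc j (labels x c))))
      ≡⟨ Σℤ-cong (upTo (suc d)) (λ j → trans (Σℤ-cong (Chains d) (λ c →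
           solve 3 (λ a b c → a :* (b :* c) := b :* (a :* c)) refl ⟦ maxChain x z c ⟧ (φ j) (decInc j (labels x c))))
           (sym (Σℤ-*ˡ (φ j) (Chains d) _))) ⟩
    Σℤ (upTo (suc d)) (λ j → φ j * Σℤ (Chains d) (λ c → ⟦ maxChain x z c ⟧ * decInc j (labels x c)))
      ≡⟨ Σℤ-upTo-cong (suc d) (λ j j<1+d → cong (φ j *_) (Σ-decInc≡Σ-dec*inc x z d j (ℕP.≤-pred j<1+d))) ⟩
    Σℤ (upTo (suc d)) (λ j → φ j * Σℤ (allFin m) (λ w → decCount x w j * incCount w z (d ℕ.∸ j)))
      ≡⟨ trans (Σℤ-cong (upTo (suc d)) (λ j → Σℤ-*ˡ (φ j) (allFin m) _)) (Σℤ-swap (upTo (suc d)) (allFin m) _) ⟩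
    Σℤ (allFin m) (λ w → Σℤ (upTo (suc d)) (λ j → φ j * (decCount x w j * incCount w z (d ℕ.∸ j))))
      ≡⟨ Σℤ-cong (allFin m) (λ w → Σ-dec*inc x w z d φ) ⟩
    Σℤ (allFin m) (λ w → ⟦ leq x w ∧ leq w z ∧ (rank z ≡ᵇ rank x ℕ.+ d) ⟧ * (φ (rank w ℕ.∸ rank x) * decChains x w)) ∎
    where open ≡-Reasoning

  Σ-signed-decChains≡0 : (x z : Fin m) → leq x z ≡ true → ¬ x ≡ z →
    Σℤ (allFin m) (λ w → ⟦ leq x w ∧ leq w z ⟧ * (−1^ (rank w ℕ.∸ rank x) * decChains x w)) ≡ 0ℤ
  Σ-signed-decChains≡0 x z x≤z x≢z = begin
    Σℤ (allFin m) (λ w → ⟦ leq x w ∧ leq w z ⟧ * (−1^ (rank w ℕ.∸ rank x) * decChains x w))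
      ≡⟨ Σℤ-cong (allFin m) (λ w → cong (λ b → ⟦ leq x w ∧ b ⟧ * _)
           (trans (sym (𝔹P.∧-identityʳ (leq w z))) (cong (leq w z ∧_) (sym (≡⇒≡ᵇ rz≡))))) ⟩
    Σℤ (allFin m) (λ w → ⟦ leq x w ∧ leq w z ∧ (rank z ≡ᵇ rank x ℕ.+ d) ⟧ * (−1^ (rank w ℕ.∸ rank x) * decChains x w))
      ≡⟨ sym (Σ-chains-decInc x z d −1^_) ⟩
    Σℤ (Chains d) (λ c → ⟦ maxChain x z c ⟧ * Σℤ (upTo (suc d)) (λ j → −1^ j * decInc j (labels x c)))
      ≡⟨ Σℤ-lists-cong (allFin m) d (λ c len → trans (cong (⟦ maxChain x z c ⟧ *_) (alternating≡0 c len))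
           (ℤP.*-zeroʳ ⟦ maxChain x z c ⟧)) ⟩
    Σℤ (Chains d) (λ _ → 0ℤ)
      ≡⟨ Σℤ-zero (Chains d) (λ _ → refl) ⟩
    0ℤ ∎
    where
    open ≡-Reasoning
    d = rank z ℕ.∸ rank x
    rz≡ : rank z ≡ rank x ℕ.+ d
    rz≡ = sym (ℕP.m+[n∸m]≡n (≤⇒rank≤ x≤z))
    alternating≡0 : (c : List (Fin m)) → length c ≡ d → Σℤ (upTo (suc d)) (λ j → −1^ j * decInc j (labels x c)) ≡ 0ℤ
    alternating≡0 c len with labels x c | length-labels x c
    ... | []    | len₀ = ⊥-elim (x≢z (≤∧rank≡⇒≡ x≤z (sym (trans rz≡
      (trans (cong (rank x ℕ.+_) (trans (sym len) (sym len₀))) (ℕP.+-identityʳ (rank x)))))))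
    ... | a ∷ L | len₁ = trans (cong (λ k → Σℤ (upTo (suc k)) (λ j → −1^ j * decInc j (a ∷ L))) (trans (sym len) (sym len₁)))
      (Σ-alternating-decInc≡0 a L)

  μ-suc : (f : ℕ) (x w : Fin m) → muFuel P (suc f) x w ≡
    (if x ≟ᵇ w then 1ℤ else if leq x w then - Σℤ (allFin m) (λ z → ⟦ leq x z ∧ ltᵇ P z w ⟧ * muFuel P f x z) else 0ℤ)
  μ-suc f x w = cong (λ s → if x ≟ᵇ w then 1ℤ else if leq x w then - s else 0ℤ)
    (trans (sym (Σℤ-def _ _)) (trans (Σℤ-filter _ (allFin m) _) (Σℤ-cong (allFin m) (λ z → if-else-0≡⟦⟧* (leq x z ∧ ltᵇ P z w) (muFuel P f x z)))))

  signedDecChains : Fin m → Fin m → ℤ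
  signedDecChains x w = −1^ (rank w ℕ.∸ rank x) * decChains x w

  Σ-signedDecChains-below : (x w : Fin m) → leq x w ≡ true → ¬ x ≡ w →
    Σℤ (allFin m) (λ z → ⟦ leq x z ∧ ltᵇ P z w ⟧ * signedDecChains x z) ≡ - signedDecChains x w
  Σ-signedDecChains-below x w x≤w x≢w = inverseˡ-unique _ _ (begin
    Σℤ (allFin m) (λ z → ⟦ leq x z ∧ ltᵇ P z w ⟧ * S z) + S w
      ≡⟨ cong (_+_ (Σℤ (allFin m) (λ z → ⟦ leq x z ∧ ltᵇ P z w ⟧ * S z))) (sym (Σℤ-δ w S)) ⟩
    Σℤ (allFin m) (λ z → ⟦ leq x z ∧ ltᵇ P z w ⟧ * S z) + Σℤ (allFin m) (λ z → ⟦ z ≟ᵇ w ⟧ * S z)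
      ≡⟨ trans (sym (Σℤ-+ (allFin m) _ _)) (Σℤ-cong (allFin m) (λ z → sym (below-or-at z))) ⟩
    Σℤ (allFin m) (λ z → ⟦ leq x z ∧ leq z w ⟧ * S z)
      ≡⟨ Σ-signed-decChains≡0 x w x≤w x≢w ⟩
    0ℤ ∎)
    where
    open ≡-Reasoning
    S = signedDecChains x
    below-or-at : (z : Fin m) → ⟦ leq x z ∧ leq z w ⟧ * S z ≡ ⟦ leq x z ∧ ltᵇ P z w ⟧ * S z + ⟦ z ≟ᵇ w ⟧ * S z
    below-or-at z with z ≟ᵇ w in z≟w
    ... | false = trans (cong (λ b → ⟦ leq x z ∧ b ⟧ * S z) (sym (𝔹P.∧-identityʳ (leq z w)))) (sym (ℤP.+-identityʳ _))
    ... | true with refl ← ≟ᵇ-sound z≟w rewrite x≤w | ≤-refl z =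
      trans (sym (ℤP.+-identityˡ (1ℤ * S z))) (cong (_+ (1ℤ * S z)) (sym (ℤP.*-zeroˡ (S z))))

  μ≡signedDecChains : (f : ℕ) (x w : Fin m) → leq x w ≡ true → rank w ℕ.∸ rank x < f →
    muFuel P f x w ≡ signedDecChains x w
  μ≡signedDecChains (suc f) x w x≤w r<f = trans (μ-suc f x w) (by-cases (x ≟ᵇ w) refl)
    where
    open ≡-Reasoning
    by-cases : (b : Bool) → (x ≟ᵇ w) ≡ b →
      (if b then 1ℤ else if leq x w then - Σℤ (allFin m) (λ z → ⟦ leq x z ∧ ltᵇ P z w ⟧ * muFuel P f x z) else 0ℤ)
        ≡ signedDecChains x w
    by-cases true x≟w with refl ← ≟ᵇ-sound x≟w =
      sym (cong₂ (λ t D → −1^ t * D) (ℕP.n∸n≡0 (rank x)) (decChains-refl x))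
    by-cases false x≟w rewrite x≤w = begin
      - Σℤ (allFin m) (λ z → ⟦ leq x z ∧ ltᵇ P z w ⟧ * muFuel P f x z)
        ≡⟨ cong -_ (Σℤ-cong (allFin m) induction-hypothesis) ⟩
      - Σℤ (allFin m) (λ z → ⟦ leq x z ∧ ltᵇ P z w ⟧ * signedDecChains x z)
        ≡⟨ cong -_ (Σ-signedDecChains-below x w x≤w x≢w) ⟩
      - - signedDecChains x w
        ≡⟨ ℤP.neg-involutive _ ⟩
      signedDecChains x w ∎
      where
      x≢w : ¬ x ≡ w
      x≢w refl with () ← trans (sym (≟ᵇ-refl x)) x≟w
      induction-hypothesis : (z : Fin m) → ⟦ leq x z ∧ ltᵇ P z w ⟧ * muFuel P f x z ≡ ⟦ leq x z ∧ ltᵇ P z w ⟧ * signedDecChains x z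
      induction-hypothesis z with leq x z in x≤z | ltᵇ P z w in z<w
      ... | true  | true  = cong (1ℤ *_) (μ≡signedDecChains f x z x≤z
        (ℕP.<-≤-trans (ℕP.∸-monoˡ-< (<⇒rank< z<w) (≤⇒rank≤ x≤z)) (ℕP.≤-pred r<f)))
      ... | true  | false = refl
      ... | false | _     = refl

  elemAt : Fin m → List (Fin m) → ℕ → Fin m
  elemAt y c       zero    = y
  elemAt y []      (suc i) = y
  elemAt y (a ∷ c) (suc i) = elemAt a c i

  rank-elemAt : {y z : Fin m} (c : List (Fin m)) → maxChain y z c ≡ true → (i : ℕ) → i ≤ length c →
    rank (elemAt y c i) ≡ rank y ℕ.+ i
  rank-elemAt c eq zero _ = sym (ℕP.+-identityʳ _)
  rank-elemAt {y} (a ∷ c) eq (suc i) (s≤s i≤) =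
    trans (rank-elemAt c (∧-true₂ eq) i i≤) (trans (cong (ℕ._+ i) rank-a) (sym (ℕP.+-suc (rank y) i)))
    where
    rank-a : rank a ≡ suc (rank y)
    rank-a = trans (rank-maxChain {y} {a} (a ∷ []) (cong₂ _∧_ (∧-true₁ eq) (≟ᵇ-refl a))) (ℕP.+-comm (rank y) 1)

  -- The rank x + 1 elements of a maximal chain from 0̂ to x are distinct, as their ranks are.
  rank<m : (x : Fin m) → rank x < m
  rank<m x with maxChain-exists {bot} {x} (T⇒≡true (botMin x))
  ... | c₀ , eq₀ with rank x ℕ.<? m
  ...   | yes r<m = r<m
  ...   | no  r≮m = ⊥-elim (distinct (FinP.pigeonhole (s≤s (ℕP.≮⇒≥ r≮m)) f))
    where
    f : Fin (suc (rank x)) → Fin m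
    f i = elemAt bot c₀ (toℕ i)
    rank-f : (i : Fin (suc (rank x))) → rank (f i) ≡ rank bot ℕ.+ toℕ i
    rank-f i = rank-elemAt c₀ eq₀ (toℕ i) (subst (toℕ i ≤_) (sym (graded x c₀ (≡true⇒T eq₀))) (ℕP.≤-pred (FinP.toℕ<n i)))
    distinct : ∃₂ (λ i j → toℕ i < toℕ j × f i ≡ f j) → ⊥
    distinct (i , j , i<j , fi≡fj) = ℕP.<⇒≢ i<j
      (ℕP.+-cancelˡ-≡ (rank bot) _ _ (trans (sym (rank-f i)) (trans (cong rank fi≡fj) (rank-f j))))

  -- Björner–Wachs: |μ(x,w)| counts the maximal chains of [x,w] with strictly decreasing labels.
  ∣μ∣≡decChains : (x w : Fin m) → leq x w ≡ true → + ∣ μ P x w ∣ ≡ decChains x w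
  ∣μ∣≡decChains x w x≤w = begin
    + ∣ muFuel P (suc m) x w ∣
      ≡⟨ cong (λ i → + ∣ i ∣) (μ≡signedDecChains (suc m) x w x≤w r<1+m) ⟩
    + ∣ −1^ (rank w ℕ.∸ rank x) * decChains x w ∣
      ≡⟨ cong +_ (trans (ℤP.∣i*j∣≡∣i∣*∣j∣ (−1^ (rank w ℕ.∸ rank x)) _)
           (trans (cong (ℕ._* ∣ decChains x w ∣) (∣−1^∣≡1 (rank w ℕ.∸ rank x))) (ℕP.*-identityˡ _))) ⟩
    + ∣ decChains x w ∣
      ≡⟨ ℤP.0≤i⇒+∣i∣≡i (decChains-nonneg x w) ⟩
    decChains x w ∎
    where
    open ≡-Reasoning
    r<1+m : rank w ℕ.∸ rank x < suc m
    r<1+m = s≤s (ℕP.≤-trans (ℕP.m∸n≤m (rank w) (rank x)) (ℕP.<⇒≤ (rank<m w)))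
    ∣−1^∣≡1 : (k : ℕ) → ∣ −1^ k ∣ ≡ 1
    ∣−1^∣≡1 zero    = refl
    ∣−1^∣≡1 (suc k) = trans (ℤP.∣-i∣≡∣i∣ (−1^ k)) (∣−1^∣≡1 k)

  Poin : Fin m → Fin m → Poly
  Poin = poinInterval P G

  coeff-Poin : (x z : Fin m) (k : ℕ) (v : Word) → coeff (Poin x z) k v ≡
    Σℤ (allFin m) (λ w → ⟦ leq x w ∧ leq w z ⟧ * (coeff (y^ (rank w ℕ.∸ rank x)) k v * + ∣ μ P x w ∣))
  coeff-Poin x z k v = begin
    coeff (Poin x z) k v
      ≡⟨ trans (coeff≡Σℤ (Poin x z) k v) (Σℤ-map g (filterᵇ p (allFin m)) _) ⟩
    Σℤ (filterᵇ p (allFin m)) (λ w → termCoeff (g w) k v)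
      ≡⟨ Σℤ-filter p (allFin m) _ ⟩
    Σℤ (allFin m) (λ w → if p w then termCoeff (g w) k v else 0ℤ)
      ≡⟨ Σℤ-cong (allFin m) (λ w → trans (if-else-0≡⟦⟧* (p w) _) (cong (⟦ p w ⟧ *_) (monomial w))) ⟩
    Σℤ (allFin m) (λ w → ⟦ leq x w ∧ leq w z ⟧ * (coeff (y^ (rank w ℕ.∸ rank x)) k v * + ∣ μ P x w ∣)) ∎
    where
    open ≡-Reasoning
    p : Fin m → Bool
    p w = leq x w ∧ leq w z
    g : Fin m → Term
    g w = (+ ∣ μ P x w ∣ , rank w ℕ.∸ rank x , [])
    monomial : (w : Fin m) → termCoeff (g w) k v ≡ coeff (y^ (rank w ℕ.∸ rank x)) k v * + ∣ μ P x w ∣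
    monomial w = trans (termCoeff-⟦⟧ _ (rank w ℕ.∸ rank x) [] k v) (cong (_* + ∣ μ P x w ∣) (sym
      (trans (ℤP.+-identityʳ _) (trans (termCoeff-⟦⟧ 1ℤ (rank w ℕ.∸ rank x) [] k v)
        (ℤP.*-identityʳ (⟦ rank w ℕ.∸ rank x ≡ᵇ k ⟧ * ⟦ [] ==w v ⟧))))))

  Poin-≰ : (x z : Fin m) → leq x z ≡ false → Poin x z ≈ []
  Poin-≰ x z x≰z = mk≈ λ k v → trans (coeff-Poin x z k v) (Σℤ-zero (allFin m) (λ w → no-w w k v))
    where
    no-w : (w : Fin m) (k : ℕ) (v : Word) → ⟦ leq x w ∧ leq w z ⟧ * (coeff (y^ (rank w ℕ.∸ rank x)) k v * + ∣ μ P x w ∣) ≡ 0ℤ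
    no-w w k v with leq x w in x≤w | leq w z in w≤z
    ... | true  | true  with () ← trans (sym x≰z) (≤-trans x≤w w≤z)
    ... | true  | false = refl
    ... | false | _     = refl

  allASum : Fin m → List (Fin m) → ℕ → Poly
  allASum x M d = ΣP (subsets d) (λ E → ifP (allA (labels x M) E) (y^ countTrue E))

  coeff-allASum : (x : Fin m) (M : List (Fin m)) (d : ℕ) → length M ≡ d → (k : ℕ) (v : Word) →
    coeff (allASum x M d) k v ≡ Σℤ (upTo (suc d)) (λ j → coeff (y^ j) k v * decInc j (labels x M))
  coeff-allASum x M d len k v = trans (coeff-ΣP (subsets d) _ k v)
    (trans (Σℤ-cong (subsets d) (λ E → coeff-ifP (allA (labels x M) E) _ k v))
    (subst (λ t → Σℤ (subsets t) (λ E → ⟦ allA (labels x M) E ⟧ * coeff (y^ countTrue E) k v)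
                    ≡ Σℤ (upTo (suc t)) (λ j → coeff (y^ j) k v * decInc j (labels x M)))
      (trans (length-labels x M) len) (Σ-allA≡Σ-decInc (labels x M) (λ e → coeff (y^ e) k v))))

  -- Summing the allowed initial segments of E turns the count of decreasing chains into |μ|.
  Σ-allASum≈Poin : (x z : Fin m) (d : ℕ) →
    ΣP (Chains d) (λ M → ifP (maxChain x z M) (allASum x M d)) ≈ ifP (rank z ≡ᵇ rank x ℕ.+ d) (Poin x z)
  Σ-allASum≈Poin x z d = mk≈ λ k v → begin
    coeff (ΣP (Chains d) (λ M → ifP (maxChain x z M) (allASum x M d))) k v
      ≡⟨ coeff-ΣP (Chains d) _ k v ⟩
    Σℤ (Chains d) (λ M → coeff (ifP (maxChain x z M) (allASum x M d)) k v)
      ≡⟨ Σℤ-lists-cong (allFin m) d (λ M len → trans (coeff-ifP (maxChain x z M) _ k v)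
           (cong (⟦ maxChain x z M ⟧ *_) (coeff-allASum x M d len k v))) ⟩
    Σℤ (Chains d) (λ M → ⟦ maxChain x z M ⟧ * Σℤ (upTo (suc d)) (λ j → ψ k v j * decInc j (labels x M)))
      ≡⟨ Σ-chains-decInc x z d (ψ k v) ⟩
    Σℤ (allFin m) (λ w → ⟦ leq x w ∧ leq w z ∧ B ⟧ * (ψ k v (rank w ℕ.∸ rank x) * decChains x w))
      ≡⟨ Σℤ-cong (allFin m) (λ w → decChains→∣μ∣ w k v) ⟩
    Σℤ (allFin m) (λ w → ⟦ B ⟧ * (⟦ leq x w ∧ leq w z ⟧ * (ψ k v (rank w ℕ.∸ rank x) * + ∣ μ P x w ∣)))
      ≡⟨ sym (Σℤ-*ˡ ⟦ B ⟧ (allFin m) _) ⟩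
    ⟦ B ⟧ * Σℤ (allFin m) (λ w → ⟦ leq x w ∧ leq w z ⟧ * (ψ k v (rank w ℕ.∸ rank x) * + ∣ μ P x w ∣))
      ≡⟨ trans (cong (⟦ B ⟧ *_) (sym (coeff-Poin x z k v))) (sym (coeff-ifP B (Poin x z) k v)) ⟩
    coeff (ifP B (Poin x z)) k v ∎
    where
    open ≡-Reasoning
    B = rank z ≡ᵇ rank x ℕ.+ d
    ψ : ℕ → Word → ℕ → ℤ
    ψ k v e = coeff (y^ e) k v
    decChains→∣μ∣ : (w : Fin m) (k : ℕ) (v : Word) →
      ⟦ leq x w ∧ leq w z ∧ B ⟧ * (ψ k v (rank w ℕ.∸ rank x) * decChains x w)
        ≡ ⟦ B ⟧ * (⟦ leq x w ∧ leq w z ⟧ * (ψ k v (rank w ℕ.∸ rank x) * + ∣ μ P x w ∣))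
    decChains→∣μ∣ w k v = on-x≤w (leq x w) refl
      where
      -- Not a with-abstraction: that would also abstract the leq x w hidden inside μ.
      on-x≤w : (b : Bool) → leq x w ≡ b → ⟦ b ∧ leq w z ∧ B ⟧ * (ψ k v (rank w ℕ.∸ rank x) * decChains x w)
        ≡ ⟦ B ⟧ * (⟦ b ∧ leq w z ⟧ * (ψ k v (rank w ℕ.∸ rank x) * + ∣ μ P x w ∣))
      on-x≤w false _   = sym (trans (cong (⟦ B ⟧ *_) (ℤP.*-zeroˡ (ψ k v (rank w ℕ.∸ rank x) * + ∣ μ P x w ∣))) (ℤP.*-zeroʳ ⟦ B ⟧))
      on-x≤w true  x≤w = trans (cong (_* (ψ k v (rank w ℕ.∸ rank x) * decChains x w)) (⟦∧⟧ (leq w z) B))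
        (trans (solve 4 (λ a b c d → (a :* b) :* (c :* d) := b :* (a :* (c :* d))) refl
                 ⟦ leq w z ⟧ ⟦ B ⟧ (ψ k v (rank w ℕ.∸ rank x)) (decChains x w))
               (cong (λ t → ⟦ B ⟧ * (⟦ leq w z ⟧ * (ψ k v (rank w ℕ.∸ rank x) * t))) (sym (∣μ∣≡decChains x w x≤w))))

  -- Sums over maximal chains M and sets E

  flagSum : Fin m → List Bool → ℕ → ℕ → Bool → List (Fin m) → Poly
  flagSum x S k ℓ e M = ΣP (subsets k) (λ E → ifP (bsIn S ℓ e (labels x M) E) (y^ countTrue E))

  -- Σ y^#E over maximal chains M of [x,z] of length k and sets E of steps for which every letter
  -- of u(M,E) outside S is 𝐚; (ℓ, e) is the label and flag preceding the first step.
  chainSumₖ : Fin m → Fin m → List Bool → ℕ → ℕ → Bool → Poly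
  chainSumₖ x z S k ℓ e = ΣP (Chains k) (λ M → ifP (maxChain x z M) (flagSum x S k ℓ e M))

  chainSum : Fin m → Fin m → List Bool → ℕ → Bool → Poly
  chainSum x z S = chainSumₖ x z S (length S)

  chainSum≡chainSumₖ : (x z : Fin m) (S : List Bool) {k : ℕ} (ℓ : ℕ) (e : Bool) → length S ≡ k →
    chainSum x z S ℓ e ≡ chainSumₖ x z S k ℓ e
  chainSum≡chainSumₖ x z S ℓ e refl = refl

  rank-bot : rank bot ≡ 0
  rank-bot = sym (graded bot [] (≡true⇒T (≟ᵇ-refl bot)))

  -- Below the first element of a chain all letters must be 𝐚: only the increasing chain with E = ∅.
  chainSum-falses : (x : Fin m) (j : ℕ) → chainSumₖ bot x (replicate j false) j 0 false ≈ ifP (rank x ≡ᵇ j) oneP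
  chainSum-falses x j = mk≈ λ k v → begin
    coeff (chainSumₖ bot x (replicate j false) j 0 false) k v
      ≡⟨ coeff-ΣP (Chains j) _ k v ⟩
    Σℤ (Chains j) (λ M → coeff (ifP (maxChain bot x M) (flagSum bot (replicate j false) j 0 false M)) k v)
      ≡⟨ Σℤ-lists-cong (allFin m) j (λ M len → trans (coeff-ifP (maxChain bot x M) _ k v)
           (trans (cong (⟦ maxChain bot x M ⟧ *_) (coeff-flagSum M len k v))
             (solve 3 (λ a b c → a :* (b :* c) := b :* c :* a) refl ⟦ maxChain bot x M ⟧ (ψ k v 0) ⟦ weaklyIncᵇ (labels bot M) ⟧))) ⟩
    Σℤ (Chains j) (λ M → ψ k v 0 * ⟦ weaklyIncᵇ (labels bot M) ⟧ * ⟦ maxChain bot x M ⟧)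
      ≡⟨ Σℤ-cong (Chains j) (λ M → trans (ℤP.*-assoc (ψ k v 0) _ _)
           (cong (ψ k v 0 *_) (trans (ℤP.*-comm ⟦ weaklyIncᵇ (labels bot M) ⟧ _) (sym (⟦∧⟧ (maxChain bot x M) _))))) ⟩
    Σℤ (Chains j) (λ M → ψ k v 0 * ⟦ maxChain bot x M ∧ weaklyIncᵇ (labels bot M) ⟧)
      ≡⟨ trans (sym (Σℤ-*ˡ (ψ k v 0) (Chains j) _)) (cong (ψ k v 0 *_) (incCount≡ bot x j)) ⟩
    ψ k v 0 * ⟦ leq bot x ∧ (rank x ≡ᵇ rank bot ℕ.+ j) ⟧
      ≡⟨ cong₂ (λ b r → ψ k v 0 * ⟦ b ∧ (rank x ≡ᵇ r) ⟧) (T⇒≡true (botMin x)) (cong (ℕ._+ j) rank-bot) ⟩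
    ψ k v 0 * ⟦ rank x ≡ᵇ j ⟧
      ≡⟨ trans (ℤP.*-comm (ψ k v 0) _) (sym (coeff-ifP (rank x ≡ᵇ j) oneP k v)) ⟩
    coeff (ifP (rank x ≡ᵇ j) oneP) k v ∎
    where
    open ≡-Reasoning
    ψ : ℕ → Word → ℕ → ℤ
    ψ k v e = coeff (y^ e) k v
    coeff-flagSum : (M : List (Fin m)) → length M ≡ j → (k : ℕ) (v : Word) →
      coeff (flagSum bot (replicate j false) j 0 false M) k v ≡ ψ k v 0 * ⟦ weaklyIncᵇ (labels bot M) ⟧
    coeff-flagSum M len k v = trans (coeff-ΣP (subsets j) _ k v)
      (trans (Σℤ-cong (subsets j) (λ E → coeff-ifP (bsIn (replicate j false) 0 false L E) _ k v))
        (subst (λ t → Σℤ (subsets t) (λ E → ⟦ bsIn (replicate t false) 0 false L E ⟧ * ψ k v (countTrue E)) ≡ ψ k v 0 * ⟦ weaklyIncᵇ L ⟧)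
          (trans (length-labels bot M) len) (Σ-bsIn-falses L (ψ k v))))
      where
      L = labels bot M

  chainSum-true∷falses : (x z : Fin m) (j ℓ : ℕ) (e : Bool) →
    chainSum x z (true ∷ replicate j false) ℓ e ≈ ifP (rank z ≡ᵇ rank x ℕ.+ suc j) (Poin x z)
  chainSum-true∷falses x z j ℓ e = begin
    chainSum x z (true ∷ replicate j false) ℓ e
      ≡⟨ chainSum≡chainSumₖ x z (true ∷ replicate j false) ℓ e (cong suc (ListP.length-replicate j)) ⟩
    chainSumₖ x z (true ∷ replicate j false) (suc j) ℓ e
      ≈⟨ ΣP-lists-cong (allFin m) (suc j) (λ M len → ifP-cong (maxChain x z M) (λ _ →
           ΣP-lists-cong (true ∷ false ∷ []) (suc j) (λ E lenE → ≡⇒≈ (cong (λ b → ifP b (y^ countTrue E)) (bsIn≡allA M E len lenE))))) ⟩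
    ΣP (Chains (suc j)) (λ M → ifP (maxChain x z M) (allASum x M (suc j)))
      ≈⟨ Σ-allASum≈Poin x z (suc j) ⟩
    ifP (rank z ≡ᵇ rank x ℕ.+ suc j) (Poin x z) ∎
    where
    open ≈-Reasoning
    bsIn≡allA : (M : List (Fin m)) (E : List Bool) → length M ≡ suc j → length E ≡ suc j →
      bsIn (true ∷ replicate j false) ℓ e (labels x M) E ≡ allA (labels x M) E
    bsIn≡allA M E lenM lenE with labels x M | length-labels x M | E
    ... | []    | len | _      = ⊥-elim (ℕP.0≢1+n (trans len lenM))
    ... | a ∷ L | len | []     = ⊥-elim (ℕP.0≢1+n lenE)
    ... | a ∷ L | len | f ∷ E′ = bsIn-falses j a f L E′ (ℕP.suc-injective (trans len lenM)) (ℕP.suc-injective lenE)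

  ΣP-maxChain-++ : (x y : Fin m) (M₁ M₂ : List (Fin m)) (H : Fin m → Poly) →
    ΣP (allFin m) (λ z → ifP (maxChain x z M₁) (ifP (maxChain z y M₂) (H z)))
      ≈ ifP (maxChain x y (M₁ ++ M₂)) (H (endpoint x M₁))
  ΣP-maxChain-++ x y M₁ M₂ H = mk≈ λ k v → begin
    coeff (ΣP (allFin m) (λ z → ifP (maxChain x z M₁) (ifP (maxChain z y M₂) (H z)))) k v
      ≡⟨ coeff-ΣP (allFin m) _ k v ⟩
    Σℤ (allFin m) (λ z → coeff (ifP (maxChain x z M₁) (ifP (maxChain z y M₂) (H z))) k v)
      ≡⟨ Σℤ-cong (allFin m) (λ z → trans (coeff-ifP (maxChain x z M₁) _ k v)
           (trans (cong (⟦ maxChain x z M₁ ⟧ *_) (coeff-ifP (maxChain z y M₂) (H z) k v)) (through-endpoint z k v))) ⟩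
    Σℤ (allFin m) (λ z → ⟦ maxChain x z M₁ ⟧ * ⟦ maxChain z y M₂ ⟧ * coeff (H (endpoint x M₁)) k v)
      ≡⟨ sym (Σℤ-*ʳ (coeff (H (endpoint x M₁)) k v) (allFin m) _) ⟩
    Σℤ (allFin m) (λ z → ⟦ maxChain x z M₁ ⟧ * ⟦ maxChain z y M₂ ⟧) * coeff (H (endpoint x M₁)) k v
      ≡⟨ cong (_* coeff (H (endpoint x M₁)) k v) (sym (⟦maxChain-++⟧ x y M₁ M₂)) ⟩
    ⟦ maxChain x y (M₁ ++ M₂) ⟧ * coeff (H (endpoint x M₁)) k v
      ≡⟨ sym (coeff-ifP (maxChain x y (M₁ ++ M₂)) (H (endpoint x M₁)) k v) ⟩
    coeff (ifP (maxChain x y (M₁ ++ M₂)) (H (endpoint x M₁))) k v ∎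
    where
    open ≡-Reasoning
    through-endpoint : (z : Fin m) (k : ℕ) (v : Word) → ⟦ maxChain x z M₁ ⟧ * (⟦ maxChain z y M₂ ⟧ * coeff (H z) k v)
      ≡ ⟦ maxChain x z M₁ ⟧ * ⟦ maxChain z y M₂ ⟧ * coeff (H (endpoint x M₁)) k v
    through-endpoint z k v with maxChain x z M₁ in eq
    ... | false = sym (trans (cong (_* coeff (H (endpoint x M₁)) k v) (ℤP.*-zeroˡ ⟦ maxChain z y M₂ ⟧))
                             (ℤP.*-zeroˡ (coeff (H (endpoint x M₁)) k v)))
    ... | true rewrite maxChain-endpoint M₁ eq = sym (ℤP.*-assoc 1ℤ ⟦ maxChain z y M₂ ⟧ (coeff (H z) k v))

  flagSum-++ : (x : Fin m) (S₁ S₂ : List Bool) (ℓ : ℕ) (e : Bool) → startsWithTrue S₂ →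
    (M₁ M₂ : List (Fin m)) → length M₁ ≡ length S₁ →
    flagSum x (S₁ ++ S₂) (length S₁ ℕ.+ length S₂) ℓ e (M₁ ++ M₂)
      ≈ flagSum x S₁ (length S₁) ℓ e M₁ ⊗ flagSum (endpoint x M₁) S₂ (length S₂) 0 false M₂
  flagSum-++ x S₁ S₂ ℓ e S₂⊤ M₁ M₂ len = begin
    flagSum x (S₁ ++ S₂) (k₁ ℕ.+ k₂) ℓ e (M₁ ++ M₂)
      ≈⟨ ΣP-lists-+ (true ∷ false ∷ []) k₁ k₂ _ ⟩
    ΣP (subsets k₁) (λ E₁ → ΣP (subsets k₂) (λ E₂ →
      ifP (bsIn (S₁ ++ S₂) ℓ e (labels x (M₁ ++ M₂)) (E₁ ++ E₂)) (y^ countTrue (E₁ ++ E₂))))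
      ≈⟨ ΣP-lists-cong (true ∷ false ∷ []) k₁ (λ E₁ lenE₁ → ΣP-cong (subsets k₂) (λ E₂ → ≡⇒≈ (cong₂ ifP
           (trans (cong (λ L → bsIn (S₁ ++ S₂) ℓ e L (E₁ ++ E₂)) (labels-++ x M₁ M₂))
                  (bsIn-++ S₁ S₂ ℓ e (labels x M₁) (labels w M₂) E₁ E₂ (trans (length-labels x M₁) len) lenE₁ S₂⊤))
           (cong y^_ (countTrue-++ E₁ E₂))))) ⟩
    ΣP (subsets k₁) (λ E₁ → ΣP (subsets k₂) (λ E₂ →
      ifP (bsIn S₁ ℓ e (labels x M₁) E₁ ∧ bsIn S₂ 0 false (labels w M₂) E₂) (y^ countTrue E₁ ⊗ y^ countTrue E₂)))
      ≈⟨ ΣP-cong (subsets k₁) (λ E₁ → ΣP-cong (subsets k₂) (λ E₂ → ≈-trans (≡⇒≈ (ifP-∧ (bsIn S₁ ℓ e (labels x M₁) E₁) _ _))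
           (≈-sym (ifP-⊗-ifP (bsIn S₁ ℓ e (labels x M₁) E₁) (bsIn S₂ 0 false (labels w M₂) E₂) _ _)))) ⟩
    ΣP (subsets k₁) (λ E₁ → ΣP (subsets k₂) (λ E₂ →
      ifP (bsIn S₁ ℓ e (labels x M₁) E₁) (y^ countTrue E₁) ⊗ ifP (bsIn S₂ 0 false (labels w M₂) E₂) (y^ countTrue E₂)))
      ≈⟨ ≈-sym (ΣP-⊗-ΣP (subsets k₁) (subsets k₂) _ _) ⟩
    flagSum x S₁ k₁ ℓ e M₁ ⊗ flagSum w S₂ k₂ 0 false M₂ ∎
    where
    open ≈-Reasoning
    k₁ = length S₁
    k₂ = length S₂
    w = endpoint x M₁

  chainSum-++ : (x : Fin m) (S₁ S₂ : List Bool) (ℓ : ℕ) (e : Bool) → startsWithTrue S₂ →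
    chainSum x top (S₁ ++ S₂) ℓ e ≈ ΣP (allFin m) (λ z → chainSum x z S₁ ℓ e ⊗ chainSum z top S₂ 0 false)
  chainSum-++ x S₁ S₂ ℓ e S₂⊤ = begin
    chainSum x top (S₁ ++ S₂) ℓ e
      ≡⟨ chainSum≡chainSumₖ x top (S₁ ++ S₂) ℓ e (ListP.length-++ S₁) ⟩
    ΣP (Chains (k₁ ℕ.+ k₂)) (λ M → ifP (maxChain x top M) (flagSum x (S₁ ++ S₂) (k₁ ℕ.+ k₂) ℓ e M))
      ≈⟨ ΣP-lists-+ (allFin m) k₁ k₂ _ ⟩
    ΣP (Chains k₁) (λ M₁ → ΣP (Chains k₂) (λ M₂ →
      ifP (maxChain x top (M₁ ++ M₂)) (flagSum x (S₁ ++ S₂) (k₁ ℕ.+ k₂) ℓ e (M₁ ++ M₂))))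
      ≈⟨ ΣP-lists-cong (allFin m) k₁ (λ M₁ len → ΣP-cong (Chains k₂) (λ M₂ → ≈-trans
           (ifP-cong (maxChain x top (M₁ ++ M₂)) (λ _ → flagSum-++ x S₁ S₂ ℓ e S₂⊤ M₁ M₂ len))
           (≈-sym (ΣP-maxChain-++ x top M₁ M₂ (λ z → F₁ M₁ ⊗ F₂ z M₂))))) ⟩
    ΣP (Chains k₁) (λ M₁ → ΣP (Chains k₂) (λ M₂ → ΣP (allFin m) (λ z →
      ifP (maxChain x z M₁) (ifP (maxChain z top M₂) (F₁ M₁ ⊗ F₂ z M₂)))))
      ≈⟨ ≈-trans (ΣP-cong (Chains k₁) (λ M₁ → ΣP-swap (Chains k₂) (allFin m) _)) (ΣP-swap (Chains k₁) (allFin m) _) ⟩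
    ΣP (allFin m) (λ z → ΣP (Chains k₁) (λ M₁ → ΣP (Chains k₂) (λ M₂ →
      ifP (maxChain x z M₁) (ifP (maxChain z top M₂) (F₁ M₁ ⊗ F₂ z M₂)))))
      ≈⟨ ΣP-cong (allFin m) (λ z → ≈-trans (ΣP-cong (Chains k₁) (λ M₁ → ΣP-cong (Chains k₂) (λ M₂ →
           ≈-sym (ifP-⊗-ifP (maxChain x z M₁) (maxChain z top M₂) (F₁ M₁) (F₂ z M₂)))))
           (≈-sym (ΣP-⊗-ΣP (Chains k₁) (Chains k₂) _ _))) ⟩
    ΣP (allFin m) (λ z → chainSum x z S₁ ℓ e ⊗ chainSum z top S₂ 0 false) ∎
    where
    open ≈-Reasoning
    k₁ = length S₁
    k₂ = length S₂
    F₁ : List (Fin m) → Poly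
    F₁ = flagSum x S₁ k₁ ℓ e
    F₂ : Fin m → List (Fin m) → Poly
    F₂ z = flagSum z S₂ k₂ 0 false

  -- Chains of P ∖ 1̂ with a given rank set

  chainsFrom : Fin m → List ℕ → Poly
  chainsFrom x ps =
    ΣP (Chains (length ps)) (λ C → ifP (strictChainᵇ P (x ∷ C) ∧ (map rank C ==ᴺᴸ ps)) (poinChain P G (x ∷ C)))

  chainsFrom-[] : (x : Fin m) → chainsFrom x [] ≈ Poin x top
  chainsFrom-[] x = ΣP-single [] (λ C → ifP (strictChainᵇ P (x ∷ C) ∧ (map rank C ==ᴺᴸ [])) (poinChain P G (x ∷ C)))

  chainsFrom-∷ : (x : Fin m) (p : ℕ) (ps : List ℕ) →
    chainsFrom x (p ∷ ps) ≈ ΣP (allFin m) (λ z → ifP (ltᵇ P x z ∧ (rank z ≡ᵇ p)) (Poin x z ⊗ chainsFrom z ps))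
  chainsFrom-∷ x p ps = begin
    chainsFrom x (p ∷ ps)
      ≈⟨ ΣP-lists-suc (allFin m) (length ps) _ ⟩
    ΣP (allFin m) (λ z → ΣP (Chains (length ps)) (λ C →
      ifP (strictChainᵇ P (x ∷ z ∷ C) ∧ (map rank (z ∷ C) ==ᴺᴸ (p ∷ ps))) (poinChain P G (x ∷ z ∷ C))))
      ≈⟨ ΣP-cong (allFin m) (λ z → ΣP-cong (Chains (length ps)) (λ C → first-step z C)) ⟩
    ΣP (allFin m) (λ z → ΣP (Chains (length ps)) (λ C → ifP (ltᵇ P x z ∧ (rank z ≡ᵇ p))
      (Poin x z ⊗ ifP (strictChainᵇ P (z ∷ C) ∧ (map rank C ==ᴺᴸ ps)) (poinChain P G (z ∷ C)))))
      ≈⟨ ΣP-cong (allFin m) (λ z → ≈-trans (ΣP-ifP (Chains (length ps)) (ltᵇ P x z ∧ (rank z ≡ᵇ p)) _)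
           (ifP-cong (ltᵇ P x z ∧ (rank z ≡ᵇ p)) (λ _ → ≈-sym (ΣP-⊗ˡ (Poin x z) (Chains (length ps)) _)))) ⟩
    ΣP (allFin m) (λ z → ifP (ltᵇ P x z ∧ (rank z ≡ᵇ p)) (Poin x z ⊗ chainsFrom z ps)) ∎
    where
    open ≈-Reasoning
    first-step : (z : Fin m) (C : List (Fin m)) →
      ifP (strictChainᵇ P (x ∷ z ∷ C) ∧ (map rank (z ∷ C) ==ᴺᴸ (p ∷ ps))) (poinChain P G (x ∷ z ∷ C))
        ≈ ifP (ltᵇ P x z ∧ (rank z ≡ᵇ p)) (Poin x z ⊗ ifP (strictChainᵇ P (z ∷ C) ∧ (map rank C ==ᴺᴸ ps)) (poinChain P G (z ∷ C)))
    first-step z C with ltᵇ P x z | rank z ≡ᵇ p | strictChainᵇ P (z ∷ C) | map rank C ==ᴺᴸ ps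
    ... | true  | true  | true  | true  = ≈-refl
    ... | true  | true  | true  | false = ≈-sym (⊗-zeroʳ (Poin x z))
    ... | true  | true  | false | _     = ≈-sym (⊗-zeroʳ (Poin x z))
    ... | true  | false | true  | _     = ≈-refl
    ... | true  | false | false | _     = ≈-refl
    ... | false | _     | _     | _     = ≈-refl

  chainSum-[] : (z : Fin m) (ℓ : ℕ) (e : Bool) → chainSum z top [] ℓ e ≈ ifP (z ≟ᵇ top) oneP
  chainSum-[] z ℓ e = ≈-trans (ΣP-single [] (λ M → ifP (maxChain z top M) (flagSum z [] 0 ℓ e M)))
    (ifP-cong (z ≟ᵇ top) (λ _ → ΣP-single [] (λ E → ifP (bsIn [] ℓ e [] E) (y^ countTrue E))))

  ΣP-ending-at-top : (Q : Fin m → Poly) (r : ℕ) → rank top ≡ r →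
    ΣP (allFin m) (λ z → ifP (rank z ≡ᵇ r) (Q z) ⊗ chainSum z top [] 0 false) ≈ Q top
  ΣP-ending-at-top Q r rank-top = begin
    ΣP (allFin m) (λ z → ifP (rank z ≡ᵇ r) (Q z) ⊗ chainSum z top [] 0 false)
      ≈⟨ ΣP-cong (allFin m) (λ z → ≈-trans (⊗-congʳ (ifP (rank z ≡ᵇ r) (Q z)) (chainSum-[] z 0 false)) (ifP-⊗ʳ (z ≟ᵇ top) (ifP (rank z ≡ᵇ r) (Q z)) oneP)) ⟩
    ΣP (allFin m) (λ z → ifP (z ≟ᵇ top) (ifP (rank z ≡ᵇ r) (Q z) ⊗ oneP))
      ≈⟨ ΣP-δ top (λ z → ifP (rank z ≡ᵇ r) (Q z) ⊗ oneP) ⟩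
    ifP (rank top ≡ᵇ r) (Q top) ⊗ oneP
      ≈⟨ ≈-trans (⊗-identityʳ _) (ifP-true (Q top) (≡⇒≡ᵇ rank-top)) ⟩
    Q top ∎
    where open ≈-Reasoning

  next-element : (x z : Fin m) (j ℓ : ℕ) (e : Bool) {Q Q′ : Poly} → (rank z ≡ suc (rank x) ℕ.+ j → Q ≈ Q′) →
    ifP (ltᵇ P x z ∧ (rank z ≡ᵇ suc (rank x) ℕ.+ j)) (Poin x z ⊗ Q) ≈ chainSum x z (true ∷ replicate j false) ℓ e ⊗ Q′
  next-element x z j ℓ e {Q} {Q′} Q≈Q′ = ≈-sym (≈-trans (⊗-congˡ Q′ (chainSum-true∷falses x z j ℓ e))
    (≈-trans (⊗-congˡ Q′ (≡⇒≈ (cong (λ r → ifP (rank z ≡ᵇ r) (Poin x z)) (ℕP.+-suc (rank x) j))))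
    (≈-sym (by-rank (rank z ≡ᵇ suc (rank x) ℕ.+ j) refl))))
    where
    by-rank : (b : Bool) → (rank z ≡ᵇ suc (rank x) ℕ.+ j) ≡ b → ifP (ltᵇ P x z ∧ b) (Poin x z ⊗ Q) ≈ ifP b (Poin x z) ⊗ Q′
    by-rank false _ rewrite 𝔹P.∧-zeroʳ (ltᵇ P x z) = ≈-refl
    by-rank true  rz≡ with leq x z in x≤z
    ... | false = ≈-sym (⊗-congˡ Q′ (Poin-≰ x z x≤z))
    ... | true  = ≈-trans (ifP-true _ (cong (λ b → not b ∧ true) (≟ᵇ-≢ x≢z))) (⊗-congʳ (Poin x z) (Q≈Q′ (≡ᵇ⇒≡ rz≡)))
      where
      x≢z : ¬ x ≡ z
      x≢z x≡z = ℕP.<-irrefl (cong rank x≡z) (subst (rank x <_) (sym (≡ᵇ⇒≡ rz≡)) (s≤s (ℕP.m≤m+n (rank x) j)))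

  chainsFrom-top : (x : Fin m) (j ℓ : ℕ) (e : Bool) → rank top ≡ rank x ℕ.+ suc j →
    chainsFrom x [] ≈ chainSum x top (true ∷ replicate j false ++ []) ℓ e
  chainsFrom-top x j ℓ e rank-top≡ = begin
    chainsFrom x []
      ≈⟨ chainsFrom-[] x ⟩
    Poin x top
      ≈⟨ ≈-sym (ΣP-ending-at-top (Poin x) (rank x ℕ.+ suc j) rank-top≡) ⟩
    ΣP (allFin m) (λ z → ifP (rank z ≡ᵇ rank x ℕ.+ suc j) (Poin x z) ⊗ chainSum z top [] 0 false)
      ≈⟨ ΣP-cong (allFin m) (λ z → ⊗-congˡ _ (≈-sym (chainSum-true∷falses x z j ℓ e))) ⟩
    ΣP (allFin m) (λ z → chainSum x z (true ∷ replicate j false) ℓ e ⊗ chainSum z top [] 0 false)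
      ≈⟨ ≈-sym (chainSum-++ x (true ∷ replicate j false) [] ℓ e tt) ⟩
    chainSum x top (true ∷ replicate j false ++ []) ℓ e ∎
    where open ≈-Reasoning

  chainsFrom≈chainSum : (S : List Bool) (j : ℕ) (x : Fin m) → suc (rank x) ℕ.+ j ℕ.+ length S ≡ n → (ℓ : ℕ) (e : Bool) →
    chainsFrom x (positions (suc (rank x) ℕ.+ j) S) ≈ chainSum x top (true ∷ replicate j false ++ S) ℓ e
  chainsFrom≈chainSum [] j x len ℓ e =
    chainsFrom-top x j ℓ e (trans rankTop (trans (sym len) (trans (ℕP.+-identityʳ _) (sym (ℕP.+-suc (rank x) j)))))
  chainsFrom≈chainSum (false ∷ S) j x len ℓ e = begin
    chainsFrom x (positions (suc (suc (rank x) ℕ.+ j)) S)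
      ≡⟨ cong (λ t → chainsFrom x (positions t S)) (sym (ℕP.+-suc (suc (rank x)) j)) ⟩
    chainsFrom x (positions (suc (rank x) ℕ.+ suc j) S)
      ≈⟨ chainsFrom≈chainSum S (suc j) x len′ ℓ e ⟩
    chainSum x top (true ∷ replicate (suc j) false ++ S) ℓ e
      ≡⟨ cong (λ S′ → chainSum x top (true ∷ S′) ℓ e) (sym (falses-++-false∷ j S)) ⟩
    chainSum x top (true ∷ replicate j false ++ false ∷ S) ℓ e ∎
    where
    open ≈-Reasoning
    len′ : suc (rank x) ℕ.+ suc j ℕ.+ length S ≡ n
    len′ = trans (cong (ℕ._+ length S) (ℕP.+-suc (suc (rank x)) j)) (trans (sym (ℕP.+-suc _ (length S))) len)
  chainsFrom≈chainSum (true ∷ S) j x len ℓ e = begin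
    chainsFrom x (p ∷ positions (suc p) S)
      ≈⟨ chainsFrom-∷ x p (positions (suc p) S) ⟩
    ΣP (allFin m) (λ z → ifP (ltᵇ P x z ∧ (rank z ≡ᵇ p)) (Poin x z ⊗ chainsFrom z (positions (suc p) S)))
      ≈⟨ ΣP-cong (allFin m) (λ z → next-element x z j ℓ e (rest z)) ⟩
    ΣP (allFin m) (λ z → chainSum x z (true ∷ replicate j false) ℓ e ⊗ chainSum z top (true ∷ S) 0 false)
      ≈⟨ ≈-sym (chainSum-++ x (true ∷ replicate j false) (true ∷ S) ℓ e tt) ⟩
    chainSum x top (true ∷ replicate j false ++ true ∷ S) ℓ e ∎
    where
    open ≈-Reasoning
    p = suc (rank x) ℕ.+ j
    rest : (z : Fin m) → rank z ≡ p → chainsFrom z (positions (suc p) S) ≈ chainSum z top (true ∷ S) 0 false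
    rest z rz≡p = ≈-trans (≡⇒≈ (cong (λ t → chainsFrom z (positions t S)) (sym (trans (ℕP.+-identityʳ _) (cong suc rz≡p)))))
      (chainsFrom≈chainSum S 0 z (trans (cong (ℕ._+ length S) (trans (ℕP.+-identityʳ _) (cong suc rz≡p)))
        (trans (sym (ℕP.+-suc p (length S))) len)) 0 false)

  chainsWithRanks : List ℕ → Poly
  chainsWithRanks []       = oneP
  chainsWithRanks (p ∷ ps) = ΣP (allFin m) (λ x → ifP (rank x ≡ᵇ p) (chainsFrom x ps))

  first-element : (x : Fin m) (j : ℕ) {Q Q′ : Poly} → (rank x ≡ j → Q ≈ Q′) →
    ifP (rank x ≡ᵇ j) Q ≈ chainSum bot x (replicate j false) 0 false ⊗ Q′
  first-element x j {Q} {Q′} Q≈Q′ = ≈-sym (≈-trans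
    (⊗-congˡ Q′ (≈-trans (≡⇒≈ (chainSum≡chainSumₖ bot x (replicate j false) 0 false (ListP.length-replicate j)))
                        (chainSum-falses x j)))
    (by-rank (rank x ≡ᵇ j) refl))
    where
    by-rank : (b : Bool) → (rank x ≡ᵇ j) ≡ b → ifP b oneP ⊗ Q′ ≈ ifP b Q
    by-rank false _   = ≈-refl
    by-rank true  rx≡ = ≈-trans (⊗-identityˡ Q′) (≈-sym (Q≈Q′ (≡ᵇ⇒≡ rx≡)))

  chainsWithRanks≈chainSum : (j : ℕ) (S : List Bool) → j ℕ.+ length S ≡ n →
    chainsWithRanks (positions j S) ≈ chainSum bot top (replicate j false ++ S) 0 false
  chainsWithRanks≈chainSum j [] len = begin
    oneP
      ≈⟨ ≈-sym (ΣP-ending-at-top (λ _ → oneP) j (trans rankTop (trans (sym len) (ℕP.+-identityʳ j)))) ⟩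
    ΣP (allFin m) (λ z → ifP (rank z ≡ᵇ j) oneP ⊗ chainSum z top [] 0 false)
      ≈⟨ ΣP-cong (allFin m) (λ z → ≈-trans (ifP-⊗ˡ (rank z ≡ᵇ j) oneP _) (first-element z j (λ _ → ⊗-identityˡ _))) ⟩
    ΣP (allFin m) (λ z → chainSum bot z (replicate j false) 0 false ⊗ chainSum z top [] 0 false)
      ≈⟨ ≈-sym (chainSum-++ bot (replicate j false) [] 0 false tt) ⟩
    chainSum bot top (replicate j false ++ []) 0 false ∎
    where open ≈-Reasoning
  chainsWithRanks≈chainSum j (false ∷ S) len =
    ≈-trans (chainsWithRanks≈chainSum (suc j) S (trans (sym (ℕP.+-suc j (length S))) len))
            (≡⇒≈ (cong (λ S′ → chainSum bot top S′ 0 false) (sym (falses-++-false∷ j S))))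
  chainsWithRanks≈chainSum j (true ∷ S) len = begin
    ΣP (allFin m) (λ x → ifP (rank x ≡ᵇ j) (chainsFrom x (positions (suc j) S)))
      ≈⟨ ΣP-cong (allFin m) (λ x → first-element x j (rest x)) ⟩
    ΣP (allFin m) (λ x → chainSum bot x (replicate j false) 0 false ⊗ chainSum x top (true ∷ S) 0 false)
      ≈⟨ ≈-sym (chainSum-++ bot (replicate j false) (true ∷ S) 0 false tt) ⟩
    chainSum bot top (replicate j false ++ true ∷ S) 0 false ∎
    where
    open ≈-Reasoning
    rest : (x : Fin m) → rank x ≡ j → chainsFrom x (positions (suc j) S) ≈ chainSum x top (true ∷ S) 0 false
    rest x refl = ≈-trans (≡⇒≈ (cong (λ t → chainsFrom x (positions t S)) (sym (ℕP.+-identityʳ (suc (rank x))))))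
      (chainsFrom≈chainSum S 0 x (trans (cong (ℕ._+ length S) (ℕP.+-identityʳ (suc (rank x))))
        (trans (sym (ℕP.+-suc (rank x) (length S))) len)) 0 false)

  rankSet : List (Fin m) → List Bool
  rankSet c = map (λ i → any (λ x → rank x ≡ᵇ i) c) (upTo n)

  rankSet≡indicator : (c : List (Fin m)) → rankSet c ≡ indicator 0 n (map rank c)
  rankSet≡indicator c = trans (map-applyUpTo _ (λ i → i) n) (applyUpTo-cong n (λ i → any-rank i c))
    where
    map-applyUpTo : {A B : Set} (g : A → B) (f : ℕ → A) (k : ℕ) → map g (applyUpTo f k) ≡ applyUpTo (g ∘ f) k
    map-applyUpTo g f zero    = refl
    map-applyUpTo g f (suc k) = cong (g (f 0) ∷_) (map-applyUpTo g (f ∘ suc) k)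
    any-rank : (i : ℕ) (c : List (Fin m)) → any (λ x → rank x ≡ᵇ i) c ≡ elemᵇ i (map rank c)
    any-rank i []      = refl
    any-rank i (x ∷ c) = cong ((rank x ≡ᵇ i) ∨_) (any-rank i c)

  length-rankSet : (c : List (Fin m)) → length (rankSet c) ≡ n
  length-rankSet c = trans (ListP.length-map _ (upTo n)) (ListP.length-applyUpTo (λ i → i) n)

  avoidsTop : List (Fin m) → Bool
  avoidsTop c = all (λ x → not (x ≟ᵇ top)) c

  ≢top⇒rank<n : (x : Fin m) → not (x ≟ᵇ top) ≡ true → rank x < n
  ≢top⇒rank<n x x≢top with ℕP.m≤n⇒m<n∨m≡n (subst (rank x ≤_) rankTop (≤⇒rank≤ (T⇒≡true (topMax x))))
  ... | inj₁ r<n = r<n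
  ... | inj₂ r≡n with () ← trans (sym x≢top)
    (cong not (trans (cong (x ≟ᵇ_) (sym (≤∧rank≡⇒≡ (T⇒≡true (topMax x)) (trans r≡n (sym rankTop))))) (≟ᵇ-refl x)))

  chain-StrictlyIncIn : (lo : ℕ) (x : Fin m) (c : List (Fin m)) → lo ≤ rank x →
    strictChainᵇ P (x ∷ c) ≡ true → avoidsTop (x ∷ c) ≡ true → StrictlyIncIn lo n (map rank (x ∷ c))
  chain-StrictlyIncIn lo x []      lo≤ _      avoids = lo≤ , ≢top⇒rank<n x (∧-true₁ avoids) , tt
  chain-StrictlyIncIn lo x (y ∷ c) lo≤ strict avoids = lo≤ , ≢top⇒rank<n x (∧-true₁ avoids) ,
    chain-StrictlyIncIn (suc (rank x)) y c (<⇒rank< (∧-true₁ strict)) (∧-true₂ {ltᵇ P x y} strict) (∧-true₂ {not (x ≟ᵇ top)} avoids)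

  StrictlyIncIn⇒avoidsTop : {lo : ℕ} (c : List (Fin m)) → StrictlyIncIn lo n (map rank c) → avoidsTop c ≡ true
  StrictlyIncIn⇒avoidsTop []      _                = refl
  StrictlyIncIn⇒avoidsTop (x ∷ c) (_ , r<n , inc) =
    cong₂ _∧_ (cong not (≟ᵇ-≢ (λ { refl → ℕP.<-irrefl rankTop r<n }))) (StrictlyIncIn⇒avoidsTop c inc)

  positions-StrictlyIncIn : (i : ℕ) (S : List Bool) → StrictlyIncIn i (i ℕ.+ length S) (positions i S)
  positions-StrictlyIncIn i []          = tt
  positions-StrictlyIncIn i (true ∷ S)  = ℕP.≤-refl , subst (i <_) (sym (ℕP.+-suc i (length S))) (s≤s (ℕP.m≤m+n i (length S))) ,
    subst (λ h → StrictlyIncIn (suc i) h (positions (suc i) S)) (sym (ℕP.+-suc i (length S))) (positions-StrictlyIncIn (suc i) S)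
  positions-StrictlyIncIn i (false ∷ S) = weaken (subst (λ h → StrictlyIncIn (suc i) h (positions (suc i) S))
    (sym (ℕP.+-suc i (length S))) (positions-StrictlyIncIn (suc i) S))
    where
    weaken : {hi : ℕ} {rs : List ℕ} → StrictlyIncIn (suc i) hi rs → StrictlyIncIn i hi rs
    weaken {rs = []}     _                 = tt
    weaken {rs = r ∷ rs} (1+i≤r , r<hi , inc) = ℕP.<⇒≤ 1+i≤r , r<hi , inc

  isChain∧rankSet≡ : (c : List (Fin m)) (S : List Bool) → length S ≡ n →
    (isChainᵇ P G c ∧ (rankSet c ==ᴮᴸ S)) ≡ (strictChainᵇ P c ∧ (map rank c ==ᴺᴸ positions 0 S))
  isChain∧rankSet≡ c S len with strictChainᵇ P c in strict
  ... | false = refl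
  ... | true with avoidsTop c in avoids
  ...   | true = trans (cong (_==ᴮᴸ S) (trans (rankSet≡indicator c) (cong (λ k → indicator 0 k (map rank c)) (sym len))))
                   (indicator≡⇔positions 0 S (map rank c) (subst (λ h → StrictlyIncIn 0 h (map rank c)) (sym len) (increasing c strict avoids)))
    where
    increasing : (c : List (Fin m)) → strictChainᵇ P c ≡ true → avoidsTop c ≡ true → StrictlyIncIn 0 n (map rank c)
    increasing []      _ _ = tt
    increasing (x ∷ c) s a = chain-StrictlyIncIn 0 x c z≤n s a
  ...   | false with map rank c ==ᴺᴸ positions 0 S in ranks≡
  ...     | false = refl
  ...     | true with () ← trans (sym avoids) (StrictlyIncIn⇒avoidsTop c
              (subst (StrictlyIncIn 0 n) (sym (==ᴺᴸ-sound _ _ ranks≡))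
                (subst (λ h → StrictlyIncIn 0 h (positions 0 S)) len (positions-StrictlyIncIn 0 S))))

  chainsWithRanksₖ : List ℕ → ℕ → Poly
  chainsWithRanksₖ ps k = ΣP (Chains k) (λ c → ifP (strictChainᵇ P c ∧ (map rank c ==ᴺᴸ ps)) (poinChain P G c))

  chainsWithRanksₖ-length : (ps : List ℕ) (k : ℕ) → chainsWithRanksₖ ps k ≈ ifP (length ps ≡ᵇ k) (chainsWithRanksₖ ps k)
  chainsWithRanksₖ-length ps k with length ps ≡ᵇ k in |ps|≡k
  ... | true  = ≈-refl
  ... | false = ≈-trans (ΣP-lists-cong (allFin m) k (λ c len → ifP-false (poinChain P G c) (wrong-length c len)))
                        (ΣP-zero (Chains k) (λ _ → ≈-refl))
    where
    wrong-length : (c : List (Fin m)) → length c ≡ k → (strictChainᵇ P c ∧ (map rank c ==ᴺᴸ ps)) ≡ false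
    wrong-length c len with map rank c ==ᴺᴸ ps in ranks≡
    ... | false = 𝔹P.∧-zeroʳ (strictChainᵇ P c)
    ... | true with () ← trans (sym |ps|≡k)
      (≡⇒≡ᵇ (trans (sym (cong length (==ᴺᴸ-sound (map rank c) ps ranks≡))) (trans (ListP.length-map rank c) len)))

  chainsWithRanksₖ≈chainsWithRanks : (ps : List ℕ) → chainsWithRanksₖ ps (length ps) ≈ chainsWithRanks ps
  chainsWithRanksₖ≈chainsWithRanks []       = ΣP-single [] (λ c → ifP (strictChainᵇ P c ∧ (map rank c ==ᴺᴸ [])) (poinChain P G c))
  chainsWithRanksₖ≈chainsWithRanks (p ∷ ps) = ≈-trans (ΣP-lists-suc (allFin m) (length ps) _) (ΣP-cong (allFin m) (λ x →
    ≈-trans (ΣP-cong (Chains (length ps)) (λ C → first-rank x C)) (ΣP-ifP (Chains (length ps)) (rank x ≡ᵇ p) _)))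
    where
    first-rank : (x : Fin m) (C : List (Fin m)) →
      ifP (strictChainᵇ P (x ∷ C) ∧ (map rank (x ∷ C) ==ᴺᴸ (p ∷ ps))) (poinChain P G (x ∷ C))
        ≈ ifP (rank x ≡ᵇ p) (ifP (strictChainᵇ P (x ∷ C) ∧ (map rank C ==ᴺᴸ ps)) (poinChain P G (x ∷ C)))
    first-rank x C with strictChainᵇ P (x ∷ C) | rank x ≡ᵇ p
    ... | true  | true  = ≈-refl
    ... | true  | false = ≈-refl
    ... | false | true  = ≈-refl
    ... | false | false = ≈-refl

  Σ-chains-rankSet : (S : List Bool) → length S ≡ n →
    ΣP (chains P G) (λ c → ifP (rankSet c ==ᴮᴸ S) (poinChain P G c)) ≈ chainsWithRanks (positions 0 S)
  Σ-chains-rankSet S len = begin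
    ΣP (chains P G) (λ c → ifP (rankSet c ==ᴮᴸ S) (PC c))
      ≈⟨ ≈-trans (ΣP-filter (isChainᵇ P G) (concatMap Chains (upTo (suc m))) _) (ΣP-concatMap Chains (upTo (suc m)) _) ⟩
    ΣP (upTo (suc m)) (λ k → ΣP (Chains k) (λ c → ifP (isChainᵇ P G c) (ifP (rankSet c ==ᴮᴸ S) (PC c))))
      ≈⟨ ΣP-cong (upTo (suc m)) (λ k → ΣP-cong (Chains k) (λ c → ≡⇒≈
           (trans (sym (ifP-∧ (isChainᵇ P G c) _ (PC c))) (cong (λ b → ifP b (PC c)) (isChain∧rankSet≡ c S len))))) ⟩
    ΣP (upTo (suc m)) (chainsWithRanksₖ ps)
      ≈⟨ ΣP-cong (upTo (suc m)) (chainsWithRanksₖ-length ps) ⟩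
    ΣP (upTo (suc m)) (λ k → ifP (length ps ≡ᵇ k) (chainsWithRanksₖ ps k))
      ≈⟨ ΣP-upTo-δ (suc m) (length ps) (s≤s |ps|≤m) (chainsWithRanksₖ ps) ⟩
    chainsWithRanksₖ ps (length ps)
      ≈⟨ chainsWithRanksₖ≈chainsWithRanks ps ⟩
    chainsWithRanks ps ∎
    where
    open ≈-Reasoning
    ps = positions 0 S
    PC = poinChain P G
    |ps|≤m : length ps ≤ m
    |ps|≤m = ℕP.≤-trans (length-positions 0 S) (subst (_≤ m) (trans rankTop (sym len)) (ℕP.<⇒≤ (rank<m top)))

  -- A copy of the local helper of uWord in Defs, which cannot be referred to.
  ascents : List ℕ → Word
  ascents []           = []
  ascents (_ ∷ [])     = []
  ascents (l ∷ l′ ∷ r) = (if l ≤ᵇ l′ then 𝐚 else 𝐛) ∷ ascents (l′ ∷ r)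

  uWord-labels : (lab₁ lab₂ : Fin m → Fin m → ℕ) (c₁ c₂ : List (Fin m)) →
    labelsAlong P lab₁ bot c₁ ≡ labelsAlong P lab₂ bot c₂ → uWord P G lab₁ c₁ ≡ uWord P G lab₂ c₂
  uWord-labels lab₁ lab₂ c₁ c₂ eq rewrite eq = refl

  -- For a labelling ignoring its first argument, dropping the first element of c drops the first label,
  -- which makes induction on c possible.
  uWord-target-only : (f : Fin m → ℕ) (c : List (Fin m)) →
    uWord P G (λ _ b → f b) c ≡ 𝐚 ∷ ascents (labelsAlong P (λ _ b → f b) bot c)
  uWord-target-only f []          = refl
  uWord-target-only f (x ∷ [])    = refl
  uWord-target-only f (x ∷ y ∷ c) =
    cong (λ t → 𝐚 ∷ (if f x ≤ᵇ f y then 𝐚 else 𝐛) ∷ t) (ListP.∷-injectiveʳ (uWord-target-only f (y ∷ c)))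

  -- The label of the step into b along y ⋖ M (the steps of a maximal chain have distinct targets).
  labelInto : Fin m → List (Fin m) → Fin m → ℕ
  labelInto y []      b = 0
  labelInto y (x ∷ M) b = if b ≟ᵇ x then lab y x else labelInto x M b

  RankIncreasing : Fin m → List (Fin m) → Set
  RankIncreasing y []      = ⊤
  RankIncreasing y (x ∷ M) = rank y < rank x × RankIncreasing x M

  maxChain⇒RankIncreasing : (y z : Fin m) (M : List (Fin m)) → maxChain y z M ≡ true → RankIncreasing y M
  maxChain⇒RankIncreasing y z []      _  = tt
  maxChain⇒RankIncreasing y z (x ∷ M) eq =
    <⇒rank< (∧-true₁ (∧-true₁ eq)) , maxChain⇒RankIncreasing x z M (∧-true₂ {covᵇ P y x} eq)

  labelsAlong-cong : (g h : Fin m → ℕ) (y : Fin m) (M : List (Fin m)) → RankIncreasing y M →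
    (∀ b → rank y < rank b → g b ≡ h b) → labelsAlong P (λ _ b → g b) y M ≡ labelsAlong P (λ _ b → h b) y M
  labelsAlong-cong g h y []      _          _  = refl
  labelsAlong-cong g h y (x ∷ M) (r< , inc) eq =
    cong₂ _∷_ (eq x r<) (labelsAlong-cong g h x M inc (λ b r<b → eq b (ℕP.<-trans r< r<b)))

  labels-labelInto : (y : Fin m) (M : List (Fin m)) → RankIncreasing y M →
    labelsAlong P (λ _ b → labelInto y M b) y M ≡ labels y M
  labels-labelInto y []      _          = refl
  labels-labelInto y (x ∷ M) (r< , inc) = cong₂ _∷_ (cong (λ t → if t then lab y x else labelInto x M x) (≟ᵇ-refl x))
    (trans (labelsAlong-cong (labelInto y (x ∷ M)) (labelInto x M) x M inc (λ b r<b →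
      cong (λ t → if t then lab y x else labelInto x M b) (≟ᵇ-≢ (λ b≡x → ℕP.<-irrefl (cong rank (sym b≡x)) r<b))))
    (labels-labelInto x M inc))

  uWord≡ascents : (M : List (Fin m)) (z : Fin m) → maxChain bot z M ≡ true → uWord P G lab M ≡ 𝐚 ∷ ascents (labels bot M)
  uWord≡ascents M z eq = trans (uWord-labels lab (λ _ b → labelInto bot M b) M M (sym relabel))
    (trans (uWord-target-only (labelInto bot M) M) (cong (λ L → 𝐚 ∷ ascents L) relabel))
    where
    relabel : labelsAlong P (λ _ b → labelInto bot M b) bot M ≡ labels bot M
    relabel = labels-labelInto bot M (maxChain⇒RankIncreasing bot z M eq)

  uME≡aMask : (M : List (Fin m)) (z : Fin m) → maxChain bot z M ≡ true → (E : List Bool) → length M ≡ length E →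
    uME P G lab M E ≡ map toLetter (aMask 0 false (labels bot M) E)
  uME≡aMask M z eq E len rewrite uWord≡ascents M z eq = first (labels bot M) E (trans (length-labels bot M) len)
    where
    vLetter-𝐚 : (e′ e : Bool) → vLetter P G lab 𝐚 e′ e ≡ toLetter (not e′)
    vLetter-𝐚 true  e = refl
    vLetter-𝐚 false e = refl
    vLetter-𝐛 : (e′ e : Bool) → vLetter P G lab 𝐛 e′ e ≡ toLetter e
    vLetter-𝐛 e′ true  = refl
    vLetter-𝐛 e′ false = refl
    vLetter-isA : (l l′ : ℕ) (e e′ : Bool) → vLetter P G lab (if l ≤ᵇ l′ then 𝐚 else 𝐛) e′ e ≡ toLetter (isA l e l′ e′)
    vLetter-isA l l′ e e′ with l ≤ᵇ l′
    ... | true  = vLetter-𝐚 e′ e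
    ... | false = vLetter-𝐛 e′ e
    rest : (l : ℕ) (e : Bool) (L : List ℕ) (E : List Bool) → length L ≡ length E →
      zip3 P G lab (ascents (l ∷ L)) E (e ∷ E) ≡ map toLetter (aMask l e L E)
    rest l e []       []       _   = refl
    rest l e (l′ ∷ L) (e′ ∷ E) len = cong₂ _∷_ (vLetter-isA l l′ e e′) (rest l′ e′ L E (ℕP.suc-injective len))
    first : (L : List ℕ) (E : List Bool) → length L ≡ length E →
      zip3 P G lab (𝐚 ∷ ascents L) E (false ∷ E) ≡ map toLetter (aMask 0 false L E)
    first []      []      _   = refl
    first (l ∷ L) (e ∷ E) len = cong₂ _∷_ (vLetter-𝐚 e false) (rest l e L E (ℕP.suc-injective len))

  wt≈Σ-rankSet : (c : List (Fin m)) → wt P G c ≈ ΣP (subsets n) (λ S → ifP (rankSet c ==ᴮᴸ S) (wtOf S))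
  wt≈Σ-rankSet c = ≈-trans (≡⇒≈ (cong prodP (ListP.map-∘ (upTo n)))) (mk≈ λ k w → sym (begin
    coeff (ΣP (subsets n) (λ S → ifP (rankSet c ==ᴮᴸ S) (wtOf S))) k w
      ≡⟨ trans (coeff-ΣP (subsets n) _ k w) (Σℤ-cong (subsets n) (λ S → coeff-ifP (rankSet c ==ᴮᴸ S) (wtOf S) k w)) ⟩
    Σℤ (subsets n) (λ S → ⟦ rankSet c ==ᴮᴸ S ⟧ * coeff (wtOf S) k w)
      ≡⟨ cong (λ t → Σℤ (subsets t) (λ S → ⟦ rankSet c ==ᴮᴸ S ⟧ * coeff (wtOf S) k w)) (sym (length-rankSet c)) ⟩
    Σℤ (subsets (length (rankSet c))) (λ S → ⟦ rankSet c ==ᴮᴸ S ⟧ * coeff (wtOf S) k w)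
      ≡⟨ Σℤ-subsets-δ (rankSet c) (λ S → coeff (wtOf S) k w) ⟩
    coeff (wtOf (rankSet c)) k w ∎))
    where open ≡-Reasoning

  -- wt_C depends on C only through its rank set.
  exΨ≈Σ-rankSets : exΨ P G ≈ ΣP (subsets n) (λ S → ΣP (chains P G) (λ c → ifP (rankSet c ==ᴮᴸ S) (poinChain P G c)) ⊗ wtOf S)
  exΨ≈Σ-rankSets = begin
    ΣP (chains P G) (λ c → PC c ⊗ wt P G c)
      ≈⟨ ΣP-cong (chains P G) (λ c → ≈-trans (⊗-congʳ (PC c) (wt≈Σ-rankSet c)) (≈-trans (ΣP-⊗ˡ (PC c) (subsets n) _)
           (ΣP-cong (subsets n) (λ S → ifP-⊗ʳ (rankSet c ==ᴮᴸ S) (PC c) (wtOf S))))) ⟩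
    ΣP (chains P G) (λ c → ΣP (subsets n) (λ S → ifP (rankSet c ==ᴮᴸ S) (PC c ⊗ wtOf S)))
      ≈⟨ ΣP-swap (chains P G) (subsets n) _ ⟩
    ΣP (subsets n) (λ S → ΣP (chains P G) (λ c → ifP (rankSet c ==ᴮᴸ S) (PC c ⊗ wtOf S)))
      ≈⟨ ΣP-cong (subsets n) (λ S → ≈-sym (ΣP-ifP-⊗ʳ (chains P G) (λ c → rankSet c ==ᴮᴸ S) PC (wtOf S))) ⟩
    ΣP (subsets n) (λ S → ΣP (chains P G) (λ c → ifP (rankSet c ==ᴮᴸ S) (PC c)) ⊗ wtOf S) ∎
    where
    open ≈-Reasoning
    PC = poinChain P G

  Σ-wtOf≈u : (M : List (Fin m)) (E : List Bool) → length M ≡ n → length E ≡ n → maxChain bot top M ≡ true →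
    ΣP (subsets n) (λ S → ifP (bsIn S 0 false (labels bot M) E) (y^ countTrue E ⊗ wtOf S)) ≈ (+ 1 , countTrue E , uME P G lab M E) ∷ []
  Σ-wtOf≈u M E lenM lenE eq = begin
    ΣP (subsets n) (λ S → ifP (coveredBy S cs) (y^ countTrue E ⊗ wtOf S))
      ≈⟨ ≈-trans (ΣP-cong (subsets n) (λ S → ≈-sym (ifP-⊗ʳ (coveredBy S cs) (y^ countTrue E) (wtOf S))))
                 (≈-sym (ΣP-⊗ˡ (y^ countTrue E) (subsets n) _)) ⟩
    y^ countTrue E ⊗ ΣP (subsets n) (λ S → ifP (coveredBy S cs) (wtOf S))
      ≈⟨ ⊗-congʳ (y^ countTrue E) (subst (λ t → ΣP (subsets t) (λ S → ifP (coveredBy S cs) (wtOf S)) ≈ prodP (map letterP cs))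
           |cs|≡n (Σ-coveredBy-wtOf cs)) ⟩
    y^ countTrue E ⊗ prodP (map letterP cs)
      ≡⟨ cong (y^ countTrue E ⊗_) (prod-letterP cs) ⟩
    y^ countTrue E ⊗ ((+ 1 , 0 , map toLetter cs) ∷ [])
      ≡⟨ cong (λ t → (+ 1 , t , map toLetter cs) ∷ []) (ℕP.+-identityʳ (countTrue E)) ⟩
    (+ 1 , countTrue E , map toLetter cs) ∷ []
      ≡⟨ cong (λ w → (+ 1 , countTrue E , w) ∷ []) (sym (uME≡aMask M top eq E (trans lenM (sym lenE)))) ⟩
    (+ 1 , countTrue E , uME P G lab M E) ∷ [] ∎
    where
    open ≈-Reasoning
    cs = aMask 0 false (labels bot M) E
    |cs|≡n : length cs ≡ n
    |cs|≡n = trans (length-aMask 0 false (labels bot M) E (trans (length-labels bot M) (trans lenM (sym lenE))))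
                   (trans (length-labels bot M) lenM)
      where
      length-aMask : (l : ℕ) (e : Bool) (L : List ℕ) (E : List Bool) → length L ≡ length E → length (aMask l e L E) ≡ length L
      length-aMask l e []      []      _   = refl
      length-aMask l e (x ∷ L) (f ∷ E) len = cong suc (length-aMask x f L E (ℕP.suc-injective len))

  Σ-chainSum-wtOf≈rhs : ΣP (subsets n) (λ S → chainSum bot top S 0 false ⊗ wtOf S) ≈ rhs P G lab
  Σ-chainSum-wtOf≈rhs = begin
    ΣP (subsets n) (λ S → chainSum bot top S 0 false ⊗ wtOf S)
      ≈⟨ ΣP-lists-cong (true ∷ false ∷ []) n (λ S lenS → ≡⇒≈ (cong (_⊗ wtOf S) (chainSum≡chainSumₖ bot top S 0 false lenS))) ⟩
    ΣP (subsets n) (λ S → ΣP (Chains n) (λ M → ifP (maxChain bot top M) (flagSum bot S n 0 false M)) ⊗ wtOf S)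
      ≈⟨ ΣP-cong (subsets n) (λ S → ≈-trans (ΣP-ifP-⊗ʳ (Chains n) (maxChain bot top) _ (wtOf S))
           (ΣP-cong (Chains n) (λ M → ifP-cong (maxChain bot top M) (λ _ →
             ΣP-ifP-⊗ʳ (subsets n) (λ E → bsIn S 0 false (labels bot M) E) (λ E → y^ countTrue E) (wtOf S))))) ⟩
    ΣP (subsets n) (λ S → ΣP (Chains n) (λ M → ifP (maxChain bot top M)
      (ΣP (subsets n) (λ E → ifP (bsIn S 0 false (labels bot M) E) (y^ countTrue E ⊗ wtOf S)))))
      ≈⟨ ≈-trans (ΣP-swap (subsets n) (Chains n) _) (ΣP-cong (Chains n) (λ M →
           ≈-trans (ΣP-ifP (subsets n) (maxChain bot top M) _) (ifP-cong (maxChain bot top M) (λ _ → ΣP-swap (subsets n) (subsets n) _)))) ⟩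
    ΣP (Chains n) (λ M → ifP (maxChain bot top M) (ΣP (subsets n) (λ E → ΣP (subsets n) (λ S →
      ifP (bsIn S 0 false (labels bot M) E) (y^ countTrue E ⊗ wtOf S)))))
      ≈⟨ ΣP-lists-cong (allFin m) n (λ M lenM → ifP-cong (maxChain bot top M) (λ eq →
           ΣP-lists-cong (true ∷ false ∷ []) n (λ E lenE → Σ-wtOf≈u M E lenM lenE eq))) ⟩
    ΣP (Chains n) (λ M → ifP (maxChain bot top M) (ΣP (subsets n) (λ E → (+ 1 , countTrue E , uME P G lab M E) ∷ [])))
      ≈⟨ ≈-sym (ΣP-filter (maxChain bot top) (Chains n) _) ⟩
    ΣP (maxChains P G) (λ M → ΣP (subsets n) (λ E → (+ 1 , countTrue E , uME P G lab M E) ∷ []))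
      ≡⟨ cong sumP (ListP.map-cong (λ M → sym (map≡ΣP (λ E → (+ 1 , countTrue E , uME P G lab M E)) (subsets n))) (maxChains P G)) ⟩
    rhs P G lab ∎
    where
    open ≈-Reasoning
    map≡ΣP : {A : Set} (g : A → Term) (l : List A) → map g l ≡ ΣP l (λ x → g x ∷ [])
    map≡ΣP g []      = refl
    map≡ΣP g (x ∷ l) = cong (g x ∷_) (map≡ΣP g l)

theorem2p7 : (n : ℕ) (P : FinPoset) (G : IsGraded P n)
             (lab : Fin (FinPoset.m P) → Fin (FinPoset.m P) → ℕ) →
             IsRLabeling P lab →
             exΨ P G ≈P rhs P G lab
theorem2p7 n P G lab R = coeff-≡ (begin
  exΨ P G
    ≈⟨ exΨ≈Σ-rankSets ⟩
  ΣP (subsets n) (λ S → ΣP (chains P G) (λ c → ifP (rankSet c ==ᴮᴸ S) (poinChain P G c)) ⊗ wtOf S)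
    ≈⟨ ΣP-lists-cong (true ∷ false ∷ []) n (λ S lenS → ⊗-congˡ (wtOf S)
         (≈-trans (Σ-chains-rankSet S lenS) (chainsWithRanks≈chainSum 0 S lenS))) ⟩
  ΣP (subsets n) (λ S → chainSum bot top S 0 false ⊗ wtOf S)
    ≈⟨ Σ-chainSum-wtOf≈rhs ⟩
  rhs P G lab ∎)
  where
  open RLabeled P G lab R
  open IsGraded G using (bot; top)
  open ≈-Reasoning
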